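{- Let $m\ge1$ be an integer. Then the power series $(\gamma(t,q)-1)^m/q$ equals the H-fraction $\mathrm{HF}((k_j),(v_j),(u_j))$ with $k_j=m-1$ for all $j\ge0$, $v_0=1$, $v_j=t^m$ for $j\ge1$, and $1+u_j(q)q=\beta(m;t,q)$ for all $j\ge1$.
   Context: Let $t,q$ be indeterminates. The Narayana polynomials are $\gamma_0(t)=1$ and $\gamma_n(t)=\sum_{k=0}^{n-1}\binom{n}{k}\binom{n-1}{k}\frac{1}{k+1}t^k$ for $n\ge1$, and $\gamma(t,q)=\sum_{n\ge0}\gamma_n(t)q^n$; it satisfies $-1+(1-q+tq)\gamma-tq\gamma^2=0$. For $0\le d\le m-1$ let $\rho(m;t,d)=\frac{m}{m-d}\sum_{i=0}^{d}\binom{m-1-d+i}{i}\binom{m-1-i}{d-i}t^i$, let $\rho(m;t,m)=1+t^m$, and $\beta(m;t,q)=\sum_{d=0}^{m}\rho(m;t,d)(-q)^d$. H-fractions: given nonnegative integers $(k_j)_{j\ge0}$, nonzero elements $(v_j)_{j\ge0}$ of $\mathbb{Q}(t)$, and polynomials $u_j(q)\in\mathbb{Q}(t)[q]$ ($j\ge1$) with $\deg u_j\le k_{j-1}$ (the zero polynomial being allowed), $\mathrm{HF}((k_j),(v_j),(u_j))$ denotes the formal power series in $q$ defined by the (q-adically convergent) continued fraction $$\cfrac{v_0q^{k_0}}{1+u_1(q)q-\cfrac{v_1q^{k_0+k_1+2}}{1+u_2(q)q-\cfrac{v_2q^{k_1+k_2+2}}{1+u_3(q)q-\cdots}}}.$$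 -}

module Defs where

open import Data.Nat as ℕ using (ℕ; zero; suc; _∸_; _≤_)
open import Data.Nat.Combinatorics using (_C_)
open import Data.Integer as ℤ using (+_)
open import Data.Rational as ℚ using (ℚ; _/_; 0ℚ; 1ℚ)
open import Data.Product using (∃)
open import Relation.Nullary using (yes; no)
open import Relation.Binary.PropositionalEquality using (_≡_)

record RawR (A : Set) : Set where
  field
    zeroR oneR : A
    addR mulR : A → A → A
    negR : A → A

Series : Set → Set
Series A = ℕ → A

module Ops {A : Set} (R : RawR A) where
  open RawR R

  sumTo : ℕ → (ℕ → A) → A
  sumTo zero f = f zero
  sumTo (suc n) f = addR (sumTo n f) (f (suc n))

  0s : Series A
  0s _ = zeroR

  1s : Series A
  1s zero = oneR
  1s (suc _) = zeroR

  const : A → Series A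
  const c zero = c
  const c (suc _) = zeroR

  _⊕_ : Series A → Series A → Series A
  (f ⊕ g) n = addR (f n) (g n)

  ⊖_ : Series A → Series A
  (⊖ f) n = negR (f n)

  _⊗_ : Series A → Series A → Series A
  (f ⊗ g) n = sumTo n (λ k → mulR (f k) (g (n ∸ k)))

  _^s_ : Series A → ℕ → Series A
  f ^s zero = 1s
  f ^s suc k = f ⊗ (f ^s k)

  shiftBy : ℕ → Series A → Series A
  shiftBy zero f = f
  shiftBy (suc e) f zero = zeroR
  shiftBy (suc e) f (suc n) = shiftBy e f n

  Xs : Series A
  Xs = shiftBy 1 1s

  -- division by X (meaningful when the constant term is zero)
  divX : Series A → Series A
  divX f n = f (suc n)

  -- 1/(1 - Y) = Σ_k Y^k, for Y with zero constant term
  inv1m : Series A → Series A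
  inv1m Y n = sumTo n (λ k → (Y ^s k) n)

-- Coefficient ring: ℚ[[t]] (contains ℚ[t]); series ring ℚ[[t]][[q]].

ℚR : RawR ℚ
ℚR = record { zeroR = 0ℚ ; oneR = 1ℚ ; addR = ℚ._+_ ; mulR = ℚ._*_ ; negR = ℚ.-_ }

TSer : Set
TSer = Series ℚ

module T = Ops ℚR

TR : RawR TSer
TR = record { zeroR = T.0s ; oneR = T.1s ; addR = T._⊕_ ; mulR = T._⊗_ ; negR = T.⊖_ }

QSer : Set
QSer = Series TSer

module Q = Ops TR

_≈T_ : TSer → TSer → Set
f ≈T g = ∀ i → f i ≡ g i

_≈Q_ : QSer → QSer → Set
F ≈Q G = ∀ n → F n ≈T G n

tpow : ℕ → TSer
tpow m = T.shiftBy m T.1s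

qvar : QSer
qvar = Q.Xs

narayana : ℕ → TSer
narayana zero = T.1s
narayana (suc n) k with k ℕ.<? suc n
... | yes _ = (+ ((suc n C k) ℕ.* (n C k))) / suc k
... | no _ = 0ℚ

γ : QSer
γ n = narayana n

-- ρ(m;t,d) for 0 ≤ d ≤ m (value irrelevant/zero for d > m)
ρ : ℕ → ℕ → TSer
ρ m d i with d ℕ.<? m
... | yes _ with i ℕ.≤? d
...   | yes _ = ((+ m) / suc (m ∸ suc d)) ℚ.*
                (+ (((m ∸ 1 ∸ d ℕ.+ i) C i) ℕ.* ((m ∸ 1 ∸ i) C (d ∸ i))) / 1)
...   | no _ = 0ℚ
ρ m d i | no _ with d ℕ.≟ m
...   | yes _ = T._⊕_ T.1s (tpow m) i
...   | no _ = 0ℚ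

sgn : ℕ → ℚ
sgn zero = 1ℚ
sgn (suc d) = ℚ.- sgn d

β : ℕ → QSer
β m d i with d ℕ.≤? m
... | yes _ = sgn d ℚ.* ρ m d i
... | no _ = 0ℚ

-- exponent of q in the j-th numerator: k_0 for j = 0, k_{j-1}+k_j+2 for j ≥ 1
hfExp : (ℕ → ℕ) → ℕ → ℕ
hfExp k zero = k zero
hfExp k (suc j) = k j ℕ.+ k (suc j) ℕ.+ 2

-- hfConv k v u j d : the continued fraction starting at numerator v_j,
-- truncated after d levels (the remaining tail replaced by 0):
--   v_j q^{e_j} / (1 + u_{j+1}(q) q - hfConv (j+1) (d-1))
hfConv : (ℕ → ℕ) → (ℕ → TSer) → (ℕ → QSer) → ℕ → ℕ → QSer
hfConv k v u j zero = Q.0s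
hfConv k v u j (suc d) =
  Q.shiftBy (hfExp k j)
    (Q.const (v j) Q.⊗
      Q.inv1m (hfConv k v u (suc j) d Q.⊕ (Q.⊖ (u (suc j) Q.⊗ qvar))))

-- HF((k_j),(v_j),(u_j)) = F : the convergents converge q-adically to F
-- (every coefficient of q^N is eventually that of F).
-- u j is u_j for j ≥ 1 (u 0 is unused).
HFEq : (ℕ → ℕ) → (ℕ → TSer) → (ℕ → QSer) → QSer → Set
HFEq k v u F = ∀ N → ∃ λ D → ∀ d → D ≤ d → hfConv k v u 0 d N ≈T F N

vSeq : ℕ → ℕ → TSer
vSeq m zero = T.1s
vSeq m (suc _) = tpow m

{-# OPTIONS --safe #-}
-- Write γ = 1 + q z.  The Narayana polynomials satisfy the recurrence
-- (k+3) γ_{k+2} − (2k+3)(1+t) γ_{k+1} + k (1−t)² γ_k = 0, checked coefficientwise from their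
-- factorial expressions; hence z solves a linear differential equation in q.  With
-- s = 1 − (1+t)q, b = tq²z, S = s − 2b and D = s² − 4tq², that equation says 2 D S′ = D′ S, so S²
-- and D solve the same first-order linear equation and agree at q = 0.  Thus S² = D, which is the
-- quadratic equation tq²z² − s z + 1 = 0: a = s − b is the inverse of z, and a, b are the roots of
-- X² − sX + tq².  The coefficients ρ satisfy the Pascal-type identities saying that β(m) obeys
-- β(m+2) = s β(m+1) − tq² β(m), so β(m) = aᵐ + bᵐ.  Therefore 1 − (tᵐq²ᵐzᵐ − u_j q) = β(m) − bᵐ = z⁻ᵐ:
-- every tail of the H-fraction equals tᵐq²ᵐzᵐ, and its top level is q^{m−1} zᵐ = (γ − 1)ᵐ/q.
module Submission where

open import Defs
open import Algebra.Bundles using (CommutativeRing)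
open import Algebra.Structures using (IsCommutativeRing)
import Algebra.Properties.Ring as RingProperties
open import Level using (0ℓ)
open import Data.Nat as ℕ using (ℕ; zero; suc; _∸_; _≤_; _<_; z≤n; s≤s)
import Data.Nat.Properties as ℕP
import Data.Nat.Tactic.RingSolver as NS
open import Data.Nat.Combinatorics using (_C_; nCk+nC[k+1]≡[n+1]C[k+1])
open import Data.Integer as ℤ using (ℤ; +_; -[1+_])
import Data.Integer.Properties as ℤP
open import Data.Integer.Tactic.RingSolver using (solve-∀)
open import Data.Sign as Sign using (Sign)
open import Data.Rational as ℚ using (ℚ; _/_; 0ℚ; 1ℚ)
import Data.Rational.Properties as ℚP
open import Data.Rational.Unnormalised using (mkℚᵘ; *≡*)
import Data.Rational.Unnormalised.Properties as ℚᵘP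
open import Data.Maybe using (Maybe; just; nothing)
open import Data.Product using (_,_)
open import Data.Sum using (inj₁; inj₂)
open import Relation.Nullary using (yes; no)
open import Relation.Binary.PropositionalEquality as ≡ using (_≡_)

-- The operations needed to write a ring expression once and read it both in a concrete ring and
-- as solver syntax.
record RingTerms (T : Set) : Set where
  infixl 6 _⊹_
  infixl 7 _⊛_
  field
    _⊹_ _⊛_ : T → T → T
    ⊟_ : T → T
    κ : ℕ → T

-- Algebra.Solver.Ring with integer coefficients over an arbitrary commutative ring: numerals in an
-- identity are then normalised by computation in ℤ, also when the ring is a ring of power series.
module IntegerCoefficients (R : CommutativeRing 0ℓ 0ℓ) where
  open CommutativeRing R
  open import Algebra.Properties.Semiring.Mult.TCOptimised semiring using (_×_; ×-homo-+; ×1-homo-*)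
  open import Algebra.Properties.Ring ring using (-‿involutive; -0#≈0#; -1*x≈-x)
  open import Algebra.Properties.AbelianGroup +-abelianGroup using (⁻¹-∙-comm)
  open import Algebra.Properties.CommutativeSemigroup +-commutativeSemigroup using (interchange)
  open import Algebra.Properties.CommutativeSemigroup *-commutativeSemigroup using () renaming (interchange to interchange*)
  open import Algebra.Solver.Ring.AlmostCommutativeRing
    using (_-Raw-AlmostCommutative⟶_) renaming (fromCommutativeRing to almostCommutative)
  open import Relation.Binary.Reasoning.Setoid setoid

  fromℕ : ℕ → Carrier
  fromℕ n = n × 1#

  fromℕ-suc : ∀ n → fromℕ (suc n) ≈ 1# + fromℕ n
  fromℕ-suc n = ×-homo-+ 1# 1 n

  fromℕ-+ : ∀ m n → fromℕ (m ℕ.+ n) ≈ fromℕ m + fromℕ n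
  fromℕ-+ = ×-homo-+ 1#

  fromℕ-* : ∀ m n → fromℕ (m ℕ.* n) ≈ fromℕ m * fromℕ n
  fromℕ-* = ×1-homo-*

  fromℤ : ℤ → Carrier
  fromℤ (+ n) = fromℕ n
  fromℤ -[1+ n ] = - fromℕ (suc n)

  fromℤ-⊖ : ∀ m n → fromℤ (m ℤ.⊖ n) ≈ fromℕ m - fromℕ n
  fromℤ-⊖ zero zero = sym (trans (+-congˡ -0#≈0#) (+-identityʳ 0#))
  fromℤ-⊖ (suc m) zero = sym (trans (+-congˡ -0#≈0#) (+-identityʳ _))
  fromℤ-⊖ zero (suc n) = sym (+-identityˡ _)
  fromℤ-⊖ (suc m) (suc n) = begin
    fromℤ (suc m ℤ.⊖ suc n)     ≡⟨ ≡.cong fromℤ (ℤP.[1+m]⊖[1+n]≡m⊖n m n) ⟩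
    fromℤ (m ℤ.⊖ n)             ≈⟨ fromℤ-⊖ m n ⟩
    fromℕ m - fromℕ n           ≈⟨ cancel-1 (fromℕ m) (fromℕ n) ⟨
    (1# + fromℕ m) - (1# + fromℕ n) ≈⟨ +-cong (fromℕ-suc m) (-‿cong (fromℕ-suc n)) ⟨
    fromℕ (suc m) - fromℕ (suc n) ∎
    where
    cancel-1 : ∀ a b → (1# + a) - (1# + b) ≈ a - b
    cancel-1 a b = begin
      (1# + a) + - (1# + b)      ≈⟨ +-congˡ (⁻¹-∙-comm 1# b) ⟨
      (1# + a) + (- 1# + - b)    ≈⟨ interchange 1# a (- 1#) (- b) ⟩
      (1# - 1#) + (a - b)        ≈⟨ +-congʳ (-‿inverseʳ 1#) ⟩
      0# + (a - b)               ≈⟨ +-identityˡ (a - b) ⟩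
      a - b                      ∎

  fromℤ-+ : ∀ i j → fromℤ (i ℤ.+ j) ≈ fromℤ i + fromℤ j
  fromℤ-+ (+ m) (+ n) = fromℕ-+ m n
  fromℤ-+ (+ m) -[1+ n ] = fromℤ-⊖ m (suc n)
  fromℤ-+ -[1+ m ] (+ n) = trans (fromℤ-⊖ n (suc m)) (+-comm _ _)
  fromℤ-+ -[1+ m ] -[1+ n ] = begin
    - fromℕ (suc (suc (m ℕ.+ n)))          ≡⟨ ≡.cong (λ k → - fromℕ (suc k)) (ℕP.+-suc m n) ⟨
    - fromℕ (suc m ℕ.+ suc n)              ≈⟨ -‿cong (fromℕ-+ (suc m) (suc n)) ⟩
    - (fromℕ (suc m) + fromℕ (suc n))      ≈⟨ ⁻¹-∙-comm _ _ ⟨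
    - fromℕ (suc m) + - fromℕ (suc n)      ∎

  fromℤ-neg : ∀ i → fromℤ (ℤ.- i) ≈ - fromℤ i
  fromℤ-neg -[1+ n ] = sym (-‿involutive _)
  fromℤ-neg (+ zero) = sym -0#≈0#
  fromℤ-neg (+ suc n) = refl

  fromSign : Sign → Carrier
  fromSign Sign.+ = 1#
  fromSign Sign.- = - 1#

  fromSign-* : ∀ s s′ → fromSign (s Sign.* s′) ≈ fromSign s * fromSign s′
  fromSign-* Sign.+ s′ = sym (*-identityˡ _)
  fromSign-* Sign.- Sign.+ = sym (*-identityʳ _)
  fromSign-* Sign.- Sign.- = sym (trans (-1*x≈-x (- 1#)) (-‿involutive 1#))

  fromℤ-◃ : ∀ s n → fromℤ (s ℤ.◃ n) ≈ fromSign s * fromℕ n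
  fromℤ-◃ s zero = sym (zeroʳ _)
  fromℤ-◃ Sign.+ (suc n) = sym (*-identityˡ _)
  fromℤ-◃ Sign.- (suc n) = sym (-1*x≈-x _)

  fromℤ-signAbs : ∀ i → fromℤ i ≈ fromSign (ℤ.sign i) * fromℕ ℤ.∣ i ∣
  fromℤ-signAbs i = trans (reflexive (≡.cong fromℤ (≡.sym (ℤP.◃-inverse i)))) (fromℤ-◃ (ℤ.sign i) ℤ.∣ i ∣)

  fromℤ-* : ∀ i j → fromℤ (i ℤ.* j) ≈ fromℤ i * fromℤ j
  fromℤ-* i j = begin
    fromℤ (ℤ.sign i Sign.* ℤ.sign j ℤ.◃ ℤ.∣ i ∣ ℕ.* ℤ.∣ j ∣)
      ≈⟨ fromℤ-◃ (ℤ.sign i Sign.* ℤ.sign j) (ℤ.∣ i ∣ ℕ.* ℤ.∣ j ∣) ⟩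
    fromSign (ℤ.sign i Sign.* ℤ.sign j) * fromℕ (ℤ.∣ i ∣ ℕ.* ℤ.∣ j ∣)
      ≈⟨ *-cong (fromSign-* (ℤ.sign i) (ℤ.sign j)) (fromℕ-* ℤ.∣ i ∣ ℤ.∣ j ∣) ⟩
    (fromSign (ℤ.sign i) * fromSign (ℤ.sign j)) * (fromℕ ℤ.∣ i ∣ * fromℕ ℤ.∣ j ∣)
      ≈⟨ interchange* _ _ _ _ ⟩
    (fromSign (ℤ.sign i) * fromℕ ℤ.∣ i ∣) * (fromSign (ℤ.sign j) * fromℕ ℤ.∣ j ∣)
      ≈⟨ *-cong (fromℤ-signAbs i) (fromℤ-signAbs j) ⟨
    fromℤ i * fromℤ j ∎

  fromℤ-homomorphism : ℤ.+-*-rawRing -Raw-AlmostCommutative⟶ almostCommutative R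
  fromℤ-homomorphism = record
    { ⟦_⟧ = fromℤ ; +-homo = fromℤ-+ ; *-homo = fromℤ-* ; -‿homo = fromℤ-neg
    ; 0-homo = refl ; 1-homo = refl }

  decideCoefficients : ∀ i j → Maybe (fromℤ i ≈ fromℤ j)
  decideCoefficients i j with i ℤ.≟ j
  ... | yes ≡.refl = just refl
  ... | no _ = nothing

  open import Algebra.Solver.Ring ℤ.+-*-rawRing (almostCommutative R) fromℤ-homomorphism decideCoefficients public
    using (Polynomial; solve; _:=_; _:+_; _:*_; :-_; _:-_; con)

  polynomialTerms : ∀ {n} → RingTerms (Polynomial n)
  polynomialTerms = record { _⊹_ = _:+_ ; _⊛_ = _:*_ ; ⊟_ = :-_ ; κ = λ k → con (+ k) }

module PowerSeries {A : Set} (R : RawR A) {_≈ₐ_ : A → A → Set}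
  (isCR : IsCommutativeRing _≈ₐ_ (RawR.addR R) (RawR.mulR R) (RawR.negR R) (RawR.zeroR R) (RawR.oneR R)) where
  open Ops R

  coefficientRing : CommutativeRing 0ℓ 0ℓ
  coefficientRing = record { isCommutativeRing = isCR }

  open CommutativeRing coefficientRing hiding (zero)
  open IntegerCoefficients coefficientRing using (fromℕ; fromℕ-+)
  open RingProperties ring using (-0#≈0#; -‿distribʳ-*)
  open import Algebra.Properties.Group +-group using (x∙y⁻¹≈ε⇒x≈y; x≈y⇒x∙y⁻¹≈ε)
  open import Algebra.Properties.CommutativeSemigroup +-commutativeSemigroup using (interchange)
  open import Algebra.Properties.CommutativeSemigroup *-commutativeSemigroup using (x∙yz≈y∙xz)
  open import Relation.Binary.Reasoning.Setoid setoid

  sumTo-cong≤ : ∀ n {f g : ℕ → A} → (∀ k → k ≤ n → f k ≈ g k) → sumTo n f ≈ sumTo n g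
  sumTo-cong≤ zero fg = fg 0 z≤n
  sumTo-cong≤ (suc n) fg = +-cong (sumTo-cong≤ n (λ k k≤n → fg k (ℕP.m≤n⇒m≤1+n k≤n))) (fg (suc n) ℕP.≤-refl)

  sumTo-cong : ∀ n {f g : ℕ → A} → (∀ k → f k ≈ g k) → sumTo n f ≈ sumTo n g
  sumTo-cong n fg = sumTo-cong≤ n (λ k _ → fg k)

  sumTo-+ : ∀ n (f g : ℕ → A) → sumTo n (λ k → f k + g k) ≈ sumTo n f + sumTo n g
  sumTo-+ zero f g = refl
  sumTo-+ (suc n) f g = trans (+-congʳ (sumTo-+ n f g)) (interchange _ _ _ _)

  *-distribˡ-sumTo : ∀ n c (f : ℕ → A) → c * sumTo n f ≈ sumTo n (λ k → c * f k)
  *-distribˡ-sumTo zero c f = refl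
  *-distribˡ-sumTo (suc n) c f = trans (distribˡ c _ _) (+-congʳ (*-distribˡ-sumTo n c f))

  *-distribʳ-sumTo : ∀ n c (f : ℕ → A) → sumTo n f * c ≈ sumTo n (λ k → f k * c)
  *-distribʳ-sumTo zero c f = refl
  *-distribʳ-sumTo (suc n) c f = trans (distribʳ c _ _) (+-congʳ (*-distribʳ-sumTo n c f))

  sumTo-zero : ∀ n {f : ℕ → A} → (∀ k → k ≤ n → f k ≈ 0#) → sumTo n f ≈ 0#
  sumTo-zero n f≈0 = trans (sumTo-cong≤ n f≈0) (zeros n)
    where
    zeros : ∀ n → sumTo n (λ _ → 0#) ≈ 0#
    zeros zero = refl
    zeros (suc n) = trans (+-congʳ (zeros n)) (+-identityˡ 0#)

  sumTo-suc-first : ∀ n (f : ℕ → A) → sumTo (suc n) f ≈ f 0 + sumTo n (λ k → f (suc k))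
  sumTo-suc-first zero f = refl
  sumTo-suc-first (suc n) f = trans (+-congʳ (sumTo-suc-first n f)) (+-assoc _ _ _)

  sumTo-reverse : ∀ n (f : ℕ → A) → sumTo n f ≈ sumTo n (λ k → f (n ∸ k))
  sumTo-reverse zero f = refl
  sumTo-reverse (suc n) f = sym (begin
    sumTo (suc n) (λ k → f (suc n ∸ k))   ≈⟨ sumTo-suc-first n _ ⟩
    f (suc n) + sumTo n (λ k → f (n ∸ k)) ≈⟨ +-congˡ (sumTo-reverse n f) ⟨
    f (suc n) + sumTo n f                 ≈⟨ +-comm _ _ ⟩
    sumTo n f + f (suc n)                 ∎)

  sumTo-triangle : ∀ n (g : ℕ → ℕ → A) →
    sumTo n (λ k → sumTo (n ∸ k) (g k)) ≈ sumTo n (λ l → sumTo l (λ k → g k (l ∸ k)))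
  sumTo-triangle zero g = refl
  sumTo-triangle (suc n) g = begin
    sumTo n (λ k → sumTo (suc n ∸ k) (g k)) + sumTo (suc n ∸ suc n) (g (suc n))
      ≈⟨ +-cong (sumTo-cong≤ n (λ k k≤n → reflexive (≡.cong (λ x → sumTo x (g k)) (ℕP.+-∸-assoc 1 k≤n))))
                (reflexive (≡.cong (λ x → sumTo x (g (suc n))) (ℕP.n∸n≡0 n))) ⟩
    sumTo n (λ k → sumTo (n ∸ k) (g k) + g k (suc (n ∸ k))) + g (suc n) 0
      ≈⟨ +-congʳ (sumTo-+ n _ _) ⟩
    (sumTo n (λ k → sumTo (n ∸ k) (g k)) + sumTo n (λ k → g k (suc (n ∸ k)))) + g (suc n) 0
      ≈⟨ +-assoc _ _ _ ⟩
    sumTo n (λ k → sumTo (n ∸ k) (g k)) + (sumTo n (λ k → g k (suc (n ∸ k))) + g (suc n) 0)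
      ≈⟨ +-cong (sumTo-triangle n g)
           (+-cong (sumTo-cong≤ n (λ k k≤n → reflexive (≡.cong (g k) (≡.sym (ℕP.+-∸-assoc 1 k≤n)))))
                   (reflexive (≡.cong (g (suc n)) (≡.sym (ℕP.n∸n≡0 n))))) ⟩
    sumTo n (λ l → sumTo l (λ k → g k (l ∸ k))) + sumTo (suc n) (λ k → g k (suc n ∸ k)) ∎

  sumTo-extend : ∀ i N (f : ℕ → A) → i ≤ N → (∀ k → i < k → k ≤ N → f k ≈ 0#) → sumTo N f ≈ sumTo i f
  sumTo-extend .zero zero f z≤n _ = refl
  sumTo-extend i (suc N) f i≤1+N tail≈0 with ℕP.m≤n⇒m<n∨m≡n i≤1+N
  ... | inj₂ ≡.refl = refl
  ... | inj₁ (s≤s i≤N) = begin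
    sumTo N f + f (suc N) ≈⟨ +-cong (sumTo-extend i N f i≤N (λ k i<k k≤N → tail≈0 k i<k (ℕP.m≤n⇒m≤1+n k≤N)))
                                    (tail≈0 (suc N) (s≤s i≤N) ℕP.≤-refl) ⟩
    sumTo i f + 0#        ≈⟨ +-identityʳ _ ⟩
    sumTo i f             ∎

  infix 4 _≈s_
  _≈s_ : Series A → Series A → Set
  f ≈s g = ∀ n → f n ≈ g n

  ⊗-cong : ∀ {f f′ g g′} → f ≈s f′ → g ≈s g′ → (f ⊗ g) ≈s (f′ ⊗ g′)
  ⊗-cong ff′ gg′ n = sumTo-cong n (λ k → *-cong (ff′ k) (gg′ (n ∸ k)))

  ⊗-comm : ∀ f g → (f ⊗ g) ≈s (g ⊗ f)
  ⊗-comm f g n = begin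
    sumTo n (λ k → f k * g (n ∸ k))               ≈⟨ sumTo-reverse n _ ⟩
    sumTo n (λ k → f (n ∸ k) * g (n ∸ (n ∸ k)))
      ≈⟨ sumTo-cong≤ n (λ k k≤n → trans (*-comm _ _) (*-congʳ (reflexive (≡.cong g (ℕP.m∸[m∸n]≡n k≤n))))) ⟩
    sumTo n (λ k → g k * f (n ∸ k))               ∎

  ⊗-assoc : ∀ f g h → ((f ⊗ g) ⊗ h) ≈s (f ⊗ (g ⊗ h))
  ⊗-assoc f g h n = sym (begin
    sumTo n (λ k → f k * sumTo (n ∸ k) (λ j → g j * h (n ∸ k ∸ j)))
      ≈⟨ sumTo-cong n (λ k → *-distribˡ-sumTo (n ∸ k) (f k) _) ⟩
    sumTo n (λ k → sumTo (n ∸ k) (λ j → f k * (g j * h (n ∸ k ∸ j))))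
      ≈⟨ sumTo-triangle n (λ k j → f k * (g j * h (n ∸ k ∸ j))) ⟩
    sumTo n (λ l → sumTo l (λ k → f k * (g (l ∸ k) * h (n ∸ k ∸ (l ∸ k)))))
      ≈⟨ sumTo-cong≤ n (λ l _ → sumTo-cong≤ l (λ k k≤l →
           trans (sym (*-assoc _ _ _)) (*-congˡ (reflexive (≡.cong h (∸-∸-cancel k≤l)))))) ⟩
    sumTo n (λ l → sumTo l (λ k → (f k * g (l ∸ k)) * h (n ∸ l)))
      ≈⟨ sumTo-cong n (λ l → sym (*-distribʳ-sumTo l _ _)) ⟩
    sumTo n (λ l → sumTo l (λ k → f k * g (l ∸ k)) * h (n ∸ l)) ∎)
    where
    ∸-∸-cancel : ∀ {k l} → k ≤ l → n ∸ k ∸ (l ∸ k) ≡ n ∸ l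
    ∸-∸-cancel {k} {l} k≤l = ≡.trans (ℕP.∸-+-assoc n k (l ∸ k)) (≡.cong (n ∸_) (ℕP.m+[n∸m]≡n k≤l))

  ⊗-identityˡ : ∀ f → (1s ⊗ f) ≈s f
  ⊗-identityˡ f zero = *-identityˡ _
  ⊗-identityˡ f (suc n) = begin
    sumTo (suc n) (λ k → 1s k * f (suc n ∸ k))       ≈⟨ sumTo-suc-first n _ ⟩
    1# * f (suc n) + sumTo n (λ k → 0# * f (n ∸ k))  ≈⟨ +-cong (*-identityˡ _) (sumTo-zero n (λ k _ → zeroˡ _)) ⟩
    f (suc n) + 0#                                   ≈⟨ +-identityʳ _ ⟩
    f (suc n)                                        ∎

  ⊗-distribˡ-⊕ : ∀ f g h → (f ⊗ (g ⊕ h)) ≈s ((f ⊗ g) ⊕ (f ⊗ h))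
  ⊗-distribˡ-⊕ f g h n = trans (sumTo-cong n (λ k → distribˡ _ _ _)) (sumTo-+ n _ _)

  ⊕-⊗-isCommutativeRing : IsCommutativeRing _≈s_ _⊕_ _⊗_ ⊖_ 0s 1s
  ⊕-⊗-isCommutativeRing = record
    { isRing = record
      { +-isAbelianGroup = record
        { isGroup = record
          { isMonoid = record
            { isSemigroup = record
              { isMagma = record
                { isEquivalence = record
                  { refl = λ n → refl ; sym = λ e n → sym (e n) ; trans = λ e e′ n → trans (e n) (e′ n) }
                ; ∙-cong = λ e e′ n → +-cong (e n) (e′ n) }
              ; assoc = λ f g h n → +-assoc _ _ _ }
            ; identity = (λ f n → +-identityˡ _) , (λ f n → +-identityʳ _) }
          ; inverse = (λ f n → -‿inverseˡ _) , (λ f n → -‿inverseʳ _)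
          ; ⁻¹-cong = λ e n → -‿cong (e n) }
        ; comm = λ f g n → +-comm _ _ }
      ; *-cong = ⊗-cong
      ; *-assoc = ⊗-assoc
      ; *-identity = ⊗-identityˡ , (λ f n → trans (⊗-comm f 1s n) (⊗-identityˡ f n))
      ; distrib = ⊗-distribˡ-⊕ , (λ f g h n → trans (⊗-comm (g ⊕ h) f n)
           (trans (⊗-distribˡ-⊕ f g h n) (+-cong (⊗-comm f g n) (⊗-comm f h n)))) }
    ; *-comm = ⊗-comm }

  seriesRing : CommutativeRing 0ℓ 0ℓ
  seriesRing = record { isCommutativeRing = ⊕-⊗-isCommutativeRing }

  const-⊗ : ∀ c f → (const c ⊗ f) ≈s (λ n → c * f n)
  const-⊗ c f zero = refl
  const-⊗ c f (suc n) = begin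
    sumTo (suc n) (λ k → const c k * f (suc n ∸ k))   ≈⟨ sumTo-suc-first n _ ⟩
    c * f (suc n) + sumTo n (λ k → 0# * f (n ∸ k))    ≈⟨ +-congˡ (sumTo-zero n (λ k _ → zeroˡ _)) ⟩
    c * f (suc n) + 0#                                ≈⟨ +-identityʳ _ ⟩
    c * f (suc n)                                     ∎

  shiftBy-cong : ∀ e {f g} → f ≈s g → shiftBy e f ≈s shiftBy e g
  shiftBy-cong zero f≈g n = f≈g n
  shiftBy-cong (suc e) f≈g zero = refl
  shiftBy-cong (suc e) f≈g (suc n) = shiftBy-cong e f≈g n

  shiftBy-+ : ∀ a b f → shiftBy (a ℕ.+ b) f ≈s shiftBy a (shiftBy b f)
  shiftBy-+ zero b f n = refl
  shiftBy-+ (suc a) b f zero = refl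
  shiftBy-+ (suc a) b f (suc n) = shiftBy-+ a b f n

  shiftBy-suc : ∀ e f → shiftBy (suc e) f ≈s shiftBy 1 (shiftBy e f)
  shiftBy-suc e = shiftBy-+ 1 e

  shiftBy1-⊗ : ∀ f g → (shiftBy 1 f ⊗ g) ≈s shiftBy 1 (f ⊗ g)
  shiftBy1-⊗ f g zero = zeroˡ _
  shiftBy1-⊗ f g (suc n) = begin
    sumTo (suc n) (λ k → shiftBy 1 f k * g (suc n ∸ k))  ≈⟨ sumTo-suc-first n _ ⟩
    0# * g (suc n) + (f ⊗ g) n                           ≈⟨ +-congʳ (zeroˡ _) ⟩
    0# + (f ⊗ g) n                                       ≈⟨ +-identityˡ _ ⟩
    (f ⊗ g) n                                            ∎

  shiftBy-⊗ : ∀ e f g → (shiftBy e f ⊗ g) ≈s shiftBy e (f ⊗ g)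
  shiftBy-⊗ zero f g n = refl
  shiftBy-⊗ (suc e) f g n = begin
    (shiftBy (suc e) f ⊗ g) n          ≈⟨ ⊗-cong {g = g} (shiftBy-suc e f) (λ _ → refl) n ⟩
    (shiftBy 1 (shiftBy e f) ⊗ g) n    ≈⟨ shiftBy1-⊗ (shiftBy e f) g n ⟩
    shiftBy 1 (shiftBy e f ⊗ g) n      ≈⟨ shiftBy-cong 1 (shiftBy-⊗ e f g) n ⟩
    shiftBy 1 (shiftBy e (f ⊗ g)) n    ≈⟨ shiftBy-suc e (f ⊗ g) n ⟨
    shiftBy (suc e) (f ⊗ g) n          ∎

  Xs-⊗ : ∀ f → (Xs ⊗ f) ≈s shiftBy 1 f
  Xs-⊗ f n = trans (shiftBy1-⊗ 1s f n) (shiftBy-cong 1 (⊗-identityˡ f) n)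

  AgreeUpTo : ℕ → Series A → Series A → Set
  AgreeUpTo n f g = ∀ i → i ≤ n → f i ≈ g i

  ≈s⇒AgreeUpTo : ∀ n {f g} → f ≈s g → AgreeUpTo n f g
  ≈s⇒AgreeUpTo n f≈g i _ = f≈g i

  AgreeUpTo-trans : ∀ {n f g h} → AgreeUpTo n f g → AgreeUpTo n g h → AgreeUpTo n f h
  AgreeUpTo-trans f≈g g≈h i i≤n = trans (f≈g i i≤n) (g≈h i i≤n)

  AgreeUpTo-mono : ∀ {m n f g} → m ≤ n → AgreeUpTo n f g → AgreeUpTo m f g
  AgreeUpTo-mono m≤n f≈g i i≤m = f≈g i (ℕP.≤-trans i≤m m≤n)

  AgreeUpTo-⊕ : ∀ {n f f′ g g′} → AgreeUpTo n f f′ → AgreeUpTo n g g′ → AgreeUpTo n (f ⊕ g) (f′ ⊕ g′)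
  AgreeUpTo-⊕ f≈f′ g≈g′ i i≤n = +-cong (f≈f′ i i≤n) (g≈g′ i i≤n)

  AgreeUpTo-⊗ : ∀ {n f f′ g g′} → AgreeUpTo n f f′ → AgreeUpTo n g g′ → AgreeUpTo n (f ⊗ g) (f′ ⊗ g′)
  AgreeUpTo-⊗ f≈f′ g≈g′ i i≤n = sumTo-cong≤ i (λ k k≤i →
    *-cong (f≈f′ k (ℕP.≤-trans k≤i i≤n)) (g≈g′ (i ∸ k) (ℕP.≤-trans (ℕP.m∸n≤m i k) i≤n)))

  AgreeUpTo-^s : ∀ {n f f′} k → AgreeUpTo n f f′ → AgreeUpTo n (f ^s k) (f′ ^s k)
  AgreeUpTo-^s zero f≈f′ i i≤n = refl
  AgreeUpTo-^s (suc k) f≈f′ = AgreeUpTo-⊗ f≈f′ (AgreeUpTo-^s k f≈f′)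

  AgreeUpTo-inv1m : ∀ {n f f′} → AgreeUpTo n f f′ → AgreeUpTo n (inv1m f) (inv1m f′)
  AgreeUpTo-inv1m f≈f′ i i≤n = sumTo-cong i (λ k → AgreeUpTo-^s k f≈f′ i i≤n)

  AgreeUpTo-shiftBy : ∀ {n f g} e → AgreeUpTo n f g → AgreeUpTo (e ℕ.+ n) (shiftBy e f) (shiftBy e g)
  AgreeUpTo-shiftBy zero f≈g = f≈g
  AgreeUpTo-shiftBy (suc e) f≈g zero _ = refl
  AgreeUpTo-shiftBy (suc e) f≈g (suc i) (s≤s i≤e+n) = AgreeUpTo-shiftBy e f≈g i i≤e+n

  ^s-vanishesBelow : ∀ Y → Y 0 ≈ 0# → ∀ k i → i < k → (Y ^s k) i ≈ 0#
  ^s-vanishesBelow Y Y0≈0 (suc k) i (s≤s i≤k) = sumTo-zero i term≈0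
    where
    term≈0 : ∀ j → j ≤ i → Y j * (Y ^s k) (i ∸ j) ≈ 0#
    term≈0 zero _ = trans (*-congʳ Y0≈0) (zeroˡ _)
    term≈0 (suc j) 1+j≤i = trans (*-congˡ (^s-vanishesBelow Y Y0≈0 k (i ∸ suc j) i∸[1+j]<k)) (zeroʳ _)
      where
      i∸[1+j]<k : i ∸ suc j < k
      i∸[1+j]<k = ℕP.<-≤-trans (ℕP.∸-monoʳ-< (s≤s z≤n) 1+j≤i) i≤k

  private
    module S = CommutativeRing seriesRing
    module SP = RingProperties S.ring
    module SR = IntegerCoefficients seriesRing
  open SR using (_:=_; _:+_; _:-_; :-_; _:*_; con)

  geometricSum : Series A → ℕ → Series A
  geometricSum Y N n = sumTo N (λ k → (Y ^s k) n)

  1-Y⊗geometricSum : ∀ Y N → ((1s ⊕ (⊖ Y)) ⊗ geometricSum Y N) ≈s (1s ⊕ (⊖ (Y ^s suc N)))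
  1-Y⊗geometricSum Y zero = S.trans (S.*-identityʳ _) (S.+-congˡ (S.-‿cong (S.sym (S.*-identityʳ Y))))
  1-Y⊗geometricSum Y (suc N) = S.trans (S.distribˡ (1s ⊕ (⊖ Y)) (geometricSum Y N) Yᴺ⁺¹)
    (S.trans (S.+-cong (1-Y⊗geometricSum Y N) (S.distribʳ Yᴺ⁺¹ 1s (⊖ Y)))
      (SR.solve 2 (λ y w → (con (+ 1) :- w) :+ (con (+ 1) :* w :+ (:- y) :* w) := con (+ 1) :- y :* w) S.refl Y Yᴺ⁺¹))
    where
    Yᴺ⁺¹ = Y ^s suc N

  inv1m-inverse : ∀ Y → Y 0 ≈ 0# → ((1s ⊕ (⊖ Y)) ⊗ inv1m Y) ≈s 1s
  inv1m-inverse Y Y0≈0 N = begin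
    ((1s ⊕ (⊖ Y)) ⊗ inv1m Y) N           ≈⟨ AgreeUpTo-⊗ {f = 1s ⊕ (⊖ Y)} (λ _ _ → refl) inv1m≈geometricSum N ℕP.≤-refl ⟩
    ((1s ⊕ (⊖ Y)) ⊗ geometricSum Y N) N  ≈⟨ 1-Y⊗geometricSum Y N N ⟩
    1s N + - (Y ^s suc N) N            ≈⟨ +-congˡ (-‿cong (^s-vanishesBelow Y Y0≈0 (suc N) N ℕP.≤-refl)) ⟩
    1s N + - 0#                        ≈⟨ +-congˡ -0#≈0# ⟩
    1s N + 0#                          ≈⟨ +-identityʳ _ ⟩
    1s N                               ∎
    where
    inv1m≈geometricSum : AgreeUpTo N (inv1m Y) (geometricSum Y N)
    inv1m≈geometricSum i i≤N = sym (sumTo-extend i N _ i≤N (λ k i<k _ → ^s-vanishesBelow Y Y0≈0 k i i<k))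

  inv1m-unique : ∀ Y X → Y 0 ≈ 0# → ((1s ⊕ (⊖ Y)) ⊗ X) ≈s 1s → X ≈s inv1m Y
  inv1m-unique Y X Y0≈0 [1-Y]X≈1 = S.trans (S.sym (S.*-identityʳ X)) (S.trans (S.*-congˡ (S.sym (inv1m-inverse Y Y0≈0)))
    (S.trans (SR.solve 3 (λ x a i → x :* (a :* i) := (a :* x) :* i) S.refl X (1s ⊕ (⊖ Y)) (inv1m Y))
      (S.trans (S.*-congʳ {inv1m Y} [1-Y]X≈1) (S.*-identityˡ (inv1m Y)))))

  ∂ : Series A → Series A
  ∂ f n = fromℕ (suc n) * f (suc n)

  ∂-cong : ∀ {f g} → f ≈s g → ∂ f ≈s ∂ g
  ∂-cong f≈g n = *-congˡ (f≈g (suc n))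

  ∂-⊕ : ∀ f g → ∂ (f ⊕ g) ≈s (∂ f ⊕ ∂ g)
  ∂-⊕ f g n = distribˡ _ _ _

  ∂-⊖ : ∀ f → ∂ (⊖ f) ≈s (⊖ ∂ f)
  ∂-⊖ f n = sym (-‿distribʳ-* _ _)

  ∂-⊗ : ∀ f g → ∂ (f ⊗ g) ≈s ((∂ f ⊗ g) ⊕ (f ⊗ ∂ g))
  ∂-⊗ f g n = begin
    fromℕ (suc n) * sumTo (suc n) (λ k → f k * g (suc n ∸ k))
      ≈⟨ *-distribˡ-sumTo (suc n) _ _ ⟩
    sumTo (suc n) (λ k → fromℕ (suc n) * (f k * g (suc n ∸ k)))
      ≈⟨ sumTo-cong≤ (suc n) (λ k k≤ → trans (*-congʳ (splitIndex k≤)) (distribʳ _ _ _)) ⟩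
    sumTo (suc n) (λ k → fromℕ k * (f k * g (suc n ∸ k)) + fromℕ (suc n ∸ k) * (f k * g (suc n ∸ k)))
      ≈⟨ sumTo-+ (suc n) _ _ ⟩
    sumTo (suc n) (λ k → fromℕ k * (f k * g (suc n ∸ k))) + sumTo (suc n) (λ k → fromℕ (suc n ∸ k) * (f k * g (suc n ∸ k)))
      ≈⟨ +-cong ∂-left ∂-right ⟩
    ((∂ f ⊗ g) ⊕ (f ⊗ ∂ g)) n ∎
    where
    splitIndex : ∀ {k} → k ≤ suc n → fromℕ (suc n) ≈ fromℕ k + fromℕ (suc n ∸ k)
    splitIndex {k} k≤ = trans (reflexive (≡.cong fromℕ (≡.sym (ℕP.m+[n∸m]≡n k≤)))) (fromℕ-+ k (suc n ∸ k))
    ∂-left : sumTo (suc n) (λ k → fromℕ k * (f k * g (suc n ∸ k))) ≈ (∂ f ⊗ g) n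
    ∂-left = begin
      sumTo (suc n) (λ k → fromℕ k * (f k * g (suc n ∸ k)))      ≈⟨ sumTo-suc-first n _ ⟩
      0# * (f 0 * g (suc n)) + sumTo n (λ k → fromℕ (suc k) * (f (suc k) * g (n ∸ k)))
        ≈⟨ +-cong (zeroˡ _) (sumTo-cong n (λ k → sym (*-assoc _ _ _))) ⟩
      0# + (∂ f ⊗ g) n                                          ≈⟨ +-identityˡ _ ⟩
      (∂ f ⊗ g) n                                               ∎
    ∂-right : sumTo (suc n) (λ k → fromℕ (suc n ∸ k) * (f k * g (suc n ∸ k))) ≈ (f ⊗ ∂ g) n
    ∂-right = begin
      sumTo n (λ k → fromℕ (suc n ∸ k) * (f k * g (suc n ∸ k))) + fromℕ (suc n ∸ suc n) * (f (suc n) * g (suc n ∸ suc n))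
        ≈⟨ +-congˡ (trans (*-congʳ (reflexive (≡.cong fromℕ (ℕP.n∸n≡0 n)))) (zeroˡ _)) ⟩
      sumTo n (λ k → fromℕ (suc n ∸ k) * (f k * g (suc n ∸ k))) + 0#
        ≈⟨ +-identityʳ _ ⟩
      sumTo n (λ k → fromℕ (suc n ∸ k) * (f k * g (suc n ∸ k)))
        ≈⟨ sumTo-cong≤ n (λ k k≤n → trans (reflexive (≡.cong (λ x → fromℕ x * (f k * g x)) (ℕP.+-∸-assoc 1 k≤n)))
                                          (x∙yz≈y∙xz _ _ _)) ⟩
      (f ⊗ ∂ g) n ∎

  leadingCoefficient : ∀ {P E} n → AgreeUpTo n E 0s → (P ⊗ ∂ E) n ≈ P 0 * ∂ E n
  leadingCoefficient zero _ = refl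
  leadingCoefficient {P} {E} (suc m) E≈0 = begin
    (P ⊗ ∂ E) (suc m)                                            ≈⟨ sumTo-suc-first m _ ⟩
    P 0 * ∂ E (suc m) + sumTo m (λ k → P (suc k) * ∂ E (m ∸ k))  ≈⟨ +-congˡ (sumTo-zero m (λ k _ → higher≈0 k)) ⟩
    P 0 * ∂ E (suc m) + 0#                                       ≈⟨ +-identityʳ _ ⟩
    P 0 * ∂ E (suc m)                                            ∎
    where
    higher≈0 : ∀ k → P (suc k) * ∂ E (m ∸ k) ≈ 0#
    higher≈0 k = trans (*-congˡ (trans (*-congˡ (E≈0 (suc (m ∸ k)) (s≤s (ℕP.m∸n≤m m k)))) (zeroʳ _))) (zeroʳ _)

  module LinearODE (fromℕ-suc-cancel : ∀ n x → fromℕ (suc n) * x ≈ 0# → x ≈ 0#) where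

    solution-vanishes : ∀ {P P′ E} → P 0 ≈ 1# → (P ⊗ ∂ E) ≈s (P′ ⊗ E) → E 0 ≈ 0# → ∀ n → AgreeUpTo n E 0s
    solution-vanishes P0≈1 ode E0≈0 zero .zero z≤n = E0≈0
    solution-vanishes {P} {P′} {E} P0≈1 ode E0≈0 (suc n) i i≤1+n with ℕP.m≤n⇒m<n∨m≡n i≤1+n
    ... | inj₁ (s≤s i≤n) = solution-vanishes {P} {P′} {E} P0≈1 ode E0≈0 n i i≤n
    ... | inj₂ ≡.refl = fromℕ-suc-cancel n (E (suc n)) (begin
      ∂ E n                ≈⟨ *-identityˡ _ ⟨
      1# * ∂ E n           ≈⟨ *-congʳ P0≈1 ⟨
      P 0 * ∂ E n          ≈⟨ leadingCoefficient n E≈0 ⟨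
      (P ⊗ ∂ E) n          ≈⟨ ode n ⟩
      (P′ ⊗ E) n           ≈⟨ sumTo-zero n (λ k k≤n → trans (*-congˡ (E≈0 (n ∸ k) (ℕP.m∸n≤m n k))) (zeroʳ _)) ⟩
      0#                   ∎)
      where
      E≈0 : AgreeUpTo n E 0s
      E≈0 = solution-vanishes {P} {P′} {E} P0≈1 ode E0≈0 n

    solution-unique : ∀ {P P′ W V} → P 0 ≈ 1# → (P ⊗ ∂ W) ≈s (P′ ⊗ W) → (P ⊗ ∂ V) ≈s (P′ ⊗ V) →
                      W 0 ≈ V 0 → W ≈s V
    solution-unique {P} {P′} {W} {V} P0≈1 odeW odeV W0≈V0 n =
      x∙y⁻¹≈ε⇒x≈y (W n) (V n) (solution-vanishes {P} {P′} {W ⊕ (⊖ V)} P0≈1 odeW-V (x≈y⇒x∙y⁻¹≈ε W0≈V0) n n ℕP.≤-refl)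
      where
      odeW-V : (P ⊗ ∂ (W ⊕ (⊖ V))) ≈s (P′ ⊗ (W ⊕ (⊖ V)))
      odeW-V = S.trans (S.*-congˡ (S.trans (∂-⊕ W (⊖ V)) (S.+-congˡ (∂-⊖ V))))
        (S.trans (SR.solve 3 (λ p w v → p :* (w :- v) := p :* w :- p :* v) S.refl P (∂ W) (∂ V))
          (S.trans (S.+-cong odeW (S.-‿cong odeV))
            (SR.solve 3 (λ p w v → p :* w :- p :* v := p :* (w :- v)) S.refl P′ W V)))

module InverseFactorials where

  module ℚ-Solver = IntegerCoefficients ℚP.+-*-commutativeRing
  open ℚ-Solver public using ()
    renaming (fromℕ to ιℚ; fromℕ-suc to ιℚ-suc; fromℕ-+ to ιℚ-+; fromℕ-* to ιℚ-*; fromℤ to ιℤ; fromℤ-+ to ιℤ-+; fromℤ-neg to ιℤ-neg)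
  open ℚ-Solver using (solve; _:=_; _:+_; _:-_; :-_; _:*_; con; polynomialTerms)
  open ≡.≡-Reasoning
  open import Data.Rational using (_+_; _*_; -_)

  ιℚ≡/1 : ∀ n → ιℚ n ≡ (+ n) / 1
  ιℚ≡/1 zero = ≡.refl
  ιℚ≡/1 (suc zero) = ≡.refl
  ιℚ≡/1 (suc (suc n)) = ≡.trans (≡.cong (ℚ._+ 1ℚ) (ιℚ≡/1 (suc n))) (ℚP.toℚᵘ-injective
    (ℚᵘP.≃-trans (ℚP.toℚᵘ-homo-+ ((+ suc n) / 1) 1ℚ)
    (ℚᵘP.≃-trans (ℚᵘP.+-cong (ℚP.toℚᵘ-fromℚᵘ (mkℚᵘ (+ suc n) 0)) (ℚP.toℚᵘ-fromℚᵘ (mkℚᵘ (+ 1) 0)))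
    (ℚᵘP.≃-trans (*≡* (≡.cong (λ x → + suc x) (≡.trans (ℕP.*-identityʳ _) (ℕP.+-comm (n ℕ.* 1) 1))))
      (ℚᵘP.≃-sym (ℚP.toℚᵘ-fromℚᵘ (mkℚᵘ (+ suc (suc n)) 0)))))))

  /-*-ιℚ : ∀ (a d : ℕ) .{{_ : ℕ.NonZero d}} → ((+ a) / d) ℚ.* ιℚ d ≡ ιℚ a
  /-*-ιℚ a (suc d) = ≡.trans (≡.cong ((+ a / suc d) ℚ.*_) (ιℚ≡/1 (suc d))) (≡.trans (ℚP.toℚᵘ-injective
    (ℚᵘP.≃-trans (ℚP.toℚᵘ-homo-* ((+ a) / suc d) ((+ suc d) / 1))
    (ℚᵘP.≃-trans (ℚᵘP.*-cong (ℚP.toℚᵘ-fromℚᵘ (mkℚᵘ (+ a) d)) (ℚP.toℚᵘ-fromℚᵘ (mkℚᵘ (+ suc d) 0)))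
    (ℚᵘP.≃-trans (*≡* (≡.trans (ℤP.*-identityʳ _) (≡.cong (λ x → (+ a) ℤ.* (+ x)) (≡.sym (ℕP.*-identityʳ (suc d))))))
      (ℚᵘP.≃-sym (ℚP.toℚᵘ-fromℚᵘ (mkℚᵘ (+ a) 0))))))) (≡.sym (ιℚ≡/1 a)))

  *-cancelʳ-invertible : ∀ {a b c} d → c ℚ.* d ≡ 1ℚ → a ℚ.* c ≡ b ℚ.* c → a ≡ b
  *-cancelʳ-invertible {a} {b} {c} d cd≡1 ac≡bc = begin
    a                    ≡⟨ ℚP.*-identityʳ a ⟨
    a ℚ.* 1ℚ             ≡⟨ ≡.cong (a ℚ.*_) cd≡1 ⟨
    a ℚ.* (c ℚ.* d)      ≡⟨ ℚP.*-assoc a c d ⟨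
    a ℚ.* c ℚ.* d        ≡⟨ ≡.cong (ℚ._* d) ac≡bc ⟩
    b ℚ.* c ℚ.* d        ≡⟨ ℚP.*-assoc b c d ⟩
    b ℚ.* (c ℚ.* d)      ≡⟨ ≡.cong (b ℚ.*_) cd≡1 ⟩
    b ℚ.* 1ℚ             ≡⟨ ℚP.*-identityʳ b ⟩
    b                    ∎

  ιℚ-suc-cancel : ∀ k {a b} → a ℚ.* ιℚ (suc k) ≡ b ℚ.* ιℚ (suc k) → a ≡ b
  ιℚ-suc-cancel k = *-cancelʳ-invertible ((+ 1) / suc k) (≡.trans (ℚP.*-comm (ιℚ (suc k)) _) (/-*-ιℚ 1 (suc k)))

  -- 1/x! for x ≥ 0 and 0 for x < 0, so that C(n,k) = n! invFact k invFact (n − k) for all k.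
  invFact : ℤ → ℚ
  invFact (+ n) = ((+ 1) / (n ℕ.!)) {{n ℕP.!≢0}}
  invFact -[1+ n ] = 0ℚ

  invFact-*-fact : ∀ n → invFact (+ n) ℚ.* ιℚ (n ℕ.!) ≡ 1ℚ
  invFact-*-fact n = /-*-ιℚ 1 (n ℕ.!) {{n ℕP.!≢0}}

  invFact-pred : ∀ y → invFact (y ℤ.- + 1) ≡ ιℤ y ℚ.* invFact y
  invFact-pred (+ zero) = ≡.sym (ℚP.*-zeroˡ (invFact (+ 0)))
  invFact-pred (+ suc n) = *-cancelʳ-invertible (invFact (+ n)) (≡.trans (ℚP.*-comm (ιℚ (n ℕ.!)) (invFact (+ n))) (invFact-*-fact n))
    (begin
      invFact (+ n) ℚ.* ιℚ (n ℕ.!)                         ≡⟨ invFact-*-fact n ⟩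
      1ℚ                                                    ≡⟨ invFact-*-fact (suc n) ⟨
      invFact (+ suc n) ℚ.* ιℚ (suc n ℕ.!)                  ≡⟨ ≡.cong (invFact (+ suc n) ℚ.*_) (ιℚ-* (suc n) (n ℕ.!)) ⟩
      invFact (+ suc n) ℚ.* (ιℚ (suc n) ℚ.* ιℚ (n ℕ.!))     ≡⟨ solve 3 (λ r s f → r :* (s :* f) := s :* r :* f) ≡.refl (invFact (+ suc n)) (ιℚ (suc n)) (ιℚ (n ℕ.!)) ⟩
      ιℚ (suc n) ℚ.* invFact (+ suc n) ℚ.* ιℚ (n ℕ.!)       ∎)
  invFact-pred -[1+ n ] = ≡.sym (ℚP.*-zeroʳ (ιℤ -[1+ n ]))

  invFact-pred′ : ∀ y z → y ≡ z ℤ.- + 1 → invFact y ≡ ιℤ z ℚ.* invFact z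
  invFact-pred′ y z ≡.refl = invFact-pred z

  invFact-suc : ∀ n → invFact (+ n) ≡ ιℚ (suc n) ℚ.* invFact (+ suc n)
  invFact-suc n = invFact-pred (+ suc n)

  invFact-neg : ∀ {n k} → n ℕ.< k → invFact (+ n ℤ.- + k) ≡ 0ℚ
  invFact-neg {n} {suc k} (s≤s n≤k) = ≡.cong invFact (begin
    + n ℤ.- + suc k     ≡⟨ ℤP.m-n≡m⊖n n (suc k) ⟩
    n ℤ.⊖ suc k         ≡⟨ ℤP.⊖-< (s≤s n≤k) ⟩
    ℤ.- (+ (suc k ∸ n)) ≡⟨ ≡.cong (λ j → ℤ.- (+ j)) (ℕP.+-∸-assoc 1 n≤k) ⟩
    -[1+ k ∸ n ]        ∎)

  choose≡factorials : ∀ n k → ιℚ (n C k) ≡ ιℚ (n ℕ.!) * (invFact (+ k) * invFact (+ n ℤ.- + k))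
  choose≡factorials zero zero = ≡.refl
  choose≡factorials zero (suc k) = ≡.sym (≡.trans (≡.cong (1ℚ *_) (ℚP.*-zeroʳ (invFact (+ suc k)))) (ℚP.*-zeroʳ 1ℚ))
  choose≡factorials (suc n) zero = ≡.sym (begin
    ιℚ (suc n ℕ.!) * (1ℚ * invFact (+ suc n ℤ.- + 0))
      ≡⟨ ≡.cong (ιℚ (suc n ℕ.!) *_) (≡.trans (ℚP.*-identityˡ _) (≡.cong (λ j → invFact (+ j)) (ℕP.+-identityʳ (suc n)))) ⟩
    ιℚ (suc n ℕ.!) * invFact (+ suc n)                  ≡⟨ ℚP.*-comm (ιℚ (suc n ℕ.!)) (invFact (+ suc n)) ⟩
    invFact (+ suc n) * ιℚ (suc n ℕ.!)                  ≡⟨ invFact-*-fact (suc n) ⟩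
    1ℚ                                                  ∎)
  choose≡factorials (suc n) (suc k) = begin
    ιℚ (suc n C suc k)                         ≡⟨ ≡.cong ιℚ (nCk+nC[k+1]≡[n+1]C[k+1] n k) ⟨
    ιℚ (n C k ℕ.+ n C suc k)                   ≡⟨ ιℚ-+ (n C k) (n C suc k) ⟩
    ιℚ (n C k) + ιℚ (n C suc k)                ≡⟨ ≡.cong₂ _+_ (choose≡factorials n k) (choose≡factorials n (suc k)) ⟩
    F * (invFact (+ k) * B) + F * (A * invFact (+ n ℤ.- + suc k))
      ≡⟨ ≡.cong₂ (λ u v → F * (u * B) + F * (A * v)) (invFact-suc k) (invFact-pred′ (+ n ℤ.- + suc k) (+ n ℤ.- + k) n-[1+k]≡n-k-1) ⟩
    F * (X * A * B) + F * (A * (Y * B))        ≡⟨ solve 5 (λ F A B X Y → F :* (X :* A :* B) :+ F :* (A :* (Y :* B)) := (X :+ Y) :* F :* (A :* B)) ≡.refl F A B X Y ⟩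
    (X + Y) * F * (A * B)                      ≡⟨ ≡.cong (λ u → u * F * (A * B)) X+Y≡1+n ⟩
    ιℚ (suc n) * F * (A * B)                   ≡⟨ ≡.cong (_* (A * B)) (ιℚ-* (suc n) (n ℕ.!)) ⟨
    ιℚ (suc n ℕ.!) * (A * B)                   ≡⟨ ≡.cong (λ y → ιℚ (suc n ℕ.!) * (A * invFact y)) n-k≡[1+n]-[1+k] ⟩
    ιℚ (suc n ℕ.!) * (A * invFact (+ suc n ℤ.- + suc k)) ∎
    where
    F = ιℚ (n ℕ.!)
    A = invFact (+ suc k)
    B = invFact (+ n ℤ.- + k)
    X = ιℚ (suc k)
    Y = ιℤ (+ n ℤ.- + k)
    n-[1+k]≡n-k-1 : + n ℤ.- + suc k ≡ (+ n ℤ.- + k) ℤ.- + 1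
    n-[1+k]≡n-k-1 = lemma (+ n) (+ k)
      where
      lemma : ∀ a b → a ℤ.- (+ 1 ℤ.+ b) ≡ a ℤ.- b ℤ.- + 1
      lemma = solve-∀
    X+Y≡1+n : X + Y ≡ ιℚ (suc n)
    X+Y≡1+n = ≡.trans (≡.sym (ιℤ-+ (+ suc k) (+ n ℤ.- + k)))
      (≡.cong ιℤ (lemma (+ n) (+ k)))
      where
      lemma : ∀ a b → (+ 1 ℤ.+ b) ℤ.+ (a ℤ.- b) ≡ + 1 ℤ.+ a
      lemma = solve-∀
    n-k≡[1+n]-[1+k] : + n ℤ.- + k ≡ + suc n ℤ.- + suc k
    n-k≡[1+n]-[1+k] = lemma (+ n) (+ k)
      where
      lemma : ∀ a b → a ℤ.- b ≡ (+ 1 ℤ.+ a) ℤ.- (+ 1 ℤ.+ b)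
      lemma = solve-∀

  extendℤ : (ℕ → ℚ) → ℤ → ℚ
  extendℤ f (+ k) = f k
  extendℤ f -[1+ _ ] = 0ℚ

  narayanaℤ : ℕ → ℤ → ℚ
  narayanaℤ n = extendℤ (narayana (suc n))

  narayanaℤ≡factorials : ∀ n x → narayanaℤ n x ≡
    ιℚ (suc n ℕ.!) * ιℚ (n ℕ.!) * (invFact x * invFact (+ 1 ℤ.+ x) * invFact (+ suc n ℤ.- x) * invFact (+ n ℤ.- x))
  narayanaℤ≡factorials n -[1+ j ] = ≡.sym (begin
    F * (0ℚ * invFact (+ 1 ℤ.+ -[1+ j ]) * invFact (+ suc n ℤ.- -[1+ j ]) * invFact (+ n ℤ.- -[1+ j ]))
      ≡⟨ ≡.cong (F *_) (solve 3 (λ a b c → con (+ 0) :* a :* b :* c := con (+ 0)) ≡.refl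
                                (invFact (+ 1 ℤ.+ -[1+ j ])) (invFact (+ suc n ℤ.- -[1+ j ])) (invFact (+ n ℤ.- -[1+ j ]))) ⟩
    F * 0ℚ ≡⟨ ℚP.*-zeroʳ F ⟩
    0ℚ ∎)
    where F = ιℚ (suc n ℕ.!) * ιℚ (n ℕ.!)
  narayanaℤ≡factorials n (+ k) with k ℕ.<? suc n
  ... | no k≮1+n = ≡.sym (≡.trans (≡.cong (λ u → F * (R * u)) (invFact-neg (ℕP.≮⇒≥ k≮1+n)))
                          (solve 2 (λ f r → f :* (r :* con (+ 0)) := con (+ 0)) ≡.refl F R))
    where
    F = ιℚ (suc n ℕ.!) * ιℚ (n ℕ.!)
    R = invFact (+ k) * invFact (+ 1 ℤ.+ + k) * invFact (+ suc n ℤ.- + k)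
  ... | yes _ = ιℚ-suc-cancel k (begin
    (+ ((suc n C k) ℕ.* (n C k))) / suc k * ιℚ (suc k) ≡⟨ /-*-ιℚ ((suc n C k) ℕ.* (n C k)) (suc k) ⟩
    ιℚ ((suc n C k) ℕ.* (n C k))                       ≡⟨ ιℚ-* (suc n C k) (n C k) ⟩
    ιℚ (suc n C k) * ιℚ (n C k)                    ≡⟨ ≡.cong₂ _*_ (choose≡factorials (suc n) k) (choose≡factorials n k) ⟩
    F₁ * (Rk * B₁) * (F₀ * (Rk * B₀))               ≡⟨ ≡.cong (λ u → F₁ * (u * B₁) * (F₀ * (Rk * B₀))) (invFact-suc k) ⟩
    F₁ * (c * Rk₁ * B₁) * (F₀ * (Rk * B₀))
      ≡⟨ solve 7 (λ F₁ F₀ Rk Rk₁ B₁ B₀ c → F₁ :* (c :* Rk₁ :* B₁) :* (F₀ :* (Rk :* B₀)) := F₁ :* F₀ :* (Rk :* Rk₁ :* B₁ :* B₀) :* c)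
           ≡.refl F₁ F₀ Rk Rk₁ B₁ B₀ c ⟩
    F₁ * F₀ * (Rk * Rk₁ * B₁ * B₀) * c             ∎)
    where
    F₁ = ιℚ (suc n ℕ.!)
    F₀ = ιℚ (n ℕ.!)
    Rk = invFact (+ k)
    Rk₁ = invFact (+ suc k)
    B₁ = invFact (+ suc n ℤ.- + k)
    B₀ = invFact (+ n ℤ.- + k)
    c = ιℚ (suc k)

  module NarayanaCombination {T : Set} (ops : RingTerms T) where
    open RingTerms ops

    -- The coefficient of tˣ in (k+3) γ_{k+2} − (2k+3)(1+t) γ_{k+1} + k (1−t)² γ_k with k = N + 1:
    -- zᵢ is the coefficient of tˣ in γ_{k+i−1}, and primes shift x down by one.
    combination : (N z₃ z₂ z₂′ z₁ z₁′ z₁″ : T) → T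
    combination N z₃ z₂ z₂′ z₁ z₁′ z₁″ =
      (κ 4 ⊹ N) ⊛ z₃ ⊹ ⊟ ((κ 5 ⊹ (N ⊹ N)) ⊛ (z₂ ⊹ z₂′)) ⊹ (κ 1 ⊹ N) ⊛ (z₁ ⊹ ⊟ (κ 2 ⊛ z₁′) ⊹ z₁″)

    inFactorials : (N f₄ f₃ f₂ f₁ a b c d e₂ e₁ r₁ r₂ : T) → T
    inFactorials N f₄ f₃ f₂ f₁ a b c d e₂ e₁ r₁ r₂ = combination N
      (f₄ ⊛ f₃ ⊛ (a ⊛ b ⊛ c ⊛ d)) (f₃ ⊛ f₂ ⊛ (a ⊛ b ⊛ d ⊛ e₂)) (f₃ ⊛ f₂ ⊛ (r₁ ⊛ a ⊛ c ⊛ d))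
      (f₂ ⊛ f₁ ⊛ (a ⊛ b ⊛ e₂ ⊛ e₁)) (f₂ ⊛ f₁ ⊛ (r₁ ⊛ a ⊛ d ⊛ e₂)) (f₂ ⊛ f₁ ⊛ (r₂ ⊛ r₁ ⊛ c ⊛ d))

    -- All factorials expressed through g = N!, b = 1/(x+1)! and c = 1/(N+3−x)!.
    inBase : (N X g b c : T) → T
    inBase N X g b c = inFactorials N (N₃ ⊛ f₃) f₃ f₂ g a b c d e₂ e₁ r₁ ((X ⊹ ⊟ κ 1) ⊛ r₁)
      where
      N₁ = N ⊹ κ 1
      N₂ = N₁ ⊹ κ 1
      N₃ = N₂ ⊹ κ 1
      f₂ = N₁ ⊛ g
      f₃ = N₂ ⊛ f₂
      a = (κ 1 ⊹ X) ⊛ b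
      d = (N₃ ⊹ ⊟ X) ⊛ c
      e₂ = (N₂ ⊹ ⊟ X) ⊛ d
      e₁ = (N₁ ⊹ ⊟ X) ⊛ e₂
      r₁ = X ⊛ a

  ℚ-terms : RingTerms ℚ
  ℚ-terms = record { _⊹_ = _+_ ; _⊛_ = _*_ ; ⊟_ = -_ ; κ = ιℚ }

  open NarayanaCombination ℚ-terms public using () renaming (combination to narayanaCombination)
  private module Combinationℚ = NarayanaCombination ℚ-terms

  narayanaℤ≡factorials′ : ∀ n x {y₁ y₂ y₃} → + 1 ℤ.+ x ≡ y₁ → + suc n ℤ.- x ≡ y₂ → + n ℤ.- x ≡ y₃ →
    narayanaℤ n x ≡ ιℚ (suc n ℕ.!) * ιℚ (n ℕ.!) * (invFact x * invFact y₁ * invFact y₂ * invFact y₃)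
  narayanaℤ≡factorials′ n x ≡.refl ≡.refl ≡.refl = narayanaℤ≡factorials n x

  narayanaℤ-recurrence : ∀ p x → narayanaCombination (ιℚ (suc p))
    (narayanaℤ (3 ℕ.+ p) x) (narayanaℤ (2 ℕ.+ p) x) (narayanaℤ (2 ℕ.+ p) (x ℤ.- + 1))
    (narayanaℤ (1 ℕ.+ p) x) (narayanaℤ (1 ℕ.+ p) (x ℤ.- + 1)) (narayanaℤ (1 ℕ.+ p) (x ℤ.- + 2)) ≡ 0ℚ
  narayanaℤ-recurrence p x = begin
    narayanaCombination N (narayanaℤ (3 ℕ.+ p) x) (narayanaℤ (2 ℕ.+ p) x) (narayanaℤ (2 ℕ.+ p) (x ℤ.- + 1))
      (narayanaℤ (1 ℕ.+ p) x) (narayanaℤ (1 ℕ.+ p) (x ℤ.- + 1)) (narayanaℤ (1 ℕ.+ p) (x ℤ.- + 2))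
      ≡⟨ combination-cong (narayanaℤ≡factorials (3 ℕ.+ p) x) (narayanaℤ≡factorials (2 ℕ.+ p) x)
           (narayanaℤ≡factorials′ (2 ℕ.+ p) (x ℤ.- + 1) 1+[x-1]≡x (shift (+ 3) (+ 1)) (shift (+ 2) (+ 1)))
           (narayanaℤ≡factorials (1 ℕ.+ p) x)
           (narayanaℤ≡factorials′ (1 ℕ.+ p) (x ℤ.- + 1) 1+[x-1]≡x (shift (+ 2) (+ 1)) (shift (+ 1) (+ 1)))
           (narayanaℤ≡factorials′ (1 ℕ.+ p) (x ℤ.- + 2) 1+[x-2]≡x-1 (shift (+ 2) (+ 2)) (shift (+ 1) (+ 2))) ⟩
    Combinationℚ.inFactorials N (ιℚ ((4 ℕ.+ p) ℕ.!)) (ιℚ ((3 ℕ.+ p) ℕ.!)) (ιℚ ((2 ℕ.+ p) ℕ.!)) g a b c d e₂ e₁ r₁ r₂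
      ≡⟨ inFactorials-cong f₄≡ f₃≡ f₂≡ a≡ d≡ e₂≡ e₁≡ r₁≡ r₂≡ ⟩
    Combinationℚ.inBase N X g b c
      ≡⟨ solve 5 (λ N X g b c → Poly.inBase N X g b c := con (+ 0)) ≡.refl N X g b c ⟩
    0ℚ ∎
    where
    module Poly = NarayanaCombination (polynomialTerms {5})
    N = ιℚ (suc p)
    X = ιℤ x
    g = ιℚ ((1 ℕ.+ p) ℕ.!)
    a = invFact x
    b = invFact (+ 1 ℤ.+ x)
    c = invFact (+ (4 ℕ.+ p) ℤ.- x)
    d = invFact (+ (3 ℕ.+ p) ℤ.- x)
    e₂ = invFact (+ (2 ℕ.+ p) ℤ.- x)
    e₁ = invFact (+ (1 ℕ.+ p) ℤ.- x)
    r₁ = invFact (x ℤ.- + 1)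
    r₂ = invFact (x ℤ.- + 2)

    1+[x-1]≡x : + 1 ℤ.+ (x ℤ.- + 1) ≡ x
    1+[x-1]≡x = lemma x
      where
      lemma : ∀ y → + 1 ℤ.+ (y ℤ.- + 1) ≡ y
      lemma = solve-∀
    1+[x-2]≡x-1 : + 1 ℤ.+ (x ℤ.- + 2) ≡ x ℤ.- + 1
    1+[x-2]≡x-1 = lemma x
      where
      lemma : ∀ y → + 1 ℤ.+ (y ℤ.- + 2) ≡ y ℤ.- + 1
      lemma = solve-∀
    shift : ∀ k j → (k ℤ.+ + p) ℤ.- (x ℤ.- j) ≡ ((k ℤ.+ j) ℤ.+ + p) ℤ.- x
    shift k j = lemma k j (+ p) x
      where
      lemma : ∀ k j q y → (k ℤ.+ q) ℤ.- (y ℤ.- j) ≡ ((k ℤ.+ j) ℤ.+ q) ℤ.- y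
      lemma = solve-∀
    pred : ∀ k → (k ℤ.+ + p) ℤ.- x ≡ ((k ℤ.+ + 1) ℤ.+ + p) ℤ.- x ℤ.- + 1
    pred k = lemma k (+ p) x
      where
      lemma : ∀ k q y → (k ℤ.+ q) ℤ.- y ≡ ((k ℤ.+ + 1) ℤ.+ q) ℤ.- y ℤ.- + 1
      lemma = solve-∀
    ιℤ-[m-x] : ∀ m → ιℤ (+ m ℤ.- x) ≡ ιℚ m + - X
    ιℤ-[m-x] m = ≡.trans (ιℤ-+ (+ m) (ℤ.- x)) (≡.cong (λ y → ιℚ m + y) (ιℤ-neg x))

    f₂≡ : ιℚ ((2 ℕ.+ p) ℕ.!) ≡ ιℚ (2 ℕ.+ p) * g
    f₂≡ = ιℚ-* (2 ℕ.+ p) ((1 ℕ.+ p) ℕ.!)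
    f₃≡ : ιℚ ((3 ℕ.+ p) ℕ.!) ≡ ιℚ (3 ℕ.+ p) * (ιℚ (2 ℕ.+ p) * g)
    f₃≡ = ≡.trans (ιℚ-* (3 ℕ.+ p) ((2 ℕ.+ p) ℕ.!)) (≡.cong (ιℚ (3 ℕ.+ p) *_) f₂≡)
    f₄≡ : ιℚ ((4 ℕ.+ p) ℕ.!) ≡ ιℚ (4 ℕ.+ p) * (ιℚ (3 ℕ.+ p) * (ιℚ (2 ℕ.+ p) * g))
    f₄≡ = ≡.trans (ιℚ-* (4 ℕ.+ p) ((3 ℕ.+ p) ℕ.!)) (≡.cong (ιℚ (4 ℕ.+ p) *_) f₃≡)
    a≡ : a ≡ (ιℚ 1 + X) * b
    a≡ = ≡.trans (invFact-pred′ x (+ 1 ℤ.+ x) (≡.sym 1+[x-1]≡x′)) (≡.cong (_* b) (ιℤ-+ (+ 1) x))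
      where
      1+[x-1]≡x′ : (+ 1 ℤ.+ x) ℤ.- + 1 ≡ x
      1+[x-1]≡x′ = lemma x
        where
        lemma : ∀ y → (+ 1 ℤ.+ y) ℤ.- + 1 ≡ y
        lemma = solve-∀
    d≡ : d ≡ (ιℚ (4 ℕ.+ p) + - X) * c
    d≡ = ≡.trans (invFact-pred′ (+ (3 ℕ.+ p) ℤ.- x) (+ (4 ℕ.+ p) ℤ.- x) (pred (+ 3))) (≡.cong (_* c) (ιℤ-[m-x] (4 ℕ.+ p)))
    e₂≡ : e₂ ≡ (ιℚ (3 ℕ.+ p) + - X) * ((ιℚ (4 ℕ.+ p) + - X) * c)
    e₂≡ = ≡.trans (invFact-pred′ (+ (2 ℕ.+ p) ℤ.- x) (+ (3 ℕ.+ p) ℤ.- x) (pred (+ 2))) (≡.cong₂ _*_ (ιℤ-[m-x] (3 ℕ.+ p)) d≡)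
    e₁≡ : e₁ ≡ (ιℚ (2 ℕ.+ p) + - X) * ((ιℚ (3 ℕ.+ p) + - X) * ((ιℚ (4 ℕ.+ p) + - X) * c))
    e₁≡ = ≡.trans (invFact-pred′ (+ (1 ℕ.+ p) ℤ.- x) (+ (2 ℕ.+ p) ℤ.- x) (pred (+ 1))) (≡.cong₂ _*_ (ιℤ-[m-x] (2 ℕ.+ p)) e₂≡)
    r₁≡ : r₁ ≡ X * ((ιℚ 1 + X) * b)
    r₁≡ = ≡.trans (invFact-pred x) (≡.cong (X *_) a≡)
    r₂≡ : r₂ ≡ (X + - ιℚ 1) * (X * ((ιℚ 1 + X) * b))
    r₂≡ = ≡.trans (invFact-pred′ (x ℤ.- + 2) (x ℤ.- + 1) x-2≡x-1-1) (≡.cong₂ _*_ (ιℤ-+ x (ℤ.- + 1)) r₁≡)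
      where
      x-2≡x-1-1 : x ℤ.- + 2 ≡ (x ℤ.- + 1) ℤ.- + 1
      x-2≡x-1-1 = lemma x
        where
        lemma : ∀ y → y ℤ.- + 2 ≡ (y ℤ.- + 1) ℤ.- + 1
        lemma = solve-∀

    combination-cong : ∀ {z₃ z₂ z₂′ z₁ z₁′ z₁″ w₃ w₂ w₂′ w₁ w₁′ w₁″} →
      z₃ ≡ w₃ → z₂ ≡ w₂ → z₂′ ≡ w₂′ → z₁ ≡ w₁ → z₁′ ≡ w₁′ → z₁″ ≡ w₁″ →
      narayanaCombination N z₃ z₂ z₂′ z₁ z₁′ z₁″ ≡ narayanaCombination N w₃ w₂ w₂′ w₁ w₁′ w₁″
    combination-cong ≡.refl ≡.refl ≡.refl ≡.refl ≡.refl ≡.refl = ≡.refl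

    inFactorials-cong : ∀ {f₄ f₃ f₂ a d e₂ e₁ r₁ r₂ f₄′ f₃′ f₂′ a′ d′ e₂′ e₁′ r₁′ r₂′} →
      f₄ ≡ f₄′ → f₃ ≡ f₃′ → f₂ ≡ f₂′ → a ≡ a′ → d ≡ d′ → e₂ ≡ e₂′ → e₁ ≡ e₁′ → r₁ ≡ r₁′ → r₂ ≡ r₂′ →
      Combinationℚ.inFactorials N f₄ f₃ f₂ g a b c d e₂ e₁ r₁ r₂ ≡ Combinationℚ.inFactorials N f₄′ f₃′ f₂′ g a′ b c d′ e₂′ e₁′ r₁′ r₂′
    inFactorials-cong ≡.refl ≡.refl ≡.refl ≡.refl ≡.refl ≡.refl ≡.refl ≡.refl ≡.refl = ≡.refl

open InverseFactorials

module TP = PowerSeries ℚR ℚP.+-*-isCommutativeRing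
module QP = PowerSeries TR TP.⊕-⊗-isCommutativeRing

ℚ[[t]] ℚ[[t]][[q]] : CommutativeRing 0ℓ 0ℓ
ℚ[[t]] = TP.seriesRing
ℚ[[t]][[q]] = QP.seriesRing

module ℚ[[t]]-Solver = IntegerCoefficients ℚ[[t]]
module ℚ[[t]][[q]]-Solver = IntegerCoefficients ℚ[[t]][[q]]

ιT : ℕ → TSer
ιT = ℚ[[t]]-Solver.fromℕ

ιT≈const : ∀ k → ιT k ≈T T.const (ιℚ k)
ιT≈const zero zero = ≡.refl
ιT≈const zero (suc i) = ≡.refl
ιT≈const (suc zero) zero = ≡.refl
ιT≈const (suc zero) (suc i) = ≡.refl
ιT≈const (suc (suc k)) zero = ≡.cong (ℚ._+ 1ℚ) (ιT≈const (suc k) zero)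
ιT≈const (suc (suc k)) (suc i) = ≡.cong (ℚ._+ 0ℚ) (ιT≈const (suc k) (suc i))

⊗-by-const : ∀ {c a} → c ≈T T.const a → ∀ Y i → (c T.⊗ Y) i ≡ a ℚ.* Y i
⊗-by-const {c} {a} c≈a Y i = ≡.trans (TP.⊗-cong {g = Y} c≈a (λ _ → ≡.refl) i) (TP.const-⊗ a Y i)

≈const-⊕ : ∀ {c d a b} → c ≈T T.const a → d ≈T T.const b → (c T.⊕ d) ≈T T.const (a ℚ.+ b)
≈const-⊕ c≈a d≈b zero = ≡.cong₂ ℚ._+_ (c≈a 0) (d≈b 0)
≈const-⊕ c≈a d≈b (suc i) = ≡.cong₂ ℚ._+_ (c≈a (suc i)) (d≈b (suc i))

t : TSer
t = tpow 1

t⊗-extendℤ : ∀ Y i → (t T.⊗ Y) i ≡ extendℤ Y (+ i ℤ.- + 1)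
t⊗-extendℤ Y zero = TP.Xs-⊗ Y 0
t⊗-extendℤ Y (suc i) = TP.Xs-⊗ Y (suc i)

t²⊗-extendℤ : ∀ Y i → (t T.⊗ (t T.⊗ Y)) i ≡ extendℤ Y (+ i ℤ.- + 2)
t²⊗-extendℤ Y zero = TP.Xs-⊗ (t T.⊗ Y) 0
t²⊗-extendℤ Y (suc zero) = ≡.trans (TP.Xs-⊗ (t T.⊗ Y) 1) (TP.Xs-⊗ Y 0)
t²⊗-extendℤ Y (suc (suc i)) = ≡.trans (TP.Xs-⊗ (t T.⊗ Y) (suc (suc i))) (TP.Xs-⊗ Y (suc i))

ℚ[[t]]-terms : RingTerms TSer
ℚ[[t]]-terms = record { _⊹_ = T._⊕_ ; _⊛_ = T._⊗_ ; ⊟_ = T.⊖_ ; κ = ιT }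

module Combinationᵗ = NarayanaCombination ℚ[[t]]-terms

combination-coefficient : ∀ n y₃ y₂ y₂′ y₁ y₁′ y₁″ i →
  Combinationᵗ.combination (ιT n) y₃ y₂ y₂′ y₁ y₁′ y₁″ i ≡
  narayanaCombination (ιℚ n) (y₃ i) (y₂ i) (y₂′ i) (y₁ i) (y₁′ i) (y₁″ i)
combination-coefficient n y₃ y₂ y₂′ y₁ y₁′ y₁″ i =
  ≡.cong₂ ℚ._+_
    (≡.cong₂ ℚ._+_ (⊗-by-const (≈const-⊕ (ιT≈const 4) N≈) y₃ i)
                   (≡.cong ℚ.-_ (⊗-by-const (≈const-⊕ (ιT≈const 5) (≈const-⊕ N≈ N≈)) (y₂ T.⊕ y₂′) i)))
    (≡.trans (⊗-by-const (≈const-⊕ (ιT≈const 1) N≈) ((y₁ T.⊕ (T.⊖ (ιT 2 T.⊗ y₁′))) T.⊕ y₁″) i)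
             (≡.cong (λ u → (ιℚ 1 ℚ.+ ιℚ n) ℚ.* (y₁ i ℚ.+ ℚ.- u ℚ.+ y₁″ i)) (⊗-by-const (ιT≈const 2) y₁′ i)))
  where
  N≈ : ιT n ≈T T.const (ιℚ n)
  N≈ = ιT≈const n

z : QSer
z n = narayana (suc n)

narayana-polynomial-recurrence : ∀ p → Combinationᵗ.combination (ιT (suc p))
  (z (3 ℕ.+ p)) (z (2 ℕ.+ p)) (t T.⊗ z (2 ℕ.+ p)) (z (1 ℕ.+ p)) (t T.⊗ z (1 ℕ.+ p)) (t T.⊗ (t T.⊗ z (1 ℕ.+ p))) ≈T T.0s
narayana-polynomial-recurrence p i = begin
  Combinationᵗ.combination (ιT (suc p)) (z (3 ℕ.+ p)) (z (2 ℕ.+ p)) (t T.⊗ z (2 ℕ.+ p))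
    (z (1 ℕ.+ p)) (t T.⊗ z (1 ℕ.+ p)) (t T.⊗ (t T.⊗ z (1 ℕ.+ p))) i
    ≡⟨ combination-coefficient (suc p) (z (3 ℕ.+ p)) (z (2 ℕ.+ p)) (t T.⊗ z (2 ℕ.+ p))
         (z (1 ℕ.+ p)) (t T.⊗ z (1 ℕ.+ p)) (t T.⊗ (t T.⊗ z (1 ℕ.+ p))) i ⟩
  narayanaCombination (ιℚ (suc p)) (z (3 ℕ.+ p) i) (z (2 ℕ.+ p) i) ((t T.⊗ z (2 ℕ.+ p)) i)
    (z (1 ℕ.+ p) i) ((t T.⊗ z (1 ℕ.+ p)) i) ((t T.⊗ (t T.⊗ z (1 ℕ.+ p))) i)
    ≡⟨ ≡.cong₂ (λ u v → narayanaCombination (ιℚ (suc p)) (z (3 ℕ.+ p) i) (z (2 ℕ.+ p) i) u (z (1 ℕ.+ p) i) v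
                          ((t T.⊗ (t T.⊗ z (1 ℕ.+ p))) i))
               (t⊗-extendℤ (z (2 ℕ.+ p)) i) (t⊗-extendℤ (z (1 ℕ.+ p)) i) ⟩
  narayanaCombination (ιℚ (suc p)) (z (3 ℕ.+ p) i) (z (2 ℕ.+ p) i) (narayanaℤ (2 ℕ.+ p) (+ i ℤ.- + 1))
    (z (1 ℕ.+ p) i) (narayanaℤ (1 ℕ.+ p) (+ i ℤ.- + 1)) ((t T.⊗ (t T.⊗ z (1 ℕ.+ p))) i)
    ≡⟨ ≡.cong (narayanaCombination (ιℚ (suc p)) (z (3 ℕ.+ p) i) (z (2 ℕ.+ p) i) (narayanaℤ (2 ℕ.+ p) (+ i ℤ.- + 1))
                (z (1 ℕ.+ p) i) (narayanaℤ (1 ℕ.+ p) (+ i ℤ.- + 1)))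
              (t²⊗-extendℤ (z (1 ℕ.+ p)) i) ⟩
  narayanaCombination (ιℚ (suc p)) (narayanaℤ (3 ℕ.+ p) (+ i)) (narayanaℤ (2 ℕ.+ p) (+ i)) (narayanaℤ (2 ℕ.+ p) (+ i ℤ.- + 1))
    (narayanaℤ (1 ℕ.+ p) (+ i)) (narayanaℤ (1 ℕ.+ p) (+ i ℤ.- + 1)) (narayanaℤ (1 ℕ.+ p) (+ i ℤ.- + 2))
    ≡⟨ narayanaℤ-recurrence p (+ i) ⟩
  0ℚ ∎
  where open ≡.≡-Reasoning

module TRing = CommutativeRing ℚ[[t]]
module QRing = CommutativeRing ℚ[[t]][[q]]

q : QSer
q = qvar

t̂ : QSer
t̂ = Q.const t

ιQ : ℕ → QSer
ιQ = ℚ[[t]][[q]]-Solver.fromℕ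

q⊗-coefficient : ∀ X n → (q Q.⊗ X) (suc n) ≈T X n
q⊗-coefficient X n = QP.Xs-⊗ X (suc n)

q-Horner : ∀ A B n → (A Q.⊕ (q Q.⊗ B)) (suc n) ≈T (A (suc n) T.⊕ B n)
q-Horner A B n i = ≡.cong (A (suc n) i ℚ.+_) (q⊗-coefficient B n i)

q-Horner₀ : ∀ A B → (A Q.⊕ (q Q.⊗ B)) 0 ≈T A 0
q-Horner₀ A B i = ≡.trans (≡.cong (A 0 i ℚ.+_) (QP.Xs-⊗ B 0 i)) (ℚP.+-identityʳ (A 0 i))

t-Horner : ∀ A B i → (A T.⊕ (t T.⊗ B)) (suc i) ≡ A (suc i) ℚ.+ B i
t-Horner A B i = ≡.cong (A (suc i) ℚ.+_) (TP.Xs-⊗ B (suc i))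

t-Horner₀ : ∀ A B → (A T.⊕ (t T.⊗ B)) 0 ≡ A 0
t-Horner₀ A B = ≡.trans (≡.cong (A 0 ℚ.+_) (TP.Xs-⊗ B 0)) (ℚP.+-identityʳ (A 0))

linear : TSer → QSer → TSer → QSer → QSer
linear c X c′ Y = (Q.const c Q.⊗ X) Q.⊕ (Q.const c′ Q.⊗ Y)

linear-coefficient : ∀ c X c′ Y n → linear c X c′ Y n ≈T ((c T.⊗ X n) T.⊕ (c′ T.⊗ Y n))
linear-coefficient c X c′ Y n = TRing.+-cong (QP.const-⊗ c X n) (QP.const-⊗ c′ Y n)

horner : QSer → QSer → QSer → QSer → QSer
horner A₀ A₁ A₂ A₃ = A₀ Q.⊕ (q Q.⊗ (A₁ Q.⊕ (q Q.⊗ (A₂ Q.⊕ (q Q.⊗ A₃)))))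

module _ (A₀ A₁ A₂ A₃ : QSer) where
  private
    R₂ R₁ : QSer
    R₂ = A₂ Q.⊕ (q Q.⊗ A₃)
    R₁ = A₁ Q.⊕ (q Q.⊗ R₂)

  horner-coefficient₀ : horner A₀ A₁ A₂ A₃ 0 ≈T A₀ 0
  horner-coefficient₀ = q-Horner₀ A₀ R₁

  horner-coefficient₁ : horner A₀ A₁ A₂ A₃ 1 ≈T (A₀ 1 T.⊕ A₁ 0)
  horner-coefficient₁ i = ≡.trans (q-Horner A₀ R₁ 0 i) (≡.cong (A₀ 1 i ℚ.+_) (q-Horner₀ A₁ R₂ i))

  horner-coefficient₂ : horner A₀ A₁ A₂ A₃ 2 ≈T (A₀ 2 T.⊕ (A₁ 1 T.⊕ A₂ 0))
  horner-coefficient₂ i = ≡.trans (q-Horner A₀ R₁ 1 i)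
    (≡.cong (A₀ 2 i ℚ.+_) (≡.trans (q-Horner A₁ R₂ 0 i) (≡.cong (A₁ 1 i ℚ.+_) (q-Horner₀ A₂ A₃ i))))

  horner-coefficient₃₊ : ∀ p → horner A₀ A₁ A₂ A₃ (3 ℕ.+ p) ≈T
                               (A₀ (3 ℕ.+ p) T.⊕ (A₁ (2 ℕ.+ p) T.⊕ (A₂ (1 ℕ.+ p) T.⊕ A₃ p)))
  horner-coefficient₃₊ p i = ≡.trans (q-Horner A₀ R₁ (2 ℕ.+ p) i)
    (≡.cong (A₀ (3 ℕ.+ p) i ℚ.+_) (≡.trans (q-Horner A₁ R₂ (1 ℕ.+ p) i)
      (≡.cong (A₁ (2 ℕ.+ p) i ℚ.+_) (q-Horner A₂ A₃ p i))))

1+t 1-t : TSer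
1+t = T.1s T.⊕ t
1-t = T.1s T.⊕ (T.⊖ t)

-- q D z′ = 2 − 2z + 3(1+t)qz − (1−t)²q²z, where D = 1 − 2(1+t)q + (1−t)²q² = s² − 4tq²,
-- in powers of q with coefficients constant in q.
ode₀ ode₁ ode₂ ode₃ : QSer
ode₀ = Q.const (ιT 2) Q.⊕ (Q.const (T.⊖ ιT 2) Q.⊗ z)
ode₁ = linear (ιT 3 T.⊗ 1+t) z (T.⊖ T.1s) (QP.∂ z)
ode₂ = linear (T.⊖ (1-t T.⊗ 1-t)) z (ιT 2 T.⊗ 1+t) (QP.∂ z)
ode₃ = Q.const (T.⊖ (1-t T.⊗ 1-t)) Q.⊗ QP.∂ z

narayanaODEᴴ : QSer
narayanaODEᴴ = horner ode₀ ode₁ ode₂ ode₃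

module ODECoefficient (p : ℕ) where
  open ℚ[[t]]-Solver using (solve; _:=_; _:+_; _:-_; :-_; _:*_; con; polynomialTerms)
  module Poly = NarayanaCombination (polynomialTerms {5})

  z₃ z₂ z₁ : TSer
  z₃ = z (3 ℕ.+ p)
  z₂ = z (2 ℕ.+ p)
  z₁ = z (1 ℕ.+ p)

  coefficient≈ : narayanaODEᴴ (3 ℕ.+ p) ≈T
    ((T.0s T.⊕ ((T.⊖ ιT 2) T.⊗ z₃)) T.⊕
     ((((ιT 3 T.⊗ 1+t) T.⊗ z₂) T.⊕ ((T.⊖ T.1s) T.⊗ (ιT (3 ℕ.+ p) T.⊗ z₃))) T.⊕
      ((((T.⊖ (1-t T.⊗ 1-t)) T.⊗ z₁) T.⊕ ((ιT 2 T.⊗ 1+t) T.⊗ (ιT (2 ℕ.+ p) T.⊗ z₂))) T.⊕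
       ((T.⊖ (1-t T.⊗ 1-t)) T.⊗ (ιT (1 ℕ.+ p) T.⊗ z₁)))))
  coefficient≈ i = ≡.trans (horner-coefficient₃₊ ode₀ ode₁ ode₂ ode₃ p i)
    (≡.cong₂ ℚ._+_ (≡.cong (0ℚ ℚ.+_) (QP.const-⊗ (T.⊖ ιT 2) z (3 ℕ.+ p) i))
      (≡.cong₂ ℚ._+_ (linear-coefficient (ιT 3 T.⊗ 1+t) z (T.⊖ T.1s) (QP.∂ z) (2 ℕ.+ p) i)
        (≡.cong₂ ℚ._+_ (linear-coefficient (T.⊖ (1-t T.⊗ 1-t)) z (ιT 2 T.⊗ 1+t) (QP.∂ z) (1 ℕ.+ p) i)
          (QP.const-⊗ (T.⊖ (1-t T.⊗ 1-t)) (QP.∂ z) p i))))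

  vanishes : narayanaODEᴴ (3 ℕ.+ p) ≈T T.0s
  vanishes = TRing.trans coefficient≈ (TRing.trans
    (solve 5 (λ t N z₃ z₂ z₁ →
      (con (+ 0) :+ (:- con (+ 2)) :* z₃) :+
      ((con (+ 3) :* (con (+ 1) :+ t) :* z₂ :+ (:- con (+ 1)) :* ((N :+ con (+ 1) :+ con (+ 1)) :* z₃)) :+
       ((:- ((con (+ 1) :- t) :* (con (+ 1) :- t))) :* z₁ :+ con (+ 2) :* (con (+ 1) :+ t) :* ((N :+ con (+ 1)) :* z₂) :+
        (:- ((con (+ 1) :- t) :* (con (+ 1) :- t))) :* (N :* z₁)))
      := :- Poly.combination N z₃ z₂ (t :* z₂) z₁ (t :* z₁) (t :* (t :* z₁)))
      TRing.refl t (ιT (suc p)) z₃ z₂ z₁)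
    (TRing.trans (TRing.-‿cong (narayana-polynomial-recurrence p)) (RingProperties.-0#≈0# TRing.ring)))

module InitialODECoefficients where
  open ℚ[[t]]-Solver using (solve; _:=_; _:+_; _:-_; :-_; _:*_; con)
  open ≡.≡-Reasoning

  z₀≈ : z 0 ≈T T.1s
  z₀≈ zero = ≡.refl
  z₀≈ (suc i) = ≡.refl

  z₁≈ : z 1 ≈T (T.1s T.⊕ t)
  z₁≈ zero = ≡.refl
  z₁≈ (suc zero) = ≡.refl
  z₁≈ (suc (suc i)) = ≡.refl

  z₂≈ : z 2 ≈T (T.1s T.⊕ (t T.⊗ (ιT 3 T.⊕ t)))
  z₂≈ zero = ≡.sym (t-Horner₀ T.1s (ιT 3 T.⊕ t))
  z₂≈ (suc zero) = ≡.sym (t-Horner T.1s (ιT 3 T.⊕ t) 0)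
  z₂≈ (suc (suc zero)) = ≡.sym (t-Horner T.1s (ιT 3 T.⊕ t) 1)
  z₂≈ (suc (suc (suc i))) = ≡.sym (t-Horner T.1s (ιT 3 T.⊕ t) (suc (suc i)))

  scale : ∀ c {X Y} → X ≈T Y → (c T.⊗ X) ≈T (c T.⊗ Y)
  scale c X≈Y = TP.⊗-cong {c} {c} (λ _ → ≡.refl) X≈Y

  vanishes₀ : narayanaODEᴴ 0 ≈T T.0s
  vanishes₀ i = begin
    narayanaODEᴴ 0 i
      ≡⟨ horner-coefficient₀ ode₀ ode₁ ode₂ ode₃ i ⟩
    ιT 2 i ℚ.+ (Q.const (T.⊖ ιT 2) Q.⊗ z) 0 i
      ≡⟨ ≡.cong (ιT 2 i ℚ.+_) (≡.trans (QP.const-⊗ (T.⊖ ιT 2) z 0 i) (scale (T.⊖ ιT 2) z₀≈ i)) ⟩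
    (ιT 2 T.⊕ ((T.⊖ ιT 2) T.⊗ T.1s)) i
      ≡⟨ solve 0 (con (+ 2) :+ (:- con (+ 2)) :* con (+ 1) := con (+ 0)) TRing.refl i ⟩
    0ℚ ∎

  vanishes₁ : narayanaODEᴴ 1 ≈T T.0s
  vanishes₁ i = begin
    narayanaODEᴴ 1 i
      ≡⟨ horner-coefficient₁ ode₀ ode₁ ode₂ ode₃ i ⟩
    ode₀ 1 i ℚ.+ ode₁ 0 i
      ≡⟨ ≡.cong₂ ℚ._+_ (≡.cong (0ℚ ℚ.+_) (≡.trans (QP.const-⊗ (T.⊖ ιT 2) z 1 i) (scale (T.⊖ ιT 2) z₁≈ i)))
                      (≡.trans (linear-coefficient (ιT 3 T.⊗ 1+t) z (T.⊖ T.1s) (QP.∂ z) 0 i)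
                        (≡.cong₂ ℚ._+_ (scale (ιT 3 T.⊗ 1+t) z₀≈ i) (scale (T.⊖ T.1s) (scale (ιT 1) z₁≈) i))) ⟩
    ((T.0s T.⊕ ((T.⊖ ιT 2) T.⊗ (T.1s T.⊕ t))) T.⊕
     (((ιT 3 T.⊗ 1+t) T.⊗ T.1s) T.⊕ ((T.⊖ T.1s) T.⊗ (ιT 1 T.⊗ (T.1s T.⊕ t))))) i
      ≡⟨ solve 1 (λ t → (con (+ 0) :+ (:- con (+ 2)) :* (con (+ 1) :+ t)) :+
                         (con (+ 3) :* (con (+ 1) :+ t) :* con (+ 1) :+ (:- con (+ 1)) :* (con (+ 1) :* (con (+ 1) :+ t)))
                         := con (+ 0)) TRing.refl t i ⟩
    0ℚ ∎

  vanishes₂ : narayanaODEᴴ 2 ≈T T.0s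
  vanishes₂ i = begin
    narayanaODEᴴ 2 i
      ≡⟨ horner-coefficient₂ ode₀ ode₁ ode₂ ode₃ i ⟩
    ode₀ 2 i ℚ.+ (ode₁ 1 i ℚ.+ ode₂ 0 i)
      ≡⟨ ≡.cong₂ ℚ._+_ (≡.cong (0ℚ ℚ.+_) (≡.trans (QP.const-⊗ (T.⊖ ιT 2) z 2 i) (scale (T.⊖ ιT 2) z₂≈ i)))
           (≡.cong₂ ℚ._+_
             (≡.trans (linear-coefficient (ιT 3 T.⊗ 1+t) z (T.⊖ T.1s) (QP.∂ z) 1 i)
               (≡.cong₂ ℚ._+_ (scale (ιT 3 T.⊗ 1+t) z₁≈ i) (scale (T.⊖ T.1s) (scale (ιT 2) z₂≈) i)))
             (≡.trans (linear-coefficient (T.⊖ (1-t T.⊗ 1-t)) z (ιT 2 T.⊗ 1+t) (QP.∂ z) 0 i)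
               (≡.cong₂ ℚ._+_ (scale (T.⊖ (1-t T.⊗ 1-t)) z₀≈ i) (scale (ιT 2 T.⊗ 1+t) (scale (ιT 1) z₁≈) i)))) ⟩
    ((T.0s T.⊕ ((T.⊖ ιT 2) T.⊗ Z₂)) T.⊕
     ((((ιT 3 T.⊗ 1+t) T.⊗ (T.1s T.⊕ t)) T.⊕ ((T.⊖ T.1s) T.⊗ (ιT 2 T.⊗ Z₂))) T.⊕
      (((T.⊖ (1-t T.⊗ 1-t)) T.⊗ T.1s) T.⊕ ((ιT 2 T.⊗ 1+t) T.⊗ (ιT 1 T.⊗ (T.1s T.⊕ t)))))) i
      ≡⟨ solve 1 (λ t → let z₂ = con (+ 1) :+ t :* (con (+ 3) :+ t) in
           (con (+ 0) :+ (:- con (+ 2)) :* z₂) :+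
           ((con (+ 3) :* (con (+ 1) :+ t) :* (con (+ 1) :+ t) :+ (:- con (+ 1)) :* (con (+ 2) :* z₂)) :+
            ((:- ((con (+ 1) :- t) :* (con (+ 1) :- t))) :* con (+ 1) :+
             con (+ 2) :* (con (+ 1) :+ t) :* (con (+ 1) :* (con (+ 1) :+ t))))
           := con (+ 0)) TRing.refl t i ⟩
    0ℚ ∎
    where
    Z₂ = T.1s T.⊕ (t T.⊗ (ιT 3 T.⊕ t))

narayanaODEᴴ≈0 : narayanaODEᴴ ≈Q Q.0s
narayanaODEᴴ≈0 0 = InitialODECoefficients.vanishes₀
narayanaODEᴴ≈0 1 = InitialODECoefficients.vanishes₁
narayanaODEᴴ≈0 2 = InitialODECoefficients.vanishes₂
narayanaODEᴴ≈0 (suc (suc (suc p))) = ODECoefficient.vanishes p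

ℚ[[t]][[q]]-terms : RingTerms QSer
ℚ[[t]][[q]]-terms = record { _⊹_ = Q._⊕_ ; _⊛_ = Q._⊗_ ; ⊟_ = Q.⊖_ ; κ = ιQ }

module QuadraticShapes {T : Set} (ops : RingTerms T) (q t z z′ : T) where
  open RingTerms ops

  [1+t] [1-t] : T
  [1+t] = κ 1 ⊹ t
  [1-t] = κ 1 ⊹ (⊟ t)

  s s′ b b′ S S′ D D′ : T
  s = κ 1 ⊹ (⊟ ([1+t] ⊛ q))
  s′ = ⊟ [1+t]
  b = t ⊛ (q ⊛ (q ⊛ z))
  b′ = t ⊛ (q ⊛ (κ 2 ⊛ z ⊹ q ⊛ z′))
  S = s ⊹ (⊟ (κ 2 ⊛ b))
  S′ = s′ ⊹ (⊟ (κ 2 ⊛ b′))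
  D = s ⊛ s ⊹ (⊟ (κ 4 ⊛ (t ⊛ (q ⊛ q))))
  D′ = κ 2 ⊛ (s ⊛ s′) ⊹ (⊟ (κ 8 ⊛ (t ⊛ q)))

  ode : T
  ode = A₀ ⊹ q ⊛ (A₁ ⊹ q ⊛ (A₂ ⊹ q ⊛ A₃))
    where
    A₀ = κ 2 ⊹ (⊟ κ 2) ⊛ z
    A₁ = (κ 3 ⊛ [1+t]) ⊛ z ⊹ (⊟ κ 1) ⊛ z′
    A₂ = (⊟ ([1-t] ⊛ [1-t])) ⊛ z ⊹ (κ 2 ⊛ [1+t]) ⊛ z′
    A₃ = (⊟ ([1-t] ⊛ [1-t])) ⊛ z′

  quadratic : T
  quadratic = t ⊛ (q ⊛ (q ⊛ (z ⊛ z))) ⊹ (⊟ (s ⊛ z)) ⊹ κ 1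

module Shape = QuadraticShapes ℚ[[t]][[q]]-terms q t̂ z (QP.∂ z)

constᵠ-⊕ : ∀ a b → Q.const (a T.⊕ b) ≈Q (Q.const a Q.⊕ Q.const b)
constᵠ-⊕ a b zero i = ≡.refl
constᵠ-⊕ a b (suc n) i = ≡.sym (ℚP.+-identityʳ 0ℚ)

constᵠ-⊖ : ∀ a → Q.const (T.⊖ a) ≈Q (Q.⊖ Q.const a)
constᵠ-⊖ a zero i = ≡.refl
constᵠ-⊖ a (suc n) i = ≡.refl

constᵠ-⊗ : ∀ a b → Q.const (a T.⊗ b) ≈Q (Q.const a Q.⊗ Q.const b)
constᵠ-⊗ a b n = TRing.sym (TRing.trans (QP.const-⊗ a (Q.const b) n) (constant n))
  where
  constant : ∀ n → (a T.⊗ Q.const b n) ≈T Q.const (a T.⊗ b) n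
  constant zero = TRing.refl
  constant (suc n) = TRing.zeroʳ a

constᵠ-1 : Q.const T.1s ≈Q ιQ 1
constᵠ-1 zero i = ≡.refl
constᵠ-1 (suc n) i = ≡.refl

constᵠ-ι : ∀ k → Q.const (ιT k) ≈Q ιQ k
constᵠ-ι zero zero i = ≡.refl
constᵠ-ι zero (suc n) i = ≡.refl
constᵠ-ι (suc zero) zero i = ≡.refl
constᵠ-ι (suc zero) (suc n) i = ≡.refl
constᵠ-ι (suc (suc k)) zero i = ≡.cong (ℚ._+ T.1s i) (constᵠ-ι (suc k) zero i)
constᵠ-ι (suc (suc k)) (suc n) i = ≡.trans (≡.sym (ℚP.+-identityʳ 0ℚ)) (≡.cong (ℚ._+ 0ℚ) (constᵠ-ι (suc k) (suc n) i))

horner-cong : ∀ {A₀ A₁ A₂ A₃ B₀ B₁ B₂ B₃} → A₀ ≈Q B₀ → A₁ ≈Q B₁ → A₂ ≈Q B₂ → A₃ ≈Q B₃ →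
              horner A₀ A₁ A₂ A₃ ≈Q horner B₀ B₁ B₂ B₃
horner-cong A₀≈ A₁≈ A₂≈ A₃≈ =
  QRing.+-cong A₀≈ (QRing.*-cong (QRing.refl {q}) (QRing.+-cong A₁≈
    (QRing.*-cong (QRing.refl {q}) (QRing.+-cong A₂≈ (QRing.*-cong (QRing.refl {q}) A₃≈)))))

narayanaODE≈0 : Shape.ode ≈Q Q.0s
narayanaODE≈0 = QRing.trans (QRing.sym ode≈) narayanaODEᴴ≈0
  where
  c1+t : Q.const 1+t ≈Q Shape.[1+t]
  c1+t = QRing.trans (constᵠ-⊕ T.1s t) (QRing.+-cong constᵠ-1 (QRing.refl {t̂}))
  c1-t : Q.const 1-t ≈Q Shape.[1-t]
  c1-t = QRing.trans (constᵠ-⊕ T.1s (T.⊖ t)) (QRing.+-cong constᵠ-1 (constᵠ-⊖ t))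
  c[1-t]² : Q.const (T.⊖ (1-t T.⊗ 1-t)) ≈Q (Q.⊖ (Shape.[1-t] Q.⊗ Shape.[1-t]))
  c[1-t]² = QRing.trans (constᵠ-⊖ (1-t T.⊗ 1-t)) (QRing.-‿cong (QRing.trans (constᵠ-⊗ 1-t 1-t) (QRing.*-cong c1-t c1-t)))
  cιT⊗ : ∀ k {a b} → Q.const a ≈Q b → Q.const (ιT k T.⊗ a) ≈Q (ιQ k Q.⊗ b)
  cιT⊗ k {a} a≈b = QRing.trans (constᵠ-⊗ (ιT k) a) (QRing.*-cong (constᵠ-ι k) a≈b)
  ode≈ : narayanaODEᴴ ≈Q Shape.ode
  ode≈ = horner-cong
    (QRing.+-cong (constᵠ-ι 2) (QRing.*-cong (QRing.trans (constᵠ-⊖ (ιT 2)) (QRing.-‿cong (constᵠ-ι 2))) (QRing.refl {z})))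
    (QRing.+-cong (QRing.*-cong (cιT⊗ 3 c1+t) (QRing.refl {z}))
                  (QRing.*-cong (QRing.trans (constᵠ-⊖ T.1s) (QRing.-‿cong constᵠ-1)) (QRing.refl {QP.∂ z})))
    (QRing.+-cong (QRing.*-cong c[1-t]² (QRing.refl {z})) (QRing.*-cong (cιT⊗ 2 c1+t) (QRing.refl {QP.∂ z})))
    (QRing.*-cong c[1-t]² (QRing.refl {QP.∂ z}))

∂-const : ∀ c → QP.∂ (Q.const c) ≈Q Q.0s
∂-const c n = TRing.zeroʳ (ιT (suc n))

∂-ιQ : ∀ k → QP.∂ (ιQ k) ≈Q Q.0s
∂-ιQ k = QRing.trans (QP.∂-cong (QRing.sym (constᵠ-ι k))) (∂-const (ιT k))

∂-q : QP.∂ q ≈Q Q.1s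
∂-q zero = TRing.*-identityˡ T.1s
∂-q (suc n) = TRing.zeroʳ (ιT (suc (suc n)))

∂-scalar : ∀ K X → QP.∂ K ≈Q Q.0s → QP.∂ (K Q.⊗ X) ≈Q (K Q.⊗ QP.∂ X)
∂-scalar K X ∂K≈0 = QRing.trans (QP.∂-⊗ K X)
  (QRing.trans (QRing.+-congʳ {K Q.⊗ QP.∂ X} (QRing.trans (QRing.*-congʳ {X} ∂K≈0) (QRing.zeroˡ X)))
    (QRing.+-identityˡ (K Q.⊗ QP.∂ X)))

∂-q⊗ : ∀ X → QP.∂ (q Q.⊗ X) ≈Q (X Q.⊕ (q Q.⊗ QP.∂ X))
∂-q⊗ X = QRing.trans (QP.∂-⊗ q X) (QRing.+-congʳ {q Q.⊗ QP.∂ X} (QRing.trans (QRing.*-congʳ {X} ∂-q) (QRing.*-identityˡ X)))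

module ShapeDerivatives where
  open ℚ[[t]][[q]]-Solver using (solve; _:=_; _:+_; _:-_; :-_; _:*_; con; polynomialTerms)
  module Poly = QuadraticShapes (polynomialTerms {4})
  open Shape

  ∂[1+t] : QP.∂ [1+t] ≈Q Q.0s
  ∂[1+t] = QRing.trans (QP.∂-⊕ (ιQ 1) t̂) (QRing.trans (QRing.+-cong (∂-ιQ 1) (∂-const t)) (QRing.+-identityˡ Q.0s))

  ∂s : QP.∂ s ≈Q s′
  ∂s = QRing.trans (QP.∂-⊕ (ιQ 1) (Q.⊖ ([1+t] Q.⊗ q)))
    (QRing.trans (QRing.+-cong (∂-ιQ 1) (QRing.trans (QP.∂-⊖ ([1+t] Q.⊗ q)) (QRing.-‿cong (∂-scalar [1+t] q ∂[1+t]))))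
      (QRing.trans (QRing.+-congˡ {Q.0s} (QRing.-‿cong (QRing.*-congˡ {[1+t]} ∂-q)))
        (solve 4 (λ q t z z′ → con (+ 0) :+ :- (Poly.[1+t] q t z z′ :* con (+ 1)) := Poly.s′ q t z z′)
          QRing.refl q t̂ z (QP.∂ z))))

  ∂b : QP.∂ b ≈Q b′
  ∂b = QRing.trans (∂-scalar t̂ (q Q.⊗ (q Q.⊗ z)) (∂-const t))
    (QRing.trans (QRing.*-congˡ {t̂} (QRing.trans (∂-q⊗ (q Q.⊗ z)) (QRing.+-congˡ {q Q.⊗ z} (QRing.*-congˡ {q} (∂-q⊗ z)))))
      (solve 4 (λ q t z z′ → t :* (q :* z :+ q :* (z :+ q :* z′)) := Poly.b′ q t z z′) QRing.refl q t̂ z (QP.∂ z)))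

  ∂S : QP.∂ S ≈Q S′
  ∂S = QRing.trans (QP.∂-⊕ s (Q.⊖ (ιQ 2 Q.⊗ b)))
    (QRing.+-cong ∂s (QRing.trans (QP.∂-⊖ (ιQ 2 Q.⊗ b)) (QRing.-‿cong (QRing.trans (∂-scalar (ιQ 2) b (∂-ιQ 2)) (QRing.*-congˡ {ιQ 2} ∂b)))))

  ∂D : QP.∂ D ≈Q D′
  ∂D = QRing.trans (QP.∂-⊕ (s Q.⊗ s) (Q.⊖ (ιQ 4 Q.⊗ (t̂ Q.⊗ (q Q.⊗ q)))))
    (QRing.trans (QRing.+-cong (QRing.trans (QP.∂-⊗ s s) (QRing.+-cong (QRing.*-congʳ {s} ∂s) (QRing.*-congˡ {s} ∂s)))
                   (QRing.trans (QP.∂-⊖ (ιQ 4 Q.⊗ (t̂ Q.⊗ (q Q.⊗ q))))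
                     (QRing.-‿cong (QRing.trans (∂-scalar (ιQ 4) (t̂ Q.⊗ (q Q.⊗ q)) (∂-ιQ 4))
                       (QRing.*-congˡ {ιQ 4} (QRing.trans (∂-scalar t̂ (q Q.⊗ q) (∂-const t)) (QRing.*-congˡ {t̂} (QRing.trans (∂-q⊗ q) (QRing.+-congˡ {q} (QRing.*-congˡ {q} ∂-q))))))))))
      (solve 4 (λ q t z z′ → (Poly.s′ q t z z′ :* Poly.s q t z z′ :+ Poly.s q t z z′ :* Poly.s′ q t z z′)
                            :+ :- (con (+ 4) :* (t :* (q :+ q :* con (+ 1)))) := Poly.D′ q t z z′)
        QRing.refl q t̂ z (QP.∂ z)))

ιT-suc-cancel : ∀ n x → (ιT (suc n) T.⊗ x) ≈T T.0s → x ≈T T.0s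
ιT-suc-cancel n x ιx≈0 i = ιℚ-suc-cancel n (begin
  x i ℚ.* ιℚ (suc n)  ≡⟨ ℚP.*-comm (x i) (ιℚ (suc n)) ⟩
  ιℚ (suc n) ℚ.* x i  ≡⟨ ⊗-by-const (ιT≈const (suc n)) x i ⟨
  (ιT (suc n) T.⊗ x) i ≡⟨ ιx≈0 i ⟩
  0ℚ                  ≡⟨ ℚP.*-zeroˡ (ιℚ (suc n)) ⟨
  0ℚ ℚ.* ιℚ (suc n)   ∎)
  where open ≡.≡-Reasoning

ιQ-suc-cancel : ∀ k Y → (ιQ (suc k) Q.⊗ Y) ≈Q Q.0s → Y ≈Q Q.0s
ιQ-suc-cancel k Y ιY≈0 n = ιT-suc-cancel k (Y n) (λ i → begin
  (ιT (suc k) T.⊗ Y n) i                 ≡⟨ QP.const-⊗ (ιT (suc k)) Y n i ⟨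
  (Q.const (ιT (suc k)) Q.⊗ Y) n i       ≡⟨ QP.⊗-cong {g = Y} (constᵠ-ι (suc k)) (QRing.refl {Y}) n i ⟩
  (ιQ (suc k) Q.⊗ Y) n i                 ≡⟨ ιY≈0 n i ⟩
  0ℚ                                     ∎)
  where open ≡.≡-Reasoning

t̂-cancel : ∀ Y → (t̂ Q.⊗ Y) ≈Q Q.0s → Y ≈Q Q.0s
t̂-cancel Y tY≈0 n i = ≡.trans (≡.sym (TP.Xs-⊗ (Y n) (suc i)))
  (≡.trans (≡.sym (QP.const-⊗ t Y n (suc i))) (tY≈0 n (suc i)))

q-cancel : ∀ Y → (q Q.⊗ Y) ≈Q Q.0s → Y ≈Q Q.0s
q-cancel Y qY≈0 n i = ≡.trans (≡.sym (q⊗-coefficient Y n i)) (qY≈0 (suc n) i)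

module QuadraticEquation where
  open ℚ[[t]][[q]]-Solver using (solve; _:=_; _:+_; _:-_; :-_; _:*_; con; polynomialTerms)
  open import Algebra.Properties.Group QRing.+-group using (x∙y⁻¹≈ε⇒x≈y; identityʳ-unique)
  module Poly = QuadraticShapes (polynomialTerms {4})
  module Polyᵗ = QuadraticShapes (ℚ[[t]]-Solver.polynomialTerms {3}) (ℚ[[t]]-Solver.con (+ 0))
  open Shape
  open ShapeDerivatives using (∂S; ∂D)

  S-ODE : ((ιQ 2 Q.⊗ D) Q.⊗ QP.∂ S) ≈Q (QP.∂ D Q.⊗ S)
  S-ODE = x∙y⁻¹≈ε⇒x≈y _ _ (QRing.trans
    (QRing.+-cong (QRing.*-congˡ {ιQ 2 Q.⊗ D} ∂S) (QRing.-‿cong (QRing.*-congʳ {S} ∂D)))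
    (QRing.trans (solve 4 (λ q t z z′ → con (+ 2) :* Poly.D q t z z′ :* Poly.S′ q t z z′ :- Poly.D′ q t z z′ :* Poly.S q t z z′
                                       := con (+ 4) :* (t :* (q :* Poly.ode q t z z′)))
                    QRing.refl q t̂ z (QP.∂ z))
      (QRing.trans (QRing.*-congˡ {ιQ 4} (QRing.*-congˡ {t̂} (QRing.*-congˡ {q} narayanaODE≈0)))
        (solve 2 (λ t q → con (+ 4) :* (t :* (q :* con (+ 0))) := con (+ 0)) QRing.refl t̂ q))))

  S²-ODE : (D Q.⊗ QP.∂ (S Q.⊗ S)) ≈Q (QP.∂ D Q.⊗ (S Q.⊗ S))
  S²-ODE = QRing.trans (QRing.*-congˡ {D} (QP.∂-⊗ S S))
    (QRing.trans (solve 3 (λ d s′ s → d :* (s′ :* s :+ s :* s′) := s :* (con (+ 2) :* d :* s′)) QRing.refl D (QP.∂ S) S)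
      (QRing.trans (QRing.*-congˡ {S} S-ODE)
        (solve 2 (λ d′ s → s :* (d′ :* s) := d′ :* (s :* s)) QRing.refl (QP.∂ D) S)))

  D₀≈1 : D 0 ≈T T.1s
  D₀≈1 = ℚ[[t]]-Solver.solve 3 (λ t z z′ → Polyᵗ.D t z z′ ℚ[[t]]-Solver.:= ℚ[[t]]-Solver.con (+ 1))
           TRing.refl t (z 0) (QP.∂ z 0)

  S²₀≈D₀ : (S Q.⊗ S) 0 ≈T D 0
  S²₀≈D₀ = ℚ[[t]]-Solver.solve 3 (λ t z z′ → Polyᵗ.S t z z′ ℚ[[t]]-Solver.:* Polyᵗ.S t z z′ ℚ[[t]]-Solver.:= Polyᵗ.D t z z′)
             TRing.refl t (z 0) (QP.∂ z 0)

  S²≈D : (S Q.⊗ S) ≈Q D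
  S²≈D = QP.LinearODE.solution-unique ιT-suc-cancel {D} {QP.∂ D} {S Q.⊗ S} {D} D₀≈1 S²-ODE (QRing.*-comm D (QP.∂ D)) S²₀≈D₀

  quadratic≈0 : quadratic ≈Q Q.0s
  quadratic≈0 = q-cancel _ (q-cancel _ (t̂-cancel _ (ιQ-suc-cancel 3 _ (identityʳ-unique D _
    (QRing.trans (solve 4 (λ q t z z′ → Poly.D q t z z′ :+ con (+ 4) :* (t :* (q :* (q :* Poly.quadratic q t z z′)))
                                        := Poly.S q t z z′ :* Poly.S q t z z′) QRing.refl q t̂ z (QP.∂ z))
                 S²≈D)))))

  a : QSer
  a = s Q.⊕ (Q.⊖ b)

  a⊗z≈1 : (a Q.⊗ z) ≈Q Q.1s
  a⊗z≈1 = x∙y⁻¹≈ε⇒x≈y _ _ (QRing.trans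
    (solve 4 (λ q t z z′ → (Poly.s q t z z′ :- Poly.b q t z z′) :* z :- con (+ 1) := :- Poly.quadratic q t z z′)
      QRing.refl q t̂ z (QP.∂ z))
    (QRing.trans (QRing.-‿cong quadratic≈0) (RingProperties.-0#≈0# QRing.ring)))

module RhoRecurrence where
  open InverseFactorials.ℚ-Solver using (Polynomial; solve; _:=_; _:+_; _:-_; :-_; _:*_; con; polynomialTerms)
  open import Data.Rational using (_+_; _*_; -_)
  open ≡ using (refl; trans; sym; cong; cong₂)
  open import Data.Empty using (⊥-elim)
  open import Data.Fin using (Fin; zero; suc)
  open import Data.Vec using (Vec; lookup; []; _∷_)
  open import Relation.Binary.Definitions using (tri<; tri≈; tri>)

  fact-suc : ∀ n → ιℚ (suc n ℕ.!) ≡ ιℚ (suc n) * ιℚ (n ℕ.!)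
  fact-suc n = ιℚ-* (suc n) (n ℕ.!)

  ρ-formula : ∀ m d i → d < m → i ≤ d →
    ρ m d i ≡ ((+ m) / suc (m ∸ suc d)) ℚ.* ((+ (((m ∸ 1 ∸ d ℕ.+ i) C i) ℕ.* ((m ∸ 1 ∸ i) C (d ∸ i)))) / 1)
  ρ-formula m d i d<m i≤d with d ℕ.<? m
  ... | no ¬p = ⊥-elim (¬p d<m)
  ... | yes _ with i ℕ.≤? d
  ...   | yes _ = refl
  ...   | no ¬q = ⊥-elim (¬q i≤d)

  ρ-above-diagonal : ∀ m d i → d < m → d < i → ρ m d i ≡ 0ℚ
  ρ-above-diagonal m d i d<m d<i with d ℕ.<? m
  ... | no ¬p = ⊥-elim (¬p d<m)
  ... | yes _ with i ℕ.≤? d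
  ...   | yes i≤d = ⊥-elim (ℕP.<⇒≱ d<i i≤d)
  ...   | no _ = refl

  ρ-top : ∀ m i → ρ m m i ≡ (T.1s T.⊕ tpow m) i
  ρ-top m i with m ℕ.<? m
  ... | yes m<m = ⊥-elim (ℕP.<-irrefl refl m<m)
  ... | no _ with m ℕ.≟ m
  ...   | yes _ = refl
  ...   | no ¬e = ⊥-elim (¬e refl)

  ρ-beyond-top : ∀ m d i → m < d → ρ m d i ≡ 0ℚ
  ρ-beyond-top m d i m<d with d ℕ.<? m
  ... | yes d<m = ⊥-elim (ℕP.<-asym d<m m<d)
  ... | no _ with d ℕ.≟ m
  ...   | yes e = ⊥-elim (ℕP.<-irrefl (sym e) m<d)
  ...   | no _ = refl

  /1≡ιℚ : ∀ X → (+ X) / 1 ≡ ιℚ X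
  /1≡ιℚ X = trans (sym (ℚP.*-identityʳ ((+ X) / 1))) (/-*-ιℚ X 1)

  ρFactorials : ℕ → ℕ → ℕ → ℕ → ℚ
  ρFactorials m g i r = ιℚ m * ((ιℚ ((g ℕ.+ i) ℕ.!) * ιℚ ((g ℕ.+ r) ℕ.!)) * (((invFact (+ i) * invFact (+ r)) * invFact (+ suc g)) * invFact (+ g)))

  ρ≡factorials : ∀ m g i r → m ≡ suc g ℕ.+ (i ℕ.+ r) → ρ m (i ℕ.+ r) i ≡ ρFactorials m g i r
  ρ≡factorials .(suc g ℕ.+ (i ℕ.+ r)) g i r refl = begin
    ρ m d i ≡⟨ ρ-formula m d i (s≤s (ℕP.m≤n+m d g)) (ℕP.m≤m+n i r) ⟩
    ((+ m) / suc (m ∸ suc d)) * ((+ (((m ∸ 1 ∸ d ℕ.+ i) C i) ℕ.* ((m ∸ 1 ∸ i) C (d ∸ i)))) / 1)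
      ≡⟨ cong₂ (λ x y → ((+ m) / suc x) * ((+ y) / 1)) e1 (cong₂ ℕ._*_ (cong (λ x → (x ℕ.+ i) C i) e1) (cong₂ _C_ e2 e3)) ⟩
    A * ((+ (((g ℕ.+ i) C i) ℕ.* ((g ℕ.+ r) C r))) / 1) ≡⟨ cong (A *_) (/1≡ιℚ (((g ℕ.+ i) C i) ℕ.* ((g ℕ.+ r) C r))) ⟩
    A * ιℚ (((g ℕ.+ i) C i) ℕ.* ((g ℕ.+ r) C r)) ≡⟨ cong (A *_) (ιℚ-* ((g ℕ.+ i) C i) ((g ℕ.+ r) C r)) ⟩
    A * (ιℚ ((g ℕ.+ i) C i) * ιℚ ((g ℕ.+ r) C r)) ≡⟨ cong₂ (λ x y → A * (x * y)) (choose≡factorials (g ℕ.+ i) i) (choose≡factorials (g ℕ.+ r) r) ⟩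
    A * ((Fi * (Ri * invFact (+ (g ℕ.+ i) ℤ.- + i))) * (Fr * (Rr * invFact (+ (g ℕ.+ r) ℤ.- + r))))
      ≡⟨ cong₂ (λ x y → A * ((Fi * (Ri * invFact x)) * (Fr * (Rr * invFact y)))) (a+b-b≡a (+ g) (+ i)) (a+b-b≡a (+ g) (+ r)) ⟩
    A * ((Fi * (Ri * Rg)) * (Fr * (Rr * Rg))) ≡⟨ cong (λ x → A * ((Fi * (Ri * Rg)) * (Fr * (Rr * x)))) (invFact-pred (+ suc g)) ⟩
    A * ((Fi * (Ri * Rg)) * (Fr * (Rr * (c * Rsg))))
      ≡⟨ solve 9 (λ A Fi Fr Ri Rr Rg Rsg c x → (A :* ((Fi :* (Ri :* Rg)) :* (Fr :* (Rr :* (c :* Rsg)))))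
           := ((A :* c) :* ((Fi :* Fr) :* (((Ri :* Rr) :* Rsg) :* Rg)))) refl A Fi Fr Ri Rr Rg Rsg c c ⟩
    (A * c) * ((Fi * Fr) * (((Ri * Rr) * Rsg) * Rg)) ≡⟨ cong (_* ((Fi * Fr) * (((Ri * Rr) * Rsg) * Rg))) (/-*-ιℚ m (suc g)) ⟩
    ρFactorials m g i r ∎
    where
    open ≡.≡-Reasoning
    m = suc g ℕ.+ (i ℕ.+ r)
    d = i ℕ.+ r
    A = (+ m) / suc g
    Fi = ιℚ ((g ℕ.+ i) ℕ.!)
    Fr = ιℚ ((g ℕ.+ r) ℕ.!)
    Ri = invFact (+ i)
    Rr = invFact (+ r)
    Rg = invFact (+ g)
    Rsg = invFact (+ suc g)
    c = ιℚ (suc g)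
    e1 : m ∸ suc d ≡ g
    e1 = ℕP.m+n∸n≡m g d
    e2 : m ∸ 1 ∸ i ≡ g ℕ.+ r
    e2 = trans (cong (_∸ i) (trans (sym (ℕP.+-assoc g i r)) (trans (cong (ℕ._+ r) (ℕP.+-comm g i)) (ℕP.+-assoc i g r)))) (ℕP.m+n∸m≡n i (g ℕ.+ r))
    e3 : d ∸ i ≡ r
    e3 = ℕP.m+n∸m≡n i r
    a+b-b≡a : ∀ (a b : ℤ) → (a ℤ.+ b) ℤ.- b ≡ a
    a+b-b≡a = solve-∀

  -- Syntax for sums of naturals, so that ιℚ of such a sum can be rewritten as a polynomial in the
  -- ιℚ of its summands.

  data NatExpr (k : ℕ) : Set where
    V : Fin k → NatExpr k
    Z : NatExpr k
    S : NatExpr k → NatExpr k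
    _⊞_ : NatExpr k → NatExpr k → NatExpr k

  evalℕ : ∀ {k} → NatExpr k → Vec ℕ k → ℕ
  evalℕ (V x) env = lookup env x
  evalℕ Z env = 0
  evalℕ (S e) env = suc (evalℕ e env)
  evalℕ (e ⊞ f) env = evalℕ e env ℕ.+ evalℕ f env

  evalℚ : ∀ {k} → NatExpr k → Vec ℕ k → ℚ
  evalℚ (V x) env = ιℚ (lookup env x)
  evalℚ Z env = 0ℚ
  evalℚ (S e) env = 1ℚ + evalℚ e env
  evalℚ (e ⊞ f) env = evalℚ e env + evalℚ f env

  evalPoly : ∀ {k n} → NatExpr k → Vec (Polynomial n) k → Polynomial n
  evalPoly (V x) env = lookup env x
  evalPoly Z env = con (+ 0)
  evalPoly (S e) env = con (+ 1) :+ evalPoly e env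
  evalPoly (e ⊞ f) env = evalPoly e env :+ evalPoly f env

  ιℚ-evalℕ : ∀ {k} (e : NatExpr k) env → ιℚ (evalℕ e env) ≡ evalℚ e env
  ιℚ-evalℕ (V x) env = refl
  ιℚ-evalℕ Z env = refl
  ιℚ-evalℕ (S e) env = trans (ιℚ-suc (evalℕ e env)) (cong (1ℚ ℚ.+_) (ιℚ-evalℕ e env))
  ιℚ-evalℕ (e ⊞ f) env = trans (ιℚ-+ (evalℕ e env) (evalℕ f env)) (cong₂ _+_ (ιℚ-evalℕ e env) (ιℚ-evalℕ f env))

  ρ≡factorials′ : ∀ m d i g r → m ≡ suc g ℕ.+ (i ℕ.+ r) → d ≡ i ℕ.+ r → ρ m d i ≡ ρFactorials m g i r
  ρ≡factorials′ m .(i ℕ.+ r) i g r em refl = ρ≡factorials m g i r em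

  module FactorialShape {T : Set} (ops : RingTerms T) where
    open RingTerms ops

    shape : T → T → T → T → T → T → T → T
    shape M FA FB RA RB RC RD = M ⊛ (FA ⊛ FB ⊛ (RA ⊛ RB ⊛ RC ⊛ RD))

  factorialShape : ℚ → ℚ → ℚ → ℚ → ℚ → ℚ → ℚ → ℚ
  factorialShape = FactorialShape.shape ℚ-terms

  factorialShape-cong : ∀ M FA FB RA RB RC RD {M' FA' FB' RA' RB' RC' RD'} → M ≡ M' → FA ≡ FA' → FB ≡ FB' → RA ≡ RA' → RB ≡ RB' → RC ≡ RC' → RD ≡ RD' →
    factorialShape M FA FB RA RB RC RD ≡ factorialShape M' FA' FB' RA' RB' RC' RD'
  factorialShape-cong M FA FB RA RB RC RD refl refl refl refl refl refl refl = refl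

  fact-+suc : ∀ a b → ιℚ ((a ℕ.+ suc b) ℕ.!) ≡ ιℚ (suc (a ℕ.+ b)) * ιℚ ((a ℕ.+ b) ℕ.!)
  fact-+suc a b = trans (cong (λ x → ιℚ (x ℕ.!)) (ℕP.+-suc a b)) (fact-suc (a ℕ.+ b))

  module InteriorRecurrence (i r e : ℕ) where
    private module Poly = FactorialShape (polynomialTerms {8})
    open ≡.≡-Reasoning
    d m : ℕ
    d = i ℕ.+ r
    m = suc (suc (d ℕ.+ e))
    env : Vec ℕ 3
    env = i ∷ r ∷ e ∷ []
    vi vr ve : NatExpr 3
    vi = V zero
    vr = V (suc zero)
    ve = V (suc (suc zero))
    ⟦_⟧ : NatExpr 3 → ℚ
    ⟦ x ⟧ = evalℚ x env
    I Rp E Fa Fb Ri Rr Rs : ℚ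
    I = ιℚ i
    Rp = ιℚ r
    E = ιℚ e
    Fa = ιℚ ((e ℕ.+ i) ℕ.!)
    Fb = ιℚ ((e ℕ.+ r) ℕ.!)
    Ri = invFact (+ suc i)
    Rr = invFact (+ suc r)
    Rs = invFact (+ suc (suc e))
    fA : ιℚ ((e ℕ.+ suc i) ℕ.!) ≡ ⟦ S (ve ⊞ vi) ⟧ * Fa
    fA = trans (fact-+suc e i) (cong (_* Fa) (ιℚ-evalℕ (S (ve ⊞ vi)) env))
    fB : ιℚ ((e ℕ.+ suc r) ℕ.!) ≡ ⟦ S (ve ⊞ vr) ⟧ * Fb
    fB = trans (fact-+suc e r) (cong (_* Fb) (ιℚ-evalℕ (S (ve ⊞ vr)) env))
    fC : ιℚ ((suc e ℕ.+ i) ℕ.!) ≡ ⟦ S (ve ⊞ vi) ⟧ * Fa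
    fC = trans (fact-suc (e ℕ.+ i)) (cong (_* Fa) (ιℚ-evalℕ (S (ve ⊞ vi)) env))
    fD : ιℚ ((suc e ℕ.+ r) ℕ.!) ≡ ⟦ S (ve ⊞ vr) ⟧ * Fb
    fD = trans (fact-suc (e ℕ.+ r)) (cong (_* Fb) (ιℚ-evalℕ (S (ve ⊞ vr)) env))
    fE : ιℚ ((suc e ℕ.+ suc i) ℕ.!) ≡ ⟦ S (ve ⊞ S vi) ⟧ * (⟦ S (ve ⊞ vi) ⟧ * Fa)
    fE = trans (fact-suc (e ℕ.+ suc i)) (cong₂ _*_ (ιℚ-evalℕ (S (ve ⊞ S vi)) env) fA)
    fF : ιℚ ((suc e ℕ.+ suc r) ℕ.!) ≡ ⟦ S (ve ⊞ S vr) ⟧ * (⟦ S (ve ⊞ vr) ⟧ * Fb)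
    fF = trans (fact-suc (e ℕ.+ suc r)) (cong₂ _*_ (ιℚ-evalℕ (S (ve ⊞ S vr)) env) fB)
    rI : invFact (+ i) ≡ ⟦ S vi ⟧ * Ri
    rI = trans (invFact-suc i) (cong (_* Ri) (ιℚ-evalℕ (S vi) env))
    rR : invFact (+ r) ≡ ⟦ S vr ⟧ * Rr
    rR = trans (invFact-suc r) (cong (_* Rr) (ιℚ-evalℕ (S vr) env))
    rE1 : invFact (+ suc e) ≡ ⟦ S (S ve) ⟧ * Rs
    rE1 = trans (invFact-suc (suc e)) (cong (_* Rs) (ιℚ-evalℕ (S (S ve)) env))
    rE0 : invFact (+ e) ≡ ⟦ S ve ⟧ * (⟦ S (S ve) ⟧ * Rs)
    rE0 = trans (invFact-suc e) (cong₂ _*_ (ιℚ-evalℕ (S ve) env) rE1)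
    m-expr : NatExpr 3
    m-expr = S (S ((vi ⊞ vr) ⊞ ve))
    ιm≡ : ιℚ m ≡ ⟦ m-expr ⟧
    ιm≡ = ιℚ-evalℕ m-expr env
    ι[1+m]≡ : ιℚ (suc m) ≡ ⟦ S m-expr ⟧
    ι[1+m]≡ = ιℚ-evalℕ (S m-expr) env
    ι[2+m]≡ : ιℚ (suc (suc m)) ≡ ⟦ S (S m-expr) ⟧
    ι[2+m]≡ = ιℚ-evalℕ (S (S m-expr)) env

    eqL : suc (suc m) ≡ suc (suc e) ℕ.+ (suc i ℕ.+ suc r)
    eqL = arithmetic i r e
      where
      arithmetic : ∀ i r e → suc (suc (suc (suc ((i ℕ.+ r) ℕ.+ e)))) ≡ suc (suc e) ℕ.+ (suc i ℕ.+ suc r)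
      arithmetic = NS.solve-∀
    lhs≡ : ρ (suc (suc m)) (suc (suc d)) (suc i) ≡ factorialShape (⟦ S (S m-expr) ⟧) (⟦ S (ve ⊞ S vi) ⟧ * (⟦ S (ve ⊞ vi) ⟧ * Fa))
                   (⟦ S (ve ⊞ S vr) ⟧ * (⟦ S (ve ⊞ vr) ⟧ * Fb)) Ri Rr Rs (⟦ S (S ve) ⟧ * Rs)
    lhs≡ = trans (ρ≡factorials′ (suc (suc m)) (suc (suc d)) (suc i) (suc e) (suc r) eqL (cong suc (sym (ℕP.+-suc i r)))) (factorialShape-cong (ιℚ (suc (suc m))) (ιℚ ((suc e ℕ.+ suc i) ℕ.!)) (ιℚ ((suc e ℕ.+ suc r) ℕ.!)) Ri Rr Rs (invFact (+ suc e)) ι[2+m]≡ fE fF refl refl refl rE1)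

    eq1 : suc m ≡ suc e ℕ.+ (suc i ℕ.+ suc r)
    eq1 = arithmetic i r e
      where
      arithmetic : ∀ i r e → suc (suc (suc ((i ℕ.+ r) ℕ.+ e))) ≡ suc e ℕ.+ (suc i ℕ.+ suc r)
      arithmetic = NS.solve-∀
    eq2 : suc m ≡ suc (suc e) ℕ.+ (suc i ℕ.+ r)
    eq2 = arithmetic i r e
      where
      arithmetic : ∀ i r e → suc (suc (suc ((i ℕ.+ r) ℕ.+ e))) ≡ suc (suc e) ℕ.+ (suc i ℕ.+ r)
      arithmetic = NS.solve-∀
    eq3 : suc m ≡ suc (suc e) ℕ.+ (i ℕ.+ suc r)
    eq3 = arithmetic i r e
      where
      arithmetic : ∀ i r e → suc (suc (suc ((i ℕ.+ r) ℕ.+ e))) ≡ suc (suc e) ℕ.+ (i ℕ.+ suc r)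
      arithmetic = NS.solve-∀
    eq4 : m ≡ suc (suc e) ℕ.+ (i ℕ.+ r)
    eq4 = arithmetic i r e
      where
      arithmetic : ∀ i r e → suc (suc ((i ℕ.+ r) ℕ.+ e)) ≡ suc (suc e) ℕ.+ (i ℕ.+ r)
      arithmetic = NS.solve-∀

    term₁≡ : ρ (suc m) (suc (suc d)) (suc i) ≡ factorialShape (⟦ S m-expr ⟧) (⟦ S (ve ⊞ vi) ⟧ * Fa) (⟦ S (ve ⊞ vr) ⟧ * Fb) Ri Rr
                   (⟦ S (S ve) ⟧ * Rs) (⟦ S ve ⟧ * (⟦ S (S ve) ⟧ * Rs))
    term₁≡ = trans (ρ≡factorials′ (suc m) (suc (suc d)) (suc i) e (suc r) eq1 (cong suc (sym (ℕP.+-suc i r))))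
               (factorialShape-cong (ιℚ (suc m)) (ιℚ ((e ℕ.+ suc i) ℕ.!)) (ιℚ ((e ℕ.+ suc r) ℕ.!)) Ri Rr (invFact (+ suc e)) (invFact (+ e)) ι[1+m]≡ fA fB refl refl rE1 rE0)
    term₂≡ : ρ (suc m) (suc d) (suc i) ≡ factorialShape (⟦ S m-expr ⟧) (⟦ S (ve ⊞ S vi) ⟧ * (⟦ S (ve ⊞ vi) ⟧ * Fa)) (⟦ S (ve ⊞ vr) ⟧ * Fb)
                   Ri (⟦ S vr ⟧ * Rr) Rs (⟦ S (S ve) ⟧ * Rs)
    term₂≡ = trans (ρ≡factorials′ (suc m) (suc d) (suc i) (suc e) r eq2 refl)
               (factorialShape-cong (ιℚ (suc m)) (ιℚ ((suc e ℕ.+ suc i) ℕ.!)) (ιℚ ((suc e ℕ.+ r) ℕ.!)) Ri (invFact (+ r)) Rs (invFact (+ suc e)) ι[1+m]≡ fE fD refl rR refl rE1)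
    term₃≡ : ρ (suc m) (suc d) i ≡ factorialShape (⟦ S m-expr ⟧) (⟦ S (ve ⊞ vi) ⟧ * Fa) (⟦ S (ve ⊞ S vr) ⟧ * (⟦ S (ve ⊞ vr) ⟧ * Fb))
                   (⟦ S vi ⟧ * Ri) Rr Rs (⟦ S (S ve) ⟧ * Rs)
    term₃≡ = trans (ρ≡factorials′ (suc m) (suc d) i (suc e) (suc r) eq3 (sym (ℕP.+-suc i r)))
               (factorialShape-cong (ιℚ (suc m)) (ιℚ ((suc e ℕ.+ i) ℕ.!)) (ιℚ ((suc e ℕ.+ suc r) ℕ.!)) (invFact (+ i)) Rr Rs (invFact (+ suc e)) ι[1+m]≡ fC fF rI refl refl rE1)
    term₄≡ : ρ m d i ≡ factorialShape (⟦ m-expr ⟧) (⟦ S (ve ⊞ vi) ⟧ * Fa) (⟦ S (ve ⊞ vr) ⟧ * Fb) (⟦ S vi ⟧ * Ri) (⟦ S vr ⟧ * Rr) Rs (⟦ S (S ve) ⟧ * Rs)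
    term₄≡ = trans (ρ≡factorials′ m d i (suc e) r eq4 refl)
               (factorialShape-cong (ιℚ m) (ιℚ ((suc e ℕ.+ i) ℕ.!)) (ιℚ ((suc e ℕ.+ r) ℕ.!)) (invFact (+ i)) (invFact (+ r)) Rs (invFact (+ suc e)) ιm≡ fC fD rI rR refl rE1)

    interior : ρ (suc (suc m)) (suc (suc d)) (suc i) ≡ ((ρ (suc m) (suc (suc d)) (suc i) + ρ (suc m) (suc d) (suc i)) + ρ (suc m) (suc d) i) + ℚ.- ρ m d i
    interior = trans lhs≡ (trans (solve 8 (λ I Rp E Fa Fb Ri Rr Rs →
        let c : NatExpr 3 → Polynomial 8
            c x = evalPoly x (I ∷ Rp ∷ E ∷ [])
        in Poly.shape (c (S (S m-expr))) (c (S (ve ⊞ S vi)) :* (c (S (ve ⊞ vi)) :* Fa)) (c (S (ve ⊞ S vr)) :* (c (S (ve ⊞ vr)) :* Fb)) Ri Rr Rs (c (S (S ve)) :* Rs)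
           := (((Poly.shape (c (S m-expr)) (c (S (ve ⊞ vi)) :* Fa) (c (S (ve ⊞ vr)) :* Fb) Ri Rr (c (S (S ve)) :* Rs) (c (S ve) :* (c (S (S ve)) :* Rs))
                :+ Poly.shape (c (S m-expr)) (c (S (ve ⊞ S vi)) :* (c (S (ve ⊞ vi)) :* Fa)) (c (S (ve ⊞ vr)) :* Fb) Ri (c (S vr) :* Rr) Rs (c (S (S ve)) :* Rs))
                :+ Poly.shape (c (S m-expr)) (c (S (ve ⊞ vi)) :* Fa) (c (S (ve ⊞ S vr)) :* (c (S (ve ⊞ vr)) :* Fb)) (c (S vi) :* Ri) Rr Rs (c (S (S ve)) :* Rs))
                :+ (:- Poly.shape (c m-expr) (c (S (ve ⊞ vi)) :* Fa) (c (S (ve ⊞ vr)) :* Fb) (c (S vi) :* Ri) (c (S vr) :* Rr) Rs (c (S (S ve)) :* Rs))))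
        refl I Rp E Fa Fb Ri Rr Rs)
      (sym (cong₂ (λ x y → x + ℚ.- y) (cong₂ _+_ (cong₂ _+_ term₁≡ term₂≡) term₃≡) term₄≡)))

  module BoundaryRecurrence (d e : ℕ) where
    private module Poly = FactorialShape (polynomialTerms {7})
    m : ℕ
    m = suc (suc (d ℕ.+ e))
    env : Vec ℕ 2
    env = d ∷ e ∷ []
    vd ve : NatExpr 2
    vd = V zero
    ve = V (suc zero)
    ⟦_⟧ : NatExpr 2 → ℚ
    ⟦ x ⟧ = evalℚ x env
    Fa Fb R0 Rdd Rs : ℚ
    Fa = ιℚ ((e ℕ.+ suc d) ℕ.!)
    Fb = ιℚ ((e ℕ.+ 0) ℕ.!)
    R0 = invFact (+ 0)
    Rdd = invFact (+ suc (suc d))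
    Rs = invFact (+ suc (suc e))
    f1 : ιℚ ((suc e ℕ.+ suc d) ℕ.!) ≡ ⟦ S (ve ⊞ S vd) ⟧ * Fa
    f1 = trans (fact-suc (e ℕ.+ suc d)) (cong (_* Fa) (ιℚ-evalℕ (S (ve ⊞ S vd)) env))
    f2 : ιℚ ((e ℕ.+ suc (suc d)) ℕ.!) ≡ ⟦ S (ve ⊞ S vd) ⟧ * Fa
    f2 = trans (fact-+suc e (suc d)) (cong (_* Fa) (ιℚ-evalℕ (S (ve ⊞ S vd)) env))
    f3 : ιℚ ((suc e ℕ.+ suc (suc d)) ℕ.!) ≡ ⟦ S (ve ⊞ S (S vd)) ⟧ * (⟦ S (ve ⊞ S vd) ⟧ * Fa)
    f3 = trans (fact-suc (e ℕ.+ suc (suc d))) (cong₂ _*_ (ιℚ-evalℕ (S (ve ⊞ S (S vd))) env) f2)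
    f4 : ιℚ ((suc e ℕ.+ 0) ℕ.!) ≡ ⟦ S (ve ⊞ Z) ⟧ * Fb
    f4 = trans (fact-suc (e ℕ.+ 0)) (cong (_* Fb) (ιℚ-evalℕ (S (ve ⊞ Z)) env))
    rD : invFact (+ suc d) ≡ ⟦ S (S vd) ⟧ * Rdd
    rD = trans (invFact-suc (suc d)) (cong (_* Rdd) (ιℚ-evalℕ (S (S vd)) env))
    rE1 : invFact (+ suc e) ≡ ⟦ S (S ve) ⟧ * Rs
    rE1 = trans (invFact-suc (suc e)) (cong (_* Rs) (ιℚ-evalℕ (S (S ve)) env))
    rE0 : invFact (+ e) ≡ ⟦ S ve ⟧ * (⟦ S (S ve) ⟧ * Rs)
    rE0 = trans (invFact-suc e) (cong₂ _*_ (ιℚ-evalℕ (S ve) env) rE1)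
    m-expr : NatExpr 2
    m-expr = S (S (vd ⊞ ve))
    ι[1+m]≡ : ιℚ (suc m) ≡ ⟦ S m-expr ⟧
    ι[1+m]≡ = ιℚ-evalℕ (S m-expr) env
    ι[2+m]≡ : ιℚ (suc (suc m)) ≡ ⟦ S (S m-expr) ⟧
    ι[2+m]≡ = ιℚ-evalℕ (S (S m-expr)) env

    e1 : suc (suc m) ≡ suc (suc e) ℕ.+ (suc (suc d) ℕ.+ 0)
    e1 = arithmetic d e where
      arithmetic : ∀ d e → suc (suc (suc (suc (d ℕ.+ e)))) ≡ suc (suc e) ℕ.+ (suc (suc d) ℕ.+ 0)
      arithmetic = NS.solve-∀
    e2 : suc m ≡ suc e ℕ.+ (suc (suc d) ℕ.+ 0)
    e2 = arithmetic d e where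
      arithmetic : ∀ d e → suc (suc (suc (d ℕ.+ e))) ≡ suc e ℕ.+ (suc (suc d) ℕ.+ 0)
      arithmetic = NS.solve-∀
    e3 : suc m ≡ suc (suc e) ℕ.+ (suc d ℕ.+ 0)
    e3 = arithmetic d e where
      arithmetic : ∀ d e → suc (suc (suc (d ℕ.+ e))) ≡ suc (suc e) ℕ.+ (suc d ℕ.+ 0)
      arithmetic = NS.solve-∀
    e1' : suc (suc m) ≡ suc (suc e) ℕ.+ (0 ℕ.+ suc (suc d))
    e1' = arithmetic d e where
      arithmetic : ∀ d e → suc (suc (suc (suc (d ℕ.+ e)))) ≡ suc (suc e) ℕ.+ (0 ℕ.+ suc (suc d))
      arithmetic = NS.solve-∀
    e2' : suc m ≡ suc e ℕ.+ (0 ℕ.+ suc (suc d))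
    e2' = arithmetic d e where
      arithmetic : ∀ d e → suc (suc (suc (d ℕ.+ e))) ≡ suc e ℕ.+ (0 ℕ.+ suc (suc d))
      arithmetic = NS.solve-∀
    e3' : suc m ≡ suc (suc e) ℕ.+ (0 ℕ.+ suc d)
    e3' = arithmetic d e where
      arithmetic : ∀ d e → suc (suc (suc (d ℕ.+ e))) ≡ suc (suc e) ℕ.+ (0 ℕ.+ suc d)
      arithmetic = NS.solve-∀
    n≡n+0 : ∀ n → n ≡ n ℕ.+ 0
    n≡n+0 n = sym (ℕP.+-identityʳ n)

    i≡d+1 : ρ (suc (suc m)) (suc (suc d)) (suc (suc d)) ≡ ((ρ (suc m) (suc (suc d)) (suc (suc d)) + ρ (suc m) (suc d) (suc (suc d))) + ρ (suc m) (suc d) (suc d)) + ℚ.- ρ m d (suc d)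
    i≡d+1 = trans (trans (ρ≡factorials′ (suc (suc m)) (suc (suc d)) (suc (suc d)) (suc e) 0 e1 (n≡n+0 _))
                   (factorialShape-cong (ιℚ (suc (suc m))) (ιℚ ((suc e ℕ.+ suc (suc d)) ℕ.!)) (ιℚ ((suc e ℕ.+ 0) ℕ.!)) Rdd R0 Rs (invFact (+ suc e)) ι[2+m]≡ f3 f4 refl refl refl rE1))
      (trans (solve 7 (λ D E Fa Fb R0 Rdd Rs →
        let c : NatExpr 2 → Polynomial 7
            c x = evalPoly x (D ∷ E ∷ [])
        in Poly.shape (c (S (S m-expr))) (c (S (ve ⊞ S (S vd))) :* (c (S (ve ⊞ S vd)) :* Fa)) (c (S (ve ⊞ Z)) :* Fb) Rdd R0 Rs (c (S (S ve)) :* Rs)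
          := (((Poly.shape (c (S m-expr)) (c (S (ve ⊞ S vd)) :* Fa) Fb Rdd R0 (c (S (S ve)) :* Rs) (c (S ve) :* (c (S (S ve)) :* Rs)) :+ con (+ 0))
               :+ Poly.shape (c (S m-expr)) (c (S (ve ⊞ S vd)) :* Fa) (c (S (ve ⊞ Z)) :* Fb) (c (S (S vd)) :* Rdd) R0 Rs (c (S (S ve)) :* Rs))
               :+ (:- con (+ 0))))
        refl (ιℚ d) (ιℚ e) Fa Fb R0 Rdd Rs)
      (sym (cong₂ (λ x y → x + ℚ.- y) (cong₂ _+_ (cong₂ _+_ term₁≡ term₂≡) term₃≡) term₄≡)))
      where
      term₁≡ = trans (ρ≡factorials′ (suc m) (suc (suc d)) (suc (suc d)) e 0 e2 (n≡n+0 _))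
             (factorialShape-cong (ιℚ (suc m)) (ιℚ ((e ℕ.+ suc (suc d)) ℕ.!)) Fb Rdd R0 (invFact (+ suc e)) (invFact (+ e)) ι[1+m]≡ f2 refl refl refl rE1 rE0)
      term₂≡ = ρ-above-diagonal (suc m) (suc d) (suc (suc d)) (s≤s (s≤s (ℕP.≤-trans (ℕP.m≤m+n d e) (ℕP.n≤1+n (d ℕ.+ e))))) ℕP.≤-refl
      term₃≡ = trans (ρ≡factorials′ (suc m) (suc d) (suc d) (suc e) 0 e3 (n≡n+0 _))
             (factorialShape-cong (ιℚ (suc m)) (ιℚ ((suc e ℕ.+ suc d) ℕ.!)) (ιℚ ((suc e ℕ.+ 0) ℕ.!)) (invFact (+ suc d)) R0 Rs (invFact (+ suc e)) ι[1+m]≡ f1 f4 rD refl refl rE1)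
      term₄≡ = ρ-above-diagonal m d (suc d) (s≤s (ℕP.≤-trans (ℕP.m≤m+n d e) (ℕP.n≤1+n _))) ℕP.≤-refl

    i≡0 : ρ (suc (suc m)) (suc (suc d)) 0 ≡ ρ (suc m) (suc (suc d)) 0 + ρ (suc m) (suc d) 0
    i≡0 = trans (trans (ρ≡factorials′ (suc (suc m)) (suc (suc d)) 0 (suc e) (suc (suc d)) e1' refl)
                   (factorialShape-cong (ιℚ (suc (suc m))) (ιℚ ((suc e ℕ.+ 0) ℕ.!)) (ιℚ ((suc e ℕ.+ suc (suc d)) ℕ.!)) R0 Rdd Rs (invFact (+ suc e)) ι[2+m]≡ f4 f3 refl refl refl rE1))
      (trans (solve 7 (λ D E Fa Fb R0 Rdd Rs →
        let c : NatExpr 2 → Polynomial 7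
            c x = evalPoly x (D ∷ E ∷ [])
        in Poly.shape (c (S (S m-expr))) (c (S (ve ⊞ Z)) :* Fb) (c (S (ve ⊞ S (S vd))) :* (c (S (ve ⊞ S vd)) :* Fa)) R0 Rdd Rs (c (S (S ve)) :* Rs)
          := (Poly.shape (c (S m-expr)) Fb (c (S (ve ⊞ S vd)) :* Fa) R0 Rdd (c (S (S ve)) :* Rs) (c (S ve) :* (c (S (S ve)) :* Rs))
             :+ Poly.shape (c (S m-expr)) (c (S (ve ⊞ Z)) :* Fb) (c (S (ve ⊞ S vd)) :* Fa) R0 (c (S (S vd)) :* Rdd) Rs (c (S (S ve)) :* Rs)))
        refl (ιℚ d) (ιℚ e) Fa Fb R0 Rdd Rs)
      (sym (cong₂ _+_ term₁≡ term₂≡)))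
      where
      term₁≡ = trans (ρ≡factorials′ (suc m) (suc (suc d)) 0 e (suc (suc d)) e2' refl)
             (factorialShape-cong (ιℚ (suc m)) Fb (ιℚ ((e ℕ.+ suc (suc d)) ℕ.!)) R0 Rdd (invFact (+ suc e)) (invFact (+ e)) ι[1+m]≡ refl f2 refl refl rE1 rE0)
      term₂≡ = trans (ρ≡factorials′ (suc m) (suc d) 0 (suc e) (suc d) e3' refl)
             (factorialShape-cong (ιℚ (suc m)) (ιℚ ((suc e ℕ.+ 0) ℕ.!)) (ιℚ ((suc e ℕ.+ suc d) ℕ.!)) R0 (invFact (+ suc d)) Rs (invFact (+ suc e)) ι[1+m]≡ f4 f1 refl rD refl rE1)

  tpow-below : ∀ n i → i < n → tpow n i ≡ 0ℚ
  tpow-below (suc n) zero _ = refl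
  tpow-below (suc n) (suc i) (s≤s i<n) = tpow-below n i i<n

  tpow-at : ∀ n → tpow n n ≡ 1ℚ
  tpow-at zero = refl
  tpow-at (suc n) = tpow-at n

  tpow-above : ∀ n i → n < i → tpow n i ≡ 0ℚ
  tpow-above zero (suc i) _ = refl
  tpow-above (suc n) (suc i) (s≤s n<i) = tpow-above n i n<i

  ρ-subtop′ : ∀ i r → ρ (suc (i ℕ.+ r)) (i ℕ.+ r) i ≡ ιℚ (suc (i ℕ.+ r))
  ρ-subtop′ i r = trans (ρ≡factorials (suc (i ℕ.+ r)) 0 i r refl)
    (trans (solve 7 (λ M Fi Fr Ri Rr A B → (M :* ((Fi :* Fr) :* (((Ri :* Rr) :* A) :* B))) := (M :* (((Ri :* Fi) :* (Rr :* Fr)) :* (A :* B))))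
             refl (ιℚ (suc (i ℕ.+ r))) (ιℚ (i ℕ.!)) (ιℚ (r ℕ.!)) (invFact (+ i)) (invFact (+ r)) (invFact (+ 1)) (invFact (+ 0)))
    (trans (cong₂ (λ x y → ιℚ (suc (i ℕ.+ r)) * ((x * y) * (1ℚ * 1ℚ))) (invFact-*-fact i) (invFact-*-fact r)) (ℚP.*-identityʳ _)))

  ρ-subtop : ∀ d i → i ≤ d → ρ (suc d) d i ≡ ιℚ (suc d)
  ρ-subtop d i i≤d = ≡.subst (λ x → ρ (suc x) x i ≡ ιℚ (suc x)) (ℕP.m+[n∸m]≡n i≤d) (ρ-subtop′ i (d ∸ i))

  ρ-d0-i0 : ∀ n → ρ (suc n) 0 0 ≡ 1ℚ
  ρ-d0-i0 n = trans (ρ≡factorials (suc n) n 0 0 (cong suc (sym (ℕP.+-identityʳ n))))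
    (trans (cong (λ x → ιℚ (suc n) * ((ιℚ (x ℕ.!) * ιℚ (x ℕ.!)) * (((invFact (+ 0) * invFact (+ 0)) * invFact (+ suc n)) * invFact (+ n)))) (ℕP.+-identityʳ n))
    (trans (solve 5 (λ M F A B C → (M :* ((F :* F) :* (((C :* C) :* A) :* B))) := (((A :* (M :* F)) :* (B :* F)) :* (C :* C)))
             refl (ιℚ (suc n)) (ιℚ (n ℕ.!)) (invFact (+ suc n)) (invFact (+ n)) (invFact (+ 0)))
    (trans (cong₂ (λ x y → (x * y) * (invFact (+ 0) * invFact (+ 0))) (trans (cong (invFact (+ suc n) *_) (sym (fact-suc n))) (invFact-*-fact (suc n))) (invFact-*-fact n)) refl)))

  ρ-d1-i0 : ∀ n → ρ (suc (suc n)) 1 0 ≡ ιℚ (suc (suc n))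
  ρ-d1-i0 n = trans (ρ≡factorials′ (suc (suc n)) 1 0 n 1 (cong suc (sym (ℕP.+-comm n 1))) refl)
    (trans (cong₂ (λ x y → ιℚ (suc (suc n)) * ((ιℚ (x ℕ.!) * ιℚ (y ℕ.!)) * (((invFact (+ 0) * invFact (+ 1)) * invFact (+ suc n)) * invFact (+ n)))) (ℕP.+-identityʳ n) (ℕP.+-comm n 1))
    (trans (solve 6 (λ M F G A B C → (M :* ((F :* G) :* (((C :* C) :* A) :* B))) := (M :* (((A :* G) :* (B :* F)) :* (C :* C))))
             refl (ιℚ (suc (suc n))) (ιℚ (n ℕ.!)) (ιℚ (suc n ℕ.!)) (invFact (+ suc n)) (invFact (+ n)) 1ℚ)
    (trans (cong₂ (λ x y → ιℚ (suc (suc n)) * ((x * y) * (1ℚ * 1ℚ))) (invFact-*-fact (suc n)) (invFact-*-fact n)) (ℚP.*-identityʳ _))))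

  ρ-d1-i1 : ∀ n → ρ (suc (suc n)) 1 1 ≡ ιℚ (suc (suc n))
  ρ-d1-i1 n = trans (ρ≡factorials′ (suc (suc n)) 1 1 n 0 (cong suc (sym (ℕP.+-comm n 1))) refl)
    (trans (cong₂ (λ x y → ιℚ (suc (suc n)) * ((ιℚ (x ℕ.!) * ιℚ (y ℕ.!)) * (((invFact (+ 1) * invFact (+ 0)) * invFact (+ suc n)) * invFact (+ n)))) (ℕP.+-comm n 1) (ℕP.+-identityʳ n))
    (trans (solve 6 (λ M F G A B C → (M :* ((G :* F) :* (((C :* C) :* A) :* B))) := (M :* (((A :* G) :* (B :* F)) :* (C :* C))))
             refl (ιℚ (suc (suc n))) (ιℚ (n ℕ.!)) (ιℚ (suc n ℕ.!)) (invFact (+ suc n)) (invFact (+ n)) 1ℚ)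
    (trans (cong₂ (λ x y → ιℚ (suc (suc n)) * ((x * y) * (1ℚ * 1ℚ))) (invFact-*-fact (suc n)) (invFact-*-fact n)) (ℚP.*-identityʳ _))))

  ρ-d1-i0′ : ∀ n → ρ (suc n) 1 0 ≡ ιℚ (suc n)
  ρ-d1-i0′ zero = ρ-top 1 0
  ρ-d1-i0′ (suc n) = ρ-d1-i0 n

  ρ-d1-i1′ : ∀ n → ρ (suc n) 1 1 ≡ ιℚ (suc n)
  ρ-d1-i1′ zero = ρ-top 1 1
  ρ-d1-i1′ (suc n) = ρ-d1-i1 n

  ρ-recurrence-d0 : ∀ m i → ρ (suc (suc m)) 0 i ≡ ρ (suc m) 0 i
  ρ-recurrence-d0 m zero = trans (ρ-d0-i0 (suc m)) (sym (ρ-d0-i0 m))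
  ρ-recurrence-d0 m (suc i) = trans (ρ-above-diagonal (suc (suc m)) 0 (suc i) (s≤s z≤n) (s≤s z≤n)) (sym (ρ-above-diagonal (suc m) 0 (suc i) (s≤s z≤n) (s≤s z≤n)))

  ρ-recurrence-d1-i0 : ∀ m → ρ (suc (suc m)) 1 0 ≡ ρ (suc m) 1 0 + ρ (suc m) 0 0
  ρ-recurrence-d1-i0 m = trans (ρ-d1-i0 m) (trans (trans (ιℚ-suc (suc m)) (ℚP.+-comm 1ℚ (ιℚ (suc m)))) (sym (cong₂ _+_ (ρ-d1-i0′ m) (ρ-d0-i0 m))))

  ρ-recurrence-d1 : ∀ m i → ρ (suc (suc m)) 1 (suc i) ≡ (ρ (suc m) 1 (suc i) + ρ (suc m) 0 (suc i)) + ρ (suc m) 0 i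
  ρ-recurrence-d1 m zero = trans (ρ-d1-i1 m) (trans (trans (ιℚ-suc (suc m)) (trans (ℚP.+-comm 1ℚ (ιℚ (suc m))) (cong (_+ 1ℚ) (sym (ℚP.+-identityʳ (ιℚ (suc m)))))))
     (sym (cong₂ _+_ (cong₂ _+_ (ρ-d1-i1′ m) (ρ-above-diagonal (suc m) 0 1 (s≤s z≤n) (s≤s z≤n))) (ρ-d0-i0 m))))
  ρ-recurrence-d1 zero (suc i) = trans (ρ-above-diagonal 2 1 (suc (suc i)) (s≤s (s≤s z≤n)) (s≤s (s≤s z≤n)))
     (sym (cong₂ _+_ (cong₂ _+_ (ρ-top 1 (suc (suc i))) (ρ-above-diagonal 1 0 (suc (suc i)) (s≤s z≤n) (s≤s z≤n))) (ρ-above-diagonal 1 0 (suc i) (s≤s z≤n) (s≤s z≤n))))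
  ρ-recurrence-d1 (suc m) (suc i) = trans (ρ-above-diagonal (suc (suc (suc m))) 1 (suc (suc i)) (s≤s (s≤s z≤n)) (s≤s (s≤s z≤n)))
     (sym (cong₂ _+_ (cong₂ _+_ (ρ-above-diagonal (suc (suc m)) 1 (suc (suc i)) (s≤s (s≤s z≤n)) (s≤s (s≤s z≤n))) (ρ-above-diagonal (suc (suc m)) 0 (suc (suc i)) (s≤s z≤n) (s≤s z≤n))) (ρ-above-diagonal (suc (suc m)) 0 (suc i) (s≤s z≤n) (s≤s z≤n))))

  Recurrence₀ : ℕ → ℕ → Set
  Recurrence₀ m d = ρ (suc (suc m)) (suc (suc d)) 0 ≡ ρ (suc m) (suc (suc d)) 0 + ρ (suc m) (suc d) 0

  Recurrence : ℕ → ℕ → ℕ → Set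
  Recurrence m d i = ρ (suc (suc m)) (suc (suc d)) (suc i) ≡ ((ρ (suc m) (suc (suc d)) (suc i) + ρ (suc m) (suc d) (suc i)) + ρ (suc m) (suc d) i) + ℚ.- ρ m d i

  boundary-recurrence₀ : ∀ m d e → m ≡ suc (suc (d ℕ.+ e)) → Recurrence₀ m d
  boundary-recurrence₀ .(suc (suc (d ℕ.+ e))) d e refl = BoundaryRecurrence.i≡0 d e

  interior-recurrence : ∀ m d i r e → d ≡ i ℕ.+ r → m ≡ suc (suc (d ℕ.+ e)) → Recurrence m d i
  interior-recurrence .(suc (suc ((i ℕ.+ r) ℕ.+ e))) .(i ℕ.+ r) i r e refl refl = InteriorRecurrence.interior i r e

  boundary-recurrence : ∀ m d e → m ≡ suc (suc (d ℕ.+ e)) → Recurrence m d (suc d)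
  boundary-recurrence .(suc (suc (d ℕ.+ e))) d e refl = BoundaryRecurrence.i≡d+1 d e

  m≡2+d+[m-2-d] : ∀ m d → suc d < m → m ≡ suc (suc (d ℕ.+ (m ∸ suc (suc d))))
  m≡2+d+[m-2-d] m d lt = sym (ℕP.m+[n∸m]≡n lt)

  ρ-recurrence₀ : ∀ m d → Recurrence₀ m d
  ρ-recurrence₀ m d with ℕP.<-cmp d m
  ... | tri> _ _ m<d = trans (ρ-beyond-top _ _ 0 (s≤s (s≤s m<d))) (sym (cong₂ _+_ (ρ-beyond-top _ _ 0 (s≤s (ℕP.≤-trans m<d (ℕP.n≤1+n _)))) (ρ-beyond-top _ _ 0 (s≤s m<d))))
  ... | tri≈ _ refl _ = trans (ρ-top (suc (suc d)) 0) (sym (cong₂ _+_ (ρ-beyond-top (suc d) (suc (suc d)) 0 ℕP.≤-refl) (ρ-top (suc d) 0)))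
  ... | tri< d<m _ _ with ℕP.m≤n⇒m<n∨m≡n d<m
  ...   | inj₂ refl = trans (ρ-subtop (suc (suc d)) 0 z≤n) (trans (trans (ιℚ-suc (suc (suc d))) (cong (_+ ιℚ (suc (suc d))) (sym (ρ-top (suc (suc d)) 0))))
                         (cong (ρ (suc (suc d)) (suc (suc d)) 0 ℚ.+_) (sym (ρ-subtop (suc d) 0 z≤n))))
  ...   | inj₁ sd<m = boundary-recurrence₀ m d (m ∸ suc (suc d)) (m≡2+d+[m-2-d] m d sd<m)

  ρ-recurrence : ∀ m d i → Recurrence m d i
  ρ-recurrence m d i with ℕP.<-cmp d m
  ... | tri> _ _ m<d = trans (ρ-beyond-top _ _ _ (s≤s (s≤s m<d)))
        (sym (cong₂ (λ x y → x + ℚ.- y) (cong₂ _+_ (cong₂ _+_ (ρ-beyond-top _ _ _ (s≤s (ℕP.≤-trans m<d (ℕP.n≤1+n _)))) (ρ-beyond-top _ _ _ (s≤s m<d))) (ρ-beyond-top _ _ _ (s≤s m<d))) (ρ-beyond-top _ _ _ m<d)))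
  ... | tri≈ _ refl _ = trans (ρ-top (suc (suc d)) (suc i))
        (trans (solve 3 (λ U X0 X1 → (con (+ 0) :+ X1) := ((((con (+ 0) :+ (con (+ 0) :+ X0)) :+ (U :+ X1)) :+ (:- (U :+ X0))))) refl (T.1s i) (tpow d i) (tpow (suc d) i))
        (sym (cong₂ (λ x y → x + ℚ.- y) (cong₂ _+_ (cong₂ _+_ (trans (ρ-beyond-top (suc d) (suc (suc d)) (suc i) ℕP.≤-refl) refl) (ρ-top (suc d) (suc i))) (ρ-top (suc d) i)) (ρ-top d i))))
  ... | tri< d<m _ _ with ℕP.m≤n⇒m<n∨m≡n d<m
  ...   | inj₁ sd<m with ℕP.<-cmp i (suc d)
  ...     | tri< i<sd _ _ = interior-recurrence m d i (d ∸ i) (m ∸ suc (suc d)) (sym (ℕP.m+[n∸m]≡n (ℕP.≤-pred i<sd))) (m≡2+d+[m-2-d] m d sd<m)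
  ...     | tri≈ _ refl _ = boundary-recurrence m d (m ∸ suc (suc d)) (m≡2+d+[m-2-d] m d sd<m)
  ...     | tri> _ _ sd<i = trans (ρ-above-diagonal _ _ _ (s≤s (s≤s d<m)) (s≤s sd<i))
           (sym (cong₂ (λ x y → x + ℚ.- y) (cong₂ _+_ (cong₂ _+_ (ρ-above-diagonal _ _ _ (s≤s sd<m) (s≤s sd<i)) (ρ-above-diagonal _ _ _ (s≤s d<m) (s≤s (ℕP.<⇒≤ sd<i))))
                   (ρ-above-diagonal _ _ _ (s≤s d<m) sd<i)) (ρ-above-diagonal _ _ _ d<m (ℕP.<-trans (ℕP.n<1+n d) sd<i))))
  ρ-recurrence .(suc d) d i | tri< d<m _ _ | inj₂ refl with ℕP.<-cmp i (suc d)
  ... | tri< i<sd _ _ = trans (ρ-subtop (suc (suc d)) (suc i) (s≤s (ℕP.<⇒≤ i<sd)))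
        (trans (trans (ιℚ-suc (suc (suc d))) (cong (1ℚ ℚ.+_) (ιℚ-suc (suc d))))
        (trans (solve 1 (λ X → (con (+ 1) :+ (con (+ 1) :+ X)) := ((((con (+ 0) :+ con (+ 0)) :+ (con (+ 1) :+ X)) :+ (con (+ 1) :+ X)) :+ (:- X))) refl (ιℚ (suc d)))
        (sym (cong₂ (λ x y → x + ℚ.- y) (cong₂ _+_ (cong₂ _+_ (trans (ρ-top (suc (suc d)) (suc i)) (cong (0ℚ ℚ.+_) (tpow-below (suc d) i i<sd)))
                   (trans (ρ-subtop (suc d) (suc i) i<sd) (ιℚ-suc (suc d)))) (trans (ρ-subtop (suc d) i (ℕP.<⇒≤ i<sd)) (ιℚ-suc (suc d))))
                (ρ-subtop d i (ℕP.≤-pred i<sd))))))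
  ... | tri≈ _ refl _ = trans (ρ-subtop (suc (suc d)) (suc (suc d)) ℕP.≤-refl)
        (trans (ιℚ-suc (suc (suc d)))
        (trans (solve 1 (λ X → (con (+ 1) :+ X) := (((((con (+ 0) :+ con (+ 1)) :+ con (+ 0)) :+ X) :+ (:- con (+ 0))))) refl (ιℚ (suc (suc d))))
        (sym (cong₂ (λ x y → x + ℚ.- y) (cong₂ _+_ (cong₂ _+_ (trans (ρ-top (suc (suc d)) (suc (suc d))) (cong (0ℚ ℚ.+_) (tpow-at (suc d))))
                   (ρ-above-diagonal (suc (suc d)) (suc d) (suc (suc d)) ℕP.≤-refl ℕP.≤-refl)) (ρ-subtop (suc d) (suc d) ℕP.≤-refl))
                (ρ-above-diagonal (suc d) d (suc d) ℕP.≤-refl ℕP.≤-refl)))))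
  ... | tri> _ _ sd<i = trans (ρ-above-diagonal (suc (suc (suc d))) (suc (suc d)) (suc i) ℕP.≤-refl (s≤s sd<i))
        (sym (cong₂ (λ x y → x + ℚ.- y) (cong₂ _+_ (cong₂ _+_ (trans (ρ-top (suc (suc d)) (suc i)) (cong (0ℚ ℚ.+_) (tpow-above (suc d) i sd<i)))
                   (ρ-above-diagonal (suc (suc d)) (suc d) (suc i) ℕP.≤-refl (s≤s (ℕP.<⇒≤ sd<i)))) (ρ-above-diagonal (suc (suc d)) (suc d) i ℕP.≤-refl sd<i))
                (ρ-above-diagonal (suc d) d i ℕP.≤-refl (ℕP.<-trans (ℕP.n<1+n d) sd<i))))

module NegatedFactorProducts (V : TSer) where
  open ℚ[[t]]-Solver using (solve; _:=_; _:+_; _:-_; :-_; _:*_; con)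
  open ≡ using (trans)
  private
    [-1-t]⊗V≈ : ((T.⊖ 1+t) T.⊗ V) ≈T ((T.⊖ V) T.⊕ (t T.⊗ (T.⊖ V)))
    [-1-t]⊗V≈ = solve 2 (λ t v → (:- (con (+ 1) :+ t)) :* v
                                            := :- v :+ t :* (:- v))
                  TRing.refl t V
    [-t]⊗V≈ : ((T.⊖ t) T.⊗ V) ≈T (T.0s T.⊕ (t T.⊗ (T.⊖ V)))
    [-t]⊗V≈ = solve 2 (λ t v → (:- t) :* v
                                          := con (+ 0) :+ t :* (:- v))
                TRing.refl t V

  [-1-t]⊗-coefficient₀ : ((T.⊖ 1+t) T.⊗ V) 0 ≡ ℚ.- V 0
  [-1-t]⊗-coefficient₀ = trans ([-1-t]⊗V≈ 0) (t-Horner₀ (T.⊖ V) (T.⊖ V))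

  [-1-t]⊗-coefficient : ∀ i → ((T.⊖ 1+t) T.⊗ V) (suc i) ≡ ℚ.- V (suc i) ℚ.+ ℚ.- V i
  [-1-t]⊗-coefficient i = trans ([-1-t]⊗V≈ (suc i)) (t-Horner (T.⊖ V) (T.⊖ V) i)

  [-t]⊗-coefficient₀ : ((T.⊖ t) T.⊗ V) 0 ≡ 0ℚ
  [-t]⊗-coefficient₀ = trans ([-t]⊗V≈ 0) (t-Horner₀ T.0s (T.⊖ V))

  [-t]⊗-coefficient : ∀ i → ((T.⊖ t) T.⊗ V) (suc i) ≡ 0ℚ ℚ.+ ℚ.- V i
  [-t]⊗-coefficient i = trans ([-t]⊗V≈ (suc i)) (t-Horner T.0s (T.⊖ V) i)

module RecurrenceHorner where
  open Shape using (s)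
  open ≡ using (trans; cong; cong₂)

  p : QSer
  p = t̂ Q.⊗ (q Q.⊗ q)

  recurrenceᴴ : QSer → QSer → QSer
  recurrenceᴴ X Y = X Q.⊕ (q Q.⊗ ((Q.const (T.⊖ 1+t) Q.⊗ X) Q.⊕ (q Q.⊗ (Q.const (T.⊖ t) Q.⊗ Y))))

  recurrence≈ᴴ : ∀ X Y → ((s Q.⊗ X) Q.⊕ (Q.⊖ (p Q.⊗ Y))) ≈Q recurrenceᴴ X Y
  recurrence≈ᴴ X Y = QRing.trans
    (solve 4 (λ q t x y → (con (+ 1) :- (con (+ 1) :+ t) :* q) :* x :- t :* (q :* q) :* y
                          := x :+ q :* ((:- (con (+ 1) :+ t)) :* x :+ q :* ((:- t) :* y))) QRing.refl q t̂ X Y)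
    (QRing.+-congˡ {X} (QRing.*-congˡ {q} (QRing.+-cong (QRing.*-congʳ {X} (QRing.sym c[-1-t]))
                                                         (QRing.*-congˡ {q} (QRing.*-congʳ {Y} (QRing.sym (constᵠ-⊖ t)))))))
    where
    open ℚ[[t]][[q]]-Solver using (solve; _:=_; _:+_; _:-_; :-_; _:*_; con)
    c[-1-t] : Q.const (T.⊖ 1+t) ≈Q (Q.⊖ (ιQ 1 Q.⊕ t̂))
    c[-1-t] = QRing.trans (constᵠ-⊖ 1+t) (QRing.-‿cong (QRing.trans (constᵠ-⊕ T.1s t) (QRing.+-cong constᵠ-1 (QRing.refl {t̂}))))

  private
    R₁ : QSer → QSer → QSer
    R₁ X Y = (Q.const (T.⊖ 1+t) Q.⊗ X) Q.⊕ (q Q.⊗ (Q.const (T.⊖ t) Q.⊗ Y))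

  recurrenceᴴ-coefficient₀ : ∀ X Y → recurrenceᴴ X Y 0 ≈T X 0
  recurrenceᴴ-coefficient₀ X Y = q-Horner₀ X (R₁ X Y)

  recurrenceᴴ-coefficient₁ : ∀ X Y i → recurrenceᴴ X Y 1 i ≡ X 1 i ℚ.+ ((T.⊖ 1+t) T.⊗ X 0) i
  recurrenceᴴ-coefficient₁ X Y i = trans (q-Horner X (R₁ X Y) 0 i)
    (cong (X 1 i ℚ.+_) (trans (q-Horner₀ (Q.const (T.⊖ 1+t) Q.⊗ X) (Q.const (T.⊖ t) Q.⊗ Y) i) (QP.const-⊗ (T.⊖ 1+t) X 0 i)))

  recurrenceᴴ-coefficient₂₊ : ∀ X Y d i → recurrenceᴴ X Y (2 ℕ.+ d) i ≡
    X (2 ℕ.+ d) i ℚ.+ (((T.⊖ 1+t) T.⊗ X (1 ℕ.+ d)) i ℚ.+ ((T.⊖ t) T.⊗ Y d) i)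
  recurrenceᴴ-coefficient₂₊ X Y d i = trans (q-Horner X (R₁ X Y) (suc d) i)
    (cong (X (2 ℕ.+ d) i ℚ.+_) (trans (q-Horner (Q.const (T.⊖ 1+t) Q.⊗ X) (Q.const (T.⊖ t) Q.⊗ Y) d i)
      (cong₂ ℚ._+_ (QP.const-⊗ (T.⊖ 1+t) X (suc d) i) (QP.const-⊗ (T.⊖ t) Y d i))))

module BetaRecurrence where
  open RecurrenceHorner
  open RhoRecurrence
  open InverseFactorials.ℚ-Solver using (solve; _:=_; _:+_; _:-_; :-_; _:*_; con)
  open Shape using (s)
  open ≡ using (refl; trans; sym; cong; cong₂)

  β≡sgn*ρ : ∀ m d i → β m d i ≡ sgn d ℚ.* ρ m d i
  β≡sgn*ρ m d i with d ℕ.≤? m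
  ... | yes _ = refl
  ... | no d≰m = sym (trans (cong (sgn d ℚ.*_) (ρ-beyond-top m d i (ℕP.≰⇒> d≰m))) (ℚP.*-zeroʳ (sgn d)))

  β-recurrence-coefficient : ∀ m d i → β (2 ℕ.+ m) d i ≡ recurrenceᴴ (β (1 ℕ.+ m)) (β m) d i
  β-recurrence-coefficient m zero i =
    trans (β≡sgn*ρ (2 ℕ.+ m) 0 i) (trans (cong (1ℚ ℚ.*_) (ρ-recurrence-d0 m i))
      (trans (sym (β≡sgn*ρ (1 ℕ.+ m) 0 i)) (sym (recurrenceᴴ-coefficient₀ (β (1 ℕ.+ m)) (β m) i))))
  β-recurrence-coefficient m (suc zero) zero =
    trans (β≡sgn*ρ (2 ℕ.+ m) 1 0) (trans (cong (ℚ.- 1ℚ ℚ.*_) (ρ-recurrence-d1-i0 m))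
      (trans (solve 2 (λ a b → (:- con (+ 1)) :* (a :+ b) := (:- con (+ 1)) :* a :+ :- (con (+ 1) :* b)) refl
                      (ρ (1 ℕ.+ m) 1 0) (ρ (1 ℕ.+ m) 0 0))
        (sym (trans (recurrenceᴴ-coefficient₁ (β (1 ℕ.+ m)) (β m) 0)
          (cong₂ ℚ._+_ (β≡sgn*ρ (1 ℕ.+ m) 1 0) (trans (NegatedFactorProducts.[-1-t]⊗-coefficient₀ (β (1 ℕ.+ m) 0))
                                                     (cong ℚ.-_ (β≡sgn*ρ (1 ℕ.+ m) 0 0))))))))
  β-recurrence-coefficient m (suc zero) (suc i) =
    trans (β≡sgn*ρ (2 ℕ.+ m) 1 (suc i)) (trans (cong (ℚ.- 1ℚ ℚ.*_) (ρ-recurrence-d1 m i))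
      (trans (solve 3 (λ a b c → (:- con (+ 1)) :* (a :+ b :+ c) := (:- con (+ 1)) :* a :+ (:- (con (+ 1) :* b) :+ :- (con (+ 1) :* c)))
                      refl (ρ (1 ℕ.+ m) 1 (suc i)) (ρ (1 ℕ.+ m) 0 (suc i)) (ρ (1 ℕ.+ m) 0 i))
        (sym (trans (recurrenceᴴ-coefficient₁ (β (1 ℕ.+ m)) (β m) (suc i))
          (cong₂ ℚ._+_ (β≡sgn*ρ (1 ℕ.+ m) 1 (suc i))
            (trans (NegatedFactorProducts.[-1-t]⊗-coefficient (β (1 ℕ.+ m) 0) i)
              (cong₂ ℚ._+_ (cong ℚ.-_ (β≡sgn*ρ (1 ℕ.+ m) 0 (suc i))) (cong ℚ.-_ (β≡sgn*ρ (1 ℕ.+ m) 0 i)))))))))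
  β-recurrence-coefficient m (suc (suc d)) zero =
    trans (β≡sgn*ρ (2 ℕ.+ m) (2 ℕ.+ d) 0) (trans (cong (sgn (2 ℕ.+ d) ℚ.*_) (ρ-recurrence₀ m d))
      (trans (solve 3 (λ σ a b → (:- (:- σ)) :* (a :+ b) := (:- (:- σ)) :* a :+ (:- ((:- σ) :* b) :+ con (+ 0))) refl
                      (sgn d) (ρ (1 ℕ.+ m) (2 ℕ.+ d) 0) (ρ (1 ℕ.+ m) (1 ℕ.+ d) 0))
        (sym (trans (recurrenceᴴ-coefficient₂₊ (β (1 ℕ.+ m)) (β m) d 0)
          (cong₂ ℚ._+_ (β≡sgn*ρ (1 ℕ.+ m) (2 ℕ.+ d) 0)
            (cong₂ ℚ._+_ (trans (NegatedFactorProducts.[-1-t]⊗-coefficient₀ (β (1 ℕ.+ m) (1 ℕ.+ d)))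
                                (cong ℚ.-_ (β≡sgn*ρ (1 ℕ.+ m) (1 ℕ.+ d) 0)))
                         (NegatedFactorProducts.[-t]⊗-coefficient₀ (β m d))))))))
  β-recurrence-coefficient m (suc (suc d)) (suc i) =
    trans (β≡sgn*ρ (2 ℕ.+ m) (2 ℕ.+ d) (suc i)) (trans (cong (sgn (2 ℕ.+ d) ℚ.*_) (ρ-recurrence m d i))
      (trans (solve 5 (λ σ a b c e → (:- (:- σ)) :* (a :+ b :+ c :+ :- e)
                         := (:- (:- σ)) :* a :+ ((:- ((:- σ) :* b) :+ :- ((:- σ) :* c)) :+ (con (+ 0) :+ :- (σ :* e)))) refl
                      (sgn d) (ρ (1 ℕ.+ m) (2 ℕ.+ d) (suc i)) (ρ (1 ℕ.+ m) (1 ℕ.+ d) (suc i)) (ρ (1 ℕ.+ m) (1 ℕ.+ d) i) (ρ m d i))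
        (sym (trans (recurrenceᴴ-coefficient₂₊ (β (1 ℕ.+ m)) (β m) d (suc i))
          (cong₂ ℚ._+_ (β≡sgn*ρ (1 ℕ.+ m) (2 ℕ.+ d) (suc i))
            (cong₂ ℚ._+_
              (trans (NegatedFactorProducts.[-1-t]⊗-coefficient (β (1 ℕ.+ m) (1 ℕ.+ d)) i)
                (cong₂ ℚ._+_ (cong ℚ.-_ (β≡sgn*ρ (1 ℕ.+ m) (1 ℕ.+ d) (suc i))) (cong ℚ.-_ (β≡sgn*ρ (1 ℕ.+ m) (1 ℕ.+ d) i))))
              (trans (NegatedFactorProducts.[-t]⊗-coefficient (β m d) i) (cong (λ x → 0ℚ ℚ.+ ℚ.- x) (β≡sgn*ρ m d i)))))))))

  β-recurrence : ∀ m → β (2 ℕ.+ m) ≈Q ((s Q.⊗ β (1 ℕ.+ m)) Q.⊕ (Q.⊖ (p Q.⊗ β m)))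
  β-recurrence m = QRing.trans (β-recurrence-coefficient m) (QRing.sym (recurrence≈ᴴ (β (1 ℕ.+ m)) (β m)))

module SecondOrderRecurrence (R : CommutativeRing 0ℓ 0ℓ) (s p : CommutativeRing.Carrier R) where
  open CommutativeRing R
  open import Data.Product using (_×_; proj₁)

  Solves : (ℕ → Carrier) → Set
  Solves u = ∀ m → u (2 ℕ.+ m) ≈ s * u (1 ℕ.+ m) - p * u m

  solution-unique : ∀ {u v} → Solves u → Solves v → u 0 ≈ v 0 → u 1 ≈ v 1 → ∀ m → u m ≈ v m
  solution-unique {u} {v} u-rec v-rec u₀≈v₀ u₁≈v₁ m = proj₁ (consecutive m)
    where
    consecutive : ∀ m → u m ≈ v m × u (1 ℕ.+ m) ≈ v (1 ℕ.+ m)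
    consecutive zero = u₀≈v₀ , u₁≈v₁
    consecutive (suc m) with consecutive m
    ... | uₘ≈vₘ , uₘ₊₁≈vₘ₊₁ = uₘ₊₁≈vₘ₊₁ ,
      trans (u-rec m) (trans (+-cong (*-congˡ uₘ₊₁≈vₘ₊₁) (-‿cong (*-congˡ uₘ≈vₘ))) (sym (v-rec m)))

module PowerSum where
  open Shape using (s; b)
  open QuadraticEquation using (a; a⊗z≈1)
  open RecurrenceHorner using (p)
  open BetaRecurrence using (β-recurrence)
  open RhoRecurrence using (ρ-d0-i0; ρ-above-diagonal; ρ-top)
  open ℚ[[t]][[q]]-Solver using (solve; _:=_; _:+_; _:-_; :-_; _:*_; con)
  open SecondOrderRecurrence ℚ[[t]][[q]] s p

  powerSum : ℕ → QSer
  powerSum m = (a Q.^s m) Q.⊕ (b Q.^s m)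

  a⊕b≈s : (a Q.⊕ b) ≈Q s
  a⊕b≈s = solve 2 (λ s b → s :- b :+ b := s) QRing.refl s b

  a⊗b≈p : (a Q.⊗ b) ≈Q p
  a⊗b≈p = QRing.trans (solve 4 (λ a t q z → a :* (t :* (q :* (q :* z))) := t :* (q :* (q :* (a :* z)))) QRing.refl a t̂ q z)
    (QRing.*-congˡ {t̂} (QRing.*-congˡ {q} (QRing.trans (QRing.*-congˡ {q} a⊗z≈1) (QRing.*-identityʳ q))))

  powerSum-recurrence : Solves powerSum
  powerSum-recurrence m = QRing.trans
    (solve 4 (λ a b A B → a :* (a :* A) :+ b :* (b :* B) := (a :+ b) :* (a :* A :+ b :* B) :- (a :* b) :* (A :+ B))
      QRing.refl a b (a Q.^s m) (b Q.^s m))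
    (QRing.+-cong (QRing.*-congʳ {powerSum (1 ℕ.+ m)} a⊕b≈s) (QRing.-‿cong (QRing.*-congʳ {powerSum m} a⊗b≈p)))

  β₀≈ : β 0 ≈Q powerSum 0
  β₀≈ zero i = ℚP.*-identityˡ (T.1s i ℚ.+ T.1s i)
  β₀≈ (suc d) i = ≡.refl

  β₁≈ : β 1 ≈Q powerSum 1
  β₁≈ = QRing.trans β₁≈s (QRing.trans (QRing.sym a⊕b≈s) (QRing.sym (QRing.+-cong (QRing.*-identityʳ a) (QRing.*-identityʳ b))))
    where
    sᴴ : QSer
    sᴴ = Q.1s Q.⊕ (q Q.⊗ Q.const (T.⊖ 1+t))
    β₁≈sᴴ : β 1 ≈Q sᴴ
    β₁≈sᴴ zero zero = ≡.trans (≡.cong (1ℚ ℚ.*_) (ρ-d0-i0 0)) (≡.sym (q-Horner₀ Q.1s (Q.const (T.⊖ 1+t)) 0))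
    β₁≈sᴴ zero (suc i) = ≡.trans (≡.cong (1ℚ ℚ.*_) (ρ-above-diagonal 1 0 (suc i) (s≤s z≤n) (s≤s z≤n))) (≡.sym (q-Horner₀ Q.1s (Q.const (T.⊖ 1+t)) (suc i)))
    β₁≈sᴴ (suc zero) i = ≡.trans (≡.cong (ℚ.- 1ℚ ℚ.*_) (ρ-top 1 i))
      (≡.trans (InverseFactorials.ℚ-Solver.solve 1 (λ x → (IF.:- IF.con (+ 1)) IF.:* x IF.:= IF.con (+ 0) IF.:+ IF.:- x) ≡.refl ((T.1s T.⊕ tpow 1) i))
        (≡.sym (q-Horner Q.1s (Q.const (T.⊖ 1+t)) 0 i)))
      where module IF = InverseFactorials.ℚ-Solver
    β₁≈sᴴ (suc (suc d)) i = ≡.sym (q-Horner Q.1s (Q.const (T.⊖ 1+t)) (suc d) i)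
    β₁≈s : β 1 ≈Q s
    β₁≈s = QRing.trans β₁≈sᴴ (QRing.trans (QRing.+-congˡ {Q.1s} (QRing.*-congˡ {q} c[-1-t]))
      (solve 2 (λ q t → con (+ 1) :+ q :* (:- (con (+ 1) :+ t)) := con (+ 1) :- (con (+ 1) :+ t) :* q) QRing.refl q t̂))
      where
      c[-1-t] : Q.const (T.⊖ 1+t) ≈Q (Q.⊖ (ιQ 1 Q.⊕ t̂))
      c[-1-t] = QRing.trans (constᵠ-⊖ 1+t) (QRing.-‿cong (QRing.trans (constᵠ-⊕ T.1s t) (QRing.+-cong constᵠ-1 (QRing.refl {t̂}))))

  β≈powerSum : ∀ m → β m ≈Q powerSum m
  β≈powerSum = solution-unique β-recurrence powerSum-recurrence β₀≈ β₁≈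

shiftBy-at-0 : ∀ e X → 1 ≤ e → Q.shiftBy e X 0 ≈T T.0s
shiftBy-at-0 (suc e) X _ i = ≡.refl

module HFractionFromTails (k : ℕ → ℕ) (v : ℕ → TSer) (u : ℕ → QSer) (F : ℕ → QSer)
  (tail : ∀ j → F j ≈Q Q.shiftBy (hfExp k j) (Q.const (v j) Q.⊗ Q.inv1m (F (suc j) Q.⊕ (Q.⊖ (u (suc j) Q.⊗ q))))) where

  1≤hfExp : ∀ j → 1 ≤ hfExp k (suc j)
  1≤hfExp j = ℕP.≤-trans (s≤s z≤n) (ℕP.m≤n+m 2 (k j ℕ.+ k (suc j)))

  convergent-step : ∀ {d} j {X} → QP.AgreeUpTo d X (F (suc j)) →
    QP.AgreeUpTo (hfExp k j ℕ.+ d) (Q.shiftBy (hfExp k j) (Q.const (v j) Q.⊗ Q.inv1m (X Q.⊕ (Q.⊖ (u (suc j) Q.⊗ q))))) (F j)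
  convergent-step j X≈F = QP.AgreeUpTo-trans
    (QP.AgreeUpTo-shiftBy (hfExp k j) (QP.AgreeUpTo-⊗ {f = Q.const (v j)} (λ _ _ → TRing.refl)
      (QP.AgreeUpTo-inv1m (QP.AgreeUpTo-⊕ {g = Q.⊖ (u (suc j) Q.⊗ q)} X≈F (λ _ _ → TRing.refl)))))
    (QP.≈s⇒AgreeUpTo _ (QRing.sym (tail j)))

  tail-convergents : ∀ d j → QP.AgreeUpTo d (hfConv k v u (suc j) d) (F (suc j))
  tail-convergents zero j .zero z≤n = TRing.sym (TRing.trans (tail (suc j) 0) (shiftBy-at-0 (hfExp k (suc j)) _ (1≤hfExp j)))
  tail-convergents (suc d) j =
    QP.AgreeUpTo-mono (ℕP.+-monoˡ-≤ d (1≤hfExp j)) (convergent-step (suc j) (tail-convergents d (suc j)))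

  hfEq : HFEq k v u (F 0)
  hfEq N = suc N , agree
    where
    agree : ∀ d → suc N ≤ d → hfConv k v u 0 d N ≈T F 0 N
    agree (suc d) (s≤s N≤d) = convergent-step 0 (tail-convergents d 0) N (ℕP.≤-trans N≤d (ℕP.m≤n+m d (k 0)))

module Powers where
  ^s-distrib-⊗ : ∀ X Y n → ((X Q.⊗ Y) Q.^s n) ≈Q ((X Q.^s n) Q.⊗ (Y Q.^s n))
  ^s-distrib-⊗ X Y zero = QRing.sym (QRing.*-identityˡ Q.1s)
  ^s-distrib-⊗ X Y (suc n) = QRing.trans (QRing.*-congˡ {X Q.⊗ Y} (^s-distrib-⊗ X Y n))
    (ℚ[[t]][[q]]-Solver.solve 4 (λ x y a b → (x ℚ[[t]][[q]]-Solver.:* y) ℚ[[t]][[q]]-Solver.:* (a ℚ[[t]][[q]]-Solver.:* b)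
                                      ℚ[[t]][[q]]-Solver.:= (x ℚ[[t]][[q]]-Solver.:* a) ℚ[[t]][[q]]-Solver.:* (y ℚ[[t]][[q]]-Solver.:* b))
      QRing.refl X Y (X Q.^s n) (Y Q.^s n))

  ^s-congˡ : ∀ n {X Y} → X ≈Q Y → (X Q.^s n) ≈Q (Y Q.^s n)
  ^s-congˡ zero X≈Y = QRing.refl
  ^s-congˡ (suc n) X≈Y = QRing.*-cong X≈Y (^s-congˡ n X≈Y)

  1^s : ∀ n → (Q.1s Q.^s n) ≈Q Q.1s
  1^s zero = QRing.refl
  1^s (suc n) = QRing.trans (QRing.*-congˡ {Q.1s} (1^s n)) (QRing.*-identityˡ Q.1s)

  q^s⊗ : ∀ n X → ((q Q.^s n) Q.⊗ X) ≈Q Q.shiftBy n X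
  q^s⊗ zero X = QRing.*-identityˡ X
  q^s⊗ (suc n) X = QRing.trans (QRing.*-assoc q (q Q.^s n) X)
    (QRing.trans (QRing.*-congˡ {q} (q^s⊗ n X)) (QRing.trans (QP.Xs-⊗ (Q.shiftBy n X)) (QRing.sym (QP.shiftBy-suc n X))))

  t̂^s : ∀ n → (t̂ Q.^s n) ≈Q Q.const (tpow n)
  t̂^s zero = QRing.sym constᵠ-1
  t̂^s (suc n) = QRing.trans (QRing.*-congˡ {t̂} (t̂^s n))
    (QRing.trans (QRing.sym (constᵠ-⊗ t (tpow n))) (const-cong (TRing.trans (TP.Xs-⊗ (tpow n)) (TRing.sym (TP.shiftBy-suc n T.1s)))))
    where
    const-cong : ∀ {c c′} → c ≈T c′ → Q.const c ≈Q Q.const c′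
    const-cong c≈c′ zero = c≈c′
    const-cong c≈c′ (suc n) = TRing.refl

  ⊗-shiftBy : ∀ c e X → (c Q.⊗ Q.shiftBy e X) ≈Q Q.shiftBy e (c Q.⊗ X)
  ⊗-shiftBy c e X = QRing.trans (QRing.*-comm c (Q.shiftBy e X)) (QRing.trans (QP.shiftBy-⊗ e X c) (QP.shiftBy-cong e (QRing.*-comm X c)))

module PeriodicTail (k : ℕ) (u : ℕ → QSer) (u-spec : ∀ j → 1 ≤ j → (Q.1s Q.⊕ (u j Q.⊗ qvar)) ≈Q β (suc k)) where
  open Powers
  open Shape using (b)
  open QuadraticEquation using (a; a⊗z≈1)
  open PowerSum using (β≈powerSum)
  open ℚ[[t]][[q]]-Solver using (solve; _:=_; _:+_; _:-_; :-_; _:*_; con)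

  m : ℕ
  m = suc k

  tailSeries : QSer
  tailSeries = Q.shiftBy (k ℕ.+ k ℕ.+ 2) (Q.const (tpow m) Q.⊗ (z Q.^s m))

  b^m≈tail : (b Q.^s m) ≈Q tailSeries
  b^m≈tail = QRing.trans (^s-distrib-⊗ t̂ (q Q.⊗ (q Q.⊗ z)) m)
    (QRing.trans (QRing.*-cong (t̂^s m) (QRing.trans (^s-distrib-⊗ q (q Q.⊗ z) m)
        (QRing.trans (QRing.*-congˡ {q Q.^s m} (QRing.trans (^s-distrib-⊗ q z m) (q^s⊗ m (z Q.^s m))))
          (QRing.trans (q^s⊗ m (Q.shiftBy m (z Q.^s m)))
            (QRing.trans (QRing.sym (QP.shiftBy-+ m m (z Q.^s m))) (λ n i → ≡.cong (λ e → Q.shiftBy e (z Q.^s m) n i) m+m≡))))))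
      (⊗-shiftBy (Q.const (tpow m)) (k ℕ.+ k ℕ.+ 2) (z Q.^s m)))
    where
    m+m≡ : m ℕ.+ m ≡ k ℕ.+ k ℕ.+ 2
    m+m≡ = lemma k
      where
      lemma : ∀ k → suc k ℕ.+ suc k ≡ k ℕ.+ k ℕ.+ 2
      lemma = NS.solve-∀

  tail-inverse : ∀ j → 1 ≤ j → (z Q.^s m) ≈Q Q.inv1m (tailSeries Q.⊕ (Q.⊖ (u j Q.⊗ q)))
  tail-inverse j 1≤j = QP.inv1m-unique _ (z Q.^s m) Y₀≈0 (QRing.trans
    (QRing.*-congʳ {z Q.^s m} (QRing.trans
      (solve 2 (λ g w → con (+ 1) :- (g :- w) := (con (+ 1) :+ w) :- g) QRing.refl tailSeries (u j Q.⊗ q))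
      (QRing.+-cong (QRing.trans (u-spec j 1≤j) (β≈powerSum m)) (QRing.-‿cong (QRing.sym b^m≈tail)))))
    (QRing.trans (QRing.*-congʳ {z Q.^s m} (solve 2 (λ x y → x :+ y :- y := x) QRing.refl (a Q.^s m) (b Q.^s m)))
      (QRing.trans (QRing.sym (^s-distrib-⊗ a z m)) (QRing.trans (^s-congˡ m a⊗z≈1) (1^s m)))))
    where
    Y₀≈0 : (tailSeries Q.⊕ (Q.⊖ (u j Q.⊗ q))) 0 ≈T T.0s
    Y₀≈0 i = ≡.cong₂ ℚ._+_ (shiftBy-at-0 (k ℕ.+ k ℕ.+ 2) _ (ℕP.≤-trans (s≤s z≤n) (ℕP.m≤n+m 2 (k ℕ.+ k))) i)
                           (≡.cong ℚ.-_ (≡.trans (QP.⊗-comm (u j) q 0 i) (QP.Xs-⊗ (u j) 0 i)))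

  F : ℕ → QSer
  F zero = Q.divX ((γ Q.⊕ (Q.⊖ Q.1s)) Q.^s m)
  F (suc j) = tailSeries

  γ-1≈q⊗z : (γ Q.⊕ (Q.⊖ Q.1s)) ≈Q (q Q.⊗ z)
  γ-1≈q⊗z zero i = ≡.trans (constant-term i) (≡.sym (QP.Xs-⊗ z 0 i))
    where
    constant-term : ∀ i → T.1s i ℚ.+ ℚ.- T.1s i ≡ 0ℚ
    constant-term zero = ≡.refl
    constant-term (suc i) = ≡.refl
  γ-1≈q⊗z (suc n) i = ≡.trans (ℚP.+-identityʳ (z n i)) (≡.sym (QP.Xs-⊗ z (suc n) i))

  top : F 0 ≈Q Q.shiftBy k (z Q.^s m)
  top n = QRing.trans (^s-congˡ m γ-1≈q⊗z) (QRing.trans (^s-distrib-⊗ q z m) (q^s⊗ m (z Q.^s m))) (suc n)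

  tails : ∀ j → F j ≈Q Q.shiftBy (hfExp (λ _ → m ∸ 1) j)
                  (Q.const (vSeq m j) Q.⊗ Q.inv1m (F (suc j) Q.⊕ (Q.⊖ (u (suc j) Q.⊗ q))))
  tails zero = QRing.trans top (QP.shiftBy-cong k (QRing.trans (tail-inverse 1 (s≤s z≤n))
    (QRing.sym (QRing.trans (QRing.*-congʳ {Q.inv1m (tailSeries Q.⊕ (Q.⊖ (u 1 Q.⊗ q)))} constᵠ-1)
      (QRing.*-identityˡ (Q.inv1m (tailSeries Q.⊕ (Q.⊖ (u 1 Q.⊗ q)))))))))
  tails (suc j) = QP.shiftBy-cong (k ℕ.+ k ℕ.+ 2) (QRing.*-congˡ {Q.const (tpow m)} (tail-inverse (suc (suc j)) (s≤s z≤n)))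

lemma3p4 : (m : ℕ) → 1 ≤ m →
    (u : ℕ → QSer) →
    (∀ j → 1 ≤ j → (Q.1s Q.⊕ (u j Q.⊗ qvar)) ≈Q β m) →
    HFEq (λ _ → m ∸ 1)
         (vSeq m)
         u
         (Q.divX ((γ Q.⊕ (Q.⊖ Q.1s)) Q.^s m))
lemma3p4 (suc k) _ u u-spec = HFractionFromTails.hfEq (λ _ → k) (vSeq (suc k)) u F tails
  where open PeriodicTail k u u-spec using (F; tails)
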